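{- (1) Let $r\ge4$ and let $S$ be the Steiner triple system formed by the supports of the weight-three codewords of the binary Hamming code of length $2^r-1$. Then $m(2,\Gamma_S)=3$. (2) Let $p$ be an odd prime and let $S$ be the original Bose Steiner triple system of order $3p$ constructed from the Latin square of $\mathbb Z_p$. Then $S$ has a $3$-flow or a $2$-flow.
   Context: A Steiner triple system (STS) of order $n$ is a collection $S$ of $3$-subsets (blocks) of an $n$-set such that every $2$-subset lies in exactly one block. The Hamming STS of order $2^r-1$ has as points the nonzero vectors of $\mathbb F_2^r$ and as blocks the triples $\{x,y,x+y\}$. The Bose STS of order $3p$ has point set $\mathbb Z_p\times\{0,1,2\}$ and blocks $\{(x,0),(x,1),(x,2)\}$ for $x\in\mathbb Z_p$ and $\{(x,i),(y,i),(\frac{x+y}{2},i+1)\}$ for $x\ne y\in\mathbb Z_p$, $i\in\mathbb Z_3$ (using the idempotent commutative Latin square $x\circ y=(x+y)/2$ of $\mathbb Z_p$). The block graph $\Gamma_S$ has the blocks as vertices, distinct blocks adjacent iff they intersect; its eigenvalues are $\theta_0>\theta_1>\theta_2=-3$. With $W_S$ the point–block incidence matrix, a nowhere-zero integer vector $u$ with $W_Su=0$ is a $(\|u\|_\infty+1)$-flow; "$S$ has a $k$-flow" means such $u$ with $\|u\|_\infty+1=k$. $m(2,\Gamma_S)=\min\{\|u\|_\infty+1: u\text{ a nowhere-zero integer }\theta_2(\Gamma_S)\text{ -eigenvector}\}$, and nowhere-zero integer $\theta_2$-eigenvectors of $\Gamma_S$ are exactly the flows of $S$. -}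

module Defs where

open import Data.Bool using (Bool; true; false; if_then_else_; _∧_; _xor_)
open import Data.Nat using (ℕ; zero; suc; _<ᵇ_; _≤_; _<_; NonZero; _/_)
  renaming (_+_ to _+ℕ_; _*_ to _*ℕ_)
open import Data.Nat.DivMod using (_mod_)
open import Data.Nat.Primality using (Prime; prime⇒nonZero)
open import Data.Integer using (ℤ; +_; ∣_∣; _+_; _*_; -_)
open import Data.Fin using (Fin; zero; suc; toℕ; _≟_)
open import Data.Vec using (Vec; []; _∷_; zipWith)
open import Data.List using (List; []; _∷_; [_]; _++_; concatMap; map; allFin; length; lookup)
open import Data.Product using (_×_; _,_; ∃; Σ)
open import Data.Sum using (_⊎_)
open import Data.Empty using (⊥)
open import Relation.Binary.PropositionalEquality using (_≡_; _≢_)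
open import Relation.Binary.Definitions using (DecidableEquality)
open import Relation.Nullary using (¬_; Dec; yes; no)
import Data.Vec.Properties as VecP
import Data.Product.Properties as ProdP

Σℤ : ∀ {n} → (Fin n → ℤ) → ℤ
Σℤ {zero}  f = + 0
Σℤ {suc n} f = f zero + Σℤ (λ i → f (suc i))

maxℕ : ∀ {n} → (Fin n → ℕ) → ℕ
maxℕ {zero}  f = 0
maxℕ {suc n} f = f zero Data.Nat.⊔ maxℕ (λ i → f (suc i))

-- Blocks are indexed by Fin nb (the vertices of the block graph).

record TripleSystem : Set₁ where
  field
    Pt     : Set
    _≟ₚ_   : DecidableEquality Pt
    nb     : ℕ
    block  : Fin nb → Pt × Pt × Pt

  _∈B_ : Pt → Fin nb → Set
  x ∈B i with block i
  ... | (a , b , c) = x ≡ a ⊎ x ≡ b ⊎ x ≡ c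

  inB? : Pt → Fin nb → Bool
  inB? x i with block i
  ... | (a , b , c) = isYes (x ≟ₚ a) Data.Bool.∨ isYes (x ≟ₚ b) Data.Bool.∨ isYes (x ≟ₚ c)
    where
      isYes : ∀ {P : Set} → Dec P → Bool
      isYes (yes _) = true
      isYes (no _)  = false

  W : Pt → Fin nb → ℤ
  W x i = if inB? x i then + 1 else + 0

  meets : Fin nb → Fin nb → Bool
  meets i j with block i
  ... | (a , b , c) = inB? a j Data.Bool.∨ inB? b j Data.Bool.∨ inB? c j

  A : Fin nb → Fin nb → ℤ
  A i j with i ≟ j
  ... | yes _ = + 0
  ... | no  _ = if meets i j then + 1 else + 0

  NowhereZero : (Fin nb → ℤ) → Set
  NowhereZero u = ∀ i → u i ≢ + 0

  ‖_‖∞ : (Fin nb → ℤ) → ℕ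
  ‖ u ‖∞ = maxℕ (λ i → ∣ u i ∣)

  InKernelW : (Fin nb → ℤ) → Set
  InKernelW u = ∀ (x : Pt) → Σℤ (λ i → W x i * u i) ≡ + 0

  HasFlow : ℕ → Set
  HasFlow k = ∃ λ (u : Fin nb → ℤ) → NowhereZero u × InKernelW u × suc ‖ u ‖∞ ≡ k

  -- θ₂(Γ_S) = -3 : u is a θ₂-eigenvector of Γ_S  (A u = -3 u)
  θ₂Eigvec : (Fin nb → ℤ) → Set
  θ₂Eigvec u = ∀ i → Σℤ (λ j → A i j * u j) ≡ - (+ 3) * u i

  m2≡ : ℕ → Set
  m2≡ k = (∃ λ (u : Fin nb → ℤ) → NowhereZero u × θ₂Eigvec u × suc ‖ u ‖∞ ≡ k)
        × (∀ (u : Fin nb → ℤ) → NowhereZero u → θ₂Eigvec u → k ≤ suc ‖ u ‖∞)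

-- Hamming STS of order 2^r - 1: points nonzero vectors of F₂^r,
-- blocks {x, y, x+y}.  Each block is listed once, as (x, y, x+y) with
-- 0 < val x < val y < val (x+y) where val is the binary value.

allVecs : ∀ r → List (Vec Bool r)
allVecs zero    = [ [] ]
allVecs (suc r) = concatMap (λ v → (false ∷ v) ∷ (true ∷ v) ∷ []) (allVecs r)

val : ∀ {r} → Vec Bool r → ℕ
val []      = 0
val (b ∷ v) = (if b then 1 else 0) +ℕ 2 *ℕ val v

_⊕_ : ∀ {r} → Vec Bool r → Vec Bool r → Vec Bool r
_⊕_ = zipWith _xor_

hammingBlocks : ∀ r → List (Vec Bool r × Vec Bool r × Vec Bool r)
hammingBlocks r =
  concatMap (λ x → concatMap (λ y →
      if (0 <ᵇ val x) ∧ (val x <ᵇ val y) ∧ (val y <ᵇ val (x ⊕ y))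
      then [ (x , y , x ⊕ y) ] else [])
    (allVecs r)) (allVecs r)

-- (the zero vector is included in the point type but lies in no block;
--  it is an isolated point and does not affect W_S u = 0 or Γ_S)
HammingSTS : ℕ → TripleSystem
HammingSTS r = record
  { Pt = Vec Bool r
  ; _≟ₚ_ = VecP.≡-dec Data.Bool._≟_
  ; nb = length (hammingBlocks r)
  ; block = lookup (hammingBlocks r)
  }

-- Bose STS of order 3p: points ℤ_p × ℤ_3, blocks
-- {(x,0),(x,1),(x,2)} and {(x,i),(y,i),(x∘y,i+1)} for x ≠ y (listed once
-- with x < y), where x∘y = (x+y)/2 in ℤ_p, i.e. (x+y)·((p+1)/2) mod p.

next3 : Fin 3 → Fin 3
next3 zero             = suc zero
next3 (suc zero)       = suc (suc zero)
next3 (suc (suc zero)) = zero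

module _ (p : ℕ) .{{_ : NonZero p}} where

  mid : Fin p → Fin p → Fin p
  mid x y = ((toℕ x +ℕ toℕ y) *ℕ ((p +ℕ 1) / 2)) mod p

  boseBlocks : List ((Fin p × Fin 3) × (Fin p × Fin 3) × (Fin p × Fin 3))
  boseBlocks =
    map (λ x → ((x , zero) , (x , suc zero) , (x , suc (suc zero)))) (allFin p)
    ++ concatMap (λ i → concatMap (λ x → concatMap (λ y →
          if toℕ x <ᵇ toℕ y
          then [ ((x , i) , (y , i) , (mid x y , next3 i)) ] else [])
        (allFin p)) (allFin p)) (allFin 3)

  BoseSTS : TripleSystem
  BoseSTS = record
    { Pt = Fin p × Fin 3
    ; _≟ₚ_ = ProdP.≡-dec _≟_ _≟_
    ; nb = length boseBlocks
    ; block = lookup boseBlocks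
    }

{-# OPTIONS --safe #-}

-- Flows are nowhere-zero integer vectors u with W u = 0.  If two points lie in at most one block,
-- then Σ_{x ∈ B} (W u)_x = (A u)_B + 3 u_B, so every flow is a θ₂ = -3 eigenvector of the block graph.
--
-- Hamming system, r ≥ 4.  Every point of PG(r-1,2) is on 2^(r-1) - 1 lines, so every vertex of the
-- block graph has even degree 3·2^(r-1) - 6; for a ±1 vector u this makes (A u)_B even, whereas
-- -3 u_B is odd, hence m(2, Γ) ≥ 3.  Conversely a flow with values ±1, ±2 is built by induction on r:
-- by an explicit table for r = 4, and from PG(r-1,2) to PG(r,2) by keeping the flow on the hyperplane
-- x₀ = 0 and giving the line {(1,a), (1,b), (0,a+b)} the weight ε(a+b) χ_{a+b}(a), where χ_c is a
-- non-trivial character with χ_c(c) = 1 and ε has zero sum against every χ_c.  Sums over lines are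
-- computed as sums over ordered pairs of points, each line being counted six times.
--
-- Bose system, p ≥ 7.  The vertical block at x gets v(x) and the horizontal block through (x,i), (y,i)
-- gets F(x,y), an even function of y - x corrected at y - x = ±2 by parity signs.  The flow condition
-- at (z,j) becomes 2 v(z) + 2 Σ_y F(z,y) + Σ_x F(x, 2z - x) = 0, which holds after reindexing the sums
-- over ℤ_p.  The primes 3 and 5 are handled by explicit tables.

module Submission where

open import Defs
open import Data.Nat using (ℕ; _≤_)
open import Data.Nat.Divisibility using (_∣_)
open import Data.Nat.Primality using (Prime; prime⇒nonZero)
open import Data.Product using (_×_)
open import Data.Sum using (_⊎_)
open import Relation.Nullary using (¬_)

open import Algebra.Bundles using (AbelianGroup)
import Algebra.Properties.AbelianGroup
import Algebra.Properties.Semiring.Sum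
open import Data.Bool using (Bool; true; false; not; _∧_; _∨_; _xor_; if_then_else_)
import Data.Bool as Bool
open import Data.Bool.Properties
  using ( T-≡; xor-comm; xor-assoc; xor-identityʳ; xor-identityˡ; xor-same
        ; ∨-assoc; ∨-comm; ∨-zeroʳ; ∧-zeroʳ; ∧-identityʳ; ∧-conicalˡ; ∧-conicalʳ; ⇔→≡)
open import Data.Empty using (⊥)
import Data.Integer.Literals
open import Data.Unit using (⊤; tt)
open import Agda.Builtin.FromNat using (Number)
open import Agda.Builtin.FromNeg using (Negative)
open import Data.Fin using (Fin; zero; suc; _≟_; toℕ)
open import Data.Fin.Permutation using (permutation)
import Data.Fin.Properties as FinP
open import Data.Integer as ℤ using (ℤ; +_; -[1+_]; _+_; _*_; -_; _-_; ∣_∣)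
open import Data.Integer.Divisibility.Signed as ℤ∣ using () renaming (_∣_ to _∣ℤ_)
import Data.Integer.Properties as ℤP
open import Data.Integer.Tactic.RingSolver using (solve-∀)
open import Data.List using (List; []; _∷_; [_]; _++_; concatMap; map; lookup; allFin; tabulate)
open import Data.List.Membership.Propositional.Properties using (∈-lookup)
open import Data.List.Relation.Unary.All as All using (All; []; _∷_)
import Data.List.Relation.Unary.All.Properties as All
open import Data.Nat as ℕ using (zero; suc; _<_; _<ᵇ_; _^_; _⊓_; _∸_; _%_; _/_; s≤s; z≤n; NonZero)
import Data.Nat.Divisibility as ℕ∣
open import Data.Nat.Primality using (¬prime[1])
open import Data.Nat.DivMod
  using (_mod_; %-distribˡ-+; %-distribˡ-*; m%n%n≡m%n; [m+kn]%n≡m%n; [m+n]%n≡m%n; m<n⇒m%n≡m; m*n/n≡m)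
import Data.Nat.Properties as ℕP
import Data.Nat.Tactic.RingSolver as ℕ-Solver
open import Data.Product using (_,_; proj₁; proj₂; ∃; ∃₂)
open import Data.Sum using (inj₁; inj₂)
import Data.Sum as Sum
open import Data.Vec using (Vec; []; _∷_; replicate)
import Data.Vec.Properties as VecP
open import Function using (_∘_)
open import Function.Bundles using (Equivalence; mk⇔)
open import Level using (0ℓ)
open import Relation.Binary.Bundles using (Setoid)
open import Relation.Binary.Definitions using (tri<; tri≈; tri>)
open import Relation.Binary.PropositionalEquality hiding ([_])
import Relation.Binary.Reasoning.Setoid as SetoidReasoning
open import Relation.Nullary using (Dec; yes; no; does; contradiction; map′; _×-dec_; _⊎-dec_; _→-dec_)
open import Relation.Nullary.Decidable using (True; toWitness; dec-true; dec-false; from-yes; from-no)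

module ℤSum = Algebra.Properties.Semiring.Sum ℤP.+-*-semiring

ι : Bool → ℤ
ι b = if b then + 1 else + 0

at : ∀ {a} {A : Set a} → A → List A → ℕ → A
at d []       _       = d
at d (x ∷ xs) zero    = x
at d (x ∷ xs) (suc n) = at d xs n

-- Integer literals for the explicit tables; the ⊤ instance discharges their trivial side conditions.
module IntegerLiterals where
  instance
    ℤ-number : Number ℤ
    ℤ-number = Data.Integer.Literals.number
    ℤ-negative : Negative ℤ
    ℤ-negative = Data.Integer.Literals.negative
    ⊤-instance : ⊤
    ⊤-instance = tt

<ᵇ-true : ∀ {m n} → m < n → (m <ᵇ n) ≡ true
<ᵇ-true m<n = Equivalence.to T-≡ (ℕP.<⇒<ᵇ m<n)

<ᵇ-true⁻¹ : ∀ {m n} → (m <ᵇ n) ≡ true → m < n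
<ᵇ-true⁻¹ {m} {n} m<ᵇn = ℕP.<ᵇ⇒< m n (Equivalence.from T-≡ m<ᵇn)

<ᵇ-false : ∀ {m n} → ¬ (m < n) → (m <ᵇ n) ≡ false
<ᵇ-false {m} {n} m≮n with m <ᵇ n in m<ᵇn
... | true  = contradiction (<ᵇ-true⁻¹ m<ᵇn) m≮n
... | false = refl

<ᵇ-flip : ∀ {m n} → m ≢ n → (n <ᵇ m) ≡ not (m <ᵇ n)
<ᵇ-flip {m} {n} m≢n with ℕP.<-cmp m n
... | tri< m<n _ n≮m rewrite <ᵇ-true m<n | <ᵇ-false n≮m = refl
... | tri≈ _ m≡n _   = contradiction m≡n m≢n
... | tri> m≮n _ n<m rewrite <ᵇ-true n<m | <ᵇ-false m≮n = refl

<ᵇ-trans : ∀ {m n o} → (m <ᵇ n) ≡ true → (n <ᵇ o) ≡ true → (m <ᵇ o) ≡ true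
<ᵇ-trans {m} {n} {o} m<n n<o = <ᵇ-true {m} {o} (ℕP.<-trans (<ᵇ-true⁻¹ m<n) (<ᵇ-true⁻¹ n<o))

module _ {a} {A : Set a} where

  ΣL : (A → ℤ) → List A → ℤ
  ΣL f []       = + 0
  ΣL f (x ∷ xs) = f x + ΣL f xs

  ΣL-cong : ∀ {f g : A → ℤ} → (∀ x → f x ≡ g x) → ∀ xs → ΣL f xs ≡ ΣL g xs
  ΣL-cong f≗g []       = refl
  ΣL-cong f≗g (x ∷ xs) = cong₂ _+_ (f≗g x) (ΣL-cong f≗g xs)

  ΣL-++ : ∀ (f : A → ℤ) xs ys → ΣL f (xs ++ ys) ≡ ΣL f xs + ΣL f ys
  ΣL-++ f []       ys = sym (ℤP.+-identityˡ _)
  ΣL-++ f (x ∷ xs) ys = trans (cong (_+_ (f x)) (ΣL-++ f xs ys)) (sym (ℤP.+-assoc (f x) _ _))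

  ΣL-+ : ∀ (f g : A → ℤ) xs → ΣL (λ x → f x + g x) xs ≡ ΣL f xs + ΣL g xs
  ΣL-+ f g []       = refl
  ΣL-+ f g (x ∷ xs) = trans (cong (_+_ (f x + g x)) (ΣL-+ f g xs)) (interchange (f x) (g x) _ _)
    where
    interchange : ∀ a b c d → a + b + (c + d) ≡ a + c + (b + d)
    interchange = solve-∀

  ΣL-* : ∀ c (f : A → ℤ) xs → ΣL (λ x → c * f x) xs ≡ c * ΣL f xs
  ΣL-* c f []       = sym (ℤP.*-zeroʳ c)
  ΣL-* c f (x ∷ xs) = trans (cong (_+_ (c * f x)) (ΣL-* c f xs)) (sym (ℤP.*-distribˡ-+ c (f x) _))

  ΣL-zero : ∀ (xs : List A) → ΣL (λ _ → + 0) xs ≡ + 0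
  ΣL-zero []       = refl
  ΣL-zero (x ∷ xs) = trans (ℤP.+-identityˡ _) (ΣL-zero xs)

  Σℤ-lookup : ∀ (f : A → ℤ) xs → Σℤ (λ i → f (lookup xs i)) ≡ ΣL f xs
  Σℤ-lookup f []       = refl
  Σℤ-lookup f (x ∷ xs) = cong (_+_ (f x)) (Σℤ-lookup f xs)

  ΣL-if : ∀ (f : A → ℤ) b t → ΣL f (if b then [ t ] else []) ≡ ι b * f t
  ΣL-if f true  t = trans (ℤP.+-identityʳ (f t)) (sym (ℤP.*-identityˡ (f t)))
  ΣL-if f false t = sym (ℤP.*-zeroˡ (f t))

module _ {a b} {A : Set a} {B : Set b} where

  ΣL-map : ∀ (f : B → ℤ) (g : A → B) xs → ΣL f (map g xs) ≡ ΣL (f ∘ g) xs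
  ΣL-map f g []       = refl
  ΣL-map f g (x ∷ xs) = cong (_+_ (f (g x))) (ΣL-map f g xs)

  ΣL-concatMap : ∀ (f : B → ℤ) (g : A → List B) xs →
                 ΣL f (concatMap g xs) ≡ ΣL (λ x → ΣL f (g x)) xs
  ΣL-concatMap f g []       = refl
  ΣL-concatMap f g (x ∷ xs) =
    trans (ΣL-++ f (g x) (concatMap g xs)) (cong (_+_ (ΣL f (g x))) (ΣL-concatMap f g xs))

  ΣL-comm : ∀ (f : A → B → ℤ) xs ys →
            ΣL (λ x → ΣL (f x) ys) xs ≡ ΣL (λ y → ΣL (λ x → f x y) xs) ys
  ΣL-comm f []       ys = sym (ΣL-zero ys)
  ΣL-comm f (x ∷ xs) ys =
    trans (cong (_+_ (ΣL (f x) ys)) (ΣL-comm f xs ys)) (sym (ΣL-+ (f x) _ ys))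

ΣL-tabulate : ∀ {a} {A : Set a} {n} (f : A → ℤ) (g : Fin n → A) → ΣL f (tabulate g) ≡ Σℤ (f ∘ g)
ΣL-tabulate {n = zero}  f g = refl
ΣL-tabulate {n = suc n} f g = cong (_+_ (f (g zero))) (ΣL-tabulate f (g ∘ suc))

ΣL-allFin : ∀ {n} (f : Fin n → ℤ) → ΣL f (allFin n) ≡ Σℤ f
ΣL-allFin f = ΣL-tabulate f (λ i → i)

Σℤ-cong : ∀ {n} {f g : Fin n → ℤ} → (∀ i → f i ≡ g i) → Σℤ f ≡ Σℤ g
Σℤ-cong {zero}  f≗g = refl
Σℤ-cong {suc n} f≗g = cong₂ _+_ (f≗g zero) (Σℤ-cong (f≗g ∘ suc))

Σℤ≡sum : ∀ {n} (f : Fin n → ℤ) → Σℤ f ≡ ℤSum.sum f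
Σℤ≡sum {zero}  f = refl
Σℤ≡sum {suc n} f = cong (_+_ (f zero)) (Σℤ≡sum (f ∘ suc))

Σℤ-+ : ∀ {n} (f g : Fin n → ℤ) → Σℤ (λ i → f i + g i) ≡ Σℤ f + Σℤ g
Σℤ-+ f g = begin
  Σℤ (λ i → f i + g i)  ≡⟨ Σℤ≡sum (λ i → f i + g i) ⟩
  ℤSum.sum (λ i → f i + g i)  ≡⟨ ℤSum.∑-distrib-+ f g ⟩
  ℤSum.sum f + ℤSum.sum g ≡⟨ cong₂ _+_ (Σℤ≡sum f) (Σℤ≡sum g) ⟨
  Σℤ f + Σℤ g ∎
  where open ≡-Reasoning

Σℤ-+₃ : ∀ {n} (f g h : Fin n → ℤ) → Σℤ (λ i → f i + g i + h i) ≡ Σℤ f + Σℤ g + Σℤ h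
Σℤ-+₃ f g h = trans (Σℤ-+ (λ i → f i + g i) h) (cong (_+ Σℤ h) (Σℤ-+ f g))

Σℤ-* : ∀ {n} c (f : Fin n → ℤ) → Σℤ (λ i → c * f i) ≡ c * Σℤ f
Σℤ-* c f = begin
  Σℤ (λ i → c * f i)       ≡⟨ Σℤ≡sum (λ i → c * f i) ⟩
  ℤSum.sum (λ i → c * f i)  ≡⟨ ℤSum.*-distribˡ-sum c f ⟨
  c * ℤSum.sum f            ≡⟨ cong (c *_) (Σℤ≡sum f) ⟨
  c * Σℤ f ∎
  where open ≡-Reasoning

Σℤ-comm : ∀ {m n} (f : Fin m → Fin n → ℤ) →
          Σℤ (λ i → Σℤ (f i)) ≡ Σℤ (λ j → Σℤ (λ i → f i j))
Σℤ-comm f = begin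
  Σℤ (λ i → Σℤ (f i))                    ≡⟨ Σℤ≡sum (λ i → Σℤ (f i)) ⟩
  ℤSum.sum (λ i → Σℤ (f i))               ≡⟨ ℤSum.sum-cong-≗ (Σℤ≡sum ∘ f) ⟩
  ℤSum.sum (λ i → ℤSum.sum (f i))          ≡⟨ ℤSum.∑-comm f ⟩
  ℤSum.sum (λ j → ℤSum.sum (λ i → f i j))  ≡⟨ ℤSum.sum-cong-≗ (λ j → Σℤ≡sum (λ i → f i j)) ⟨
  ℤSum.sum (λ j → Σℤ (λ i → f i j))       ≡⟨ Σℤ≡sum (λ j → Σℤ (λ i → f i j)) ⟨
  Σℤ (λ j → Σℤ (λ i → f i j)) ∎
  where open ≡-Reasoning

Σℤ-reindex : ∀ {n} (f : Fin n → ℤ) (π π⁻¹ : Fin n → Fin n) →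
             (∀ i → π (π⁻¹ i) ≡ i) → (∀ i → π⁻¹ (π i) ≡ i) → Σℤ (f ∘ π) ≡ Σℤ f
Σℤ-reindex f π π⁻¹ ππ⁻¹ π⁻¹π = begin
  Σℤ (f ∘ π)       ≡⟨ Σℤ≡sum (f ∘ π) ⟩
  ℤSum.sum (f ∘ π)  ≡⟨ ℤSum.sum-permute f (permutation π π⁻¹ ππ⁻¹ π⁻¹π) ⟨
  ℤSum.sum f        ≡⟨ Σℤ≡sum f ⟨
  Σℤ f ∎
  where open ≡-Reasoning

Σℤ-zero : ∀ n → Σℤ {n} (λ _ → + 0) ≡ + 0
Σℤ-zero zero    = refl
Σℤ-zero (suc n) = trans (ℤP.+-identityˡ _) (Σℤ-zero n)

Σℤ-single : ∀ {n} (i : Fin n) (f : Fin n → ℤ) → (∀ j → j ≢ i → f j ≡ + 0) → Σℤ f ≡ f i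
Σℤ-single {suc n} zero f vanish =
  trans (cong (_+_ (f zero)) (trans (Σℤ-cong (λ j → vanish (suc j) λ ())) (Σℤ-zero n)))
        (ℤP.+-identityʳ (f zero))
Σℤ-single {suc n} (suc i) f vanish =
  trans (cong (_+ Σℤ (f ∘ suc)) (vanish zero λ ()))
        (trans (ℤP.+-identityˡ _) (Σℤ-single i (f ∘ suc) (λ j j≢i → vanish (suc j) (j≢i ∘ FinP.suc-injective))))

Σℤ-indicator : ∀ {n} (i : Fin n) (f : Fin n → ℤ) → Σℤ (λ j → ι (does (i ≟ j)) * f j) ≡ f i
Σℤ-indicator i f =
  trans (Σℤ-single i _ vanish) (trans (cong (λ b → ι b * f i) (dec-true (i ≟ i) refl)) (ℤP.*-identityˡ (f i)))
  where
  vanish : ∀ j → j ≢ i → ι (does (i ≟ j)) * f j ≡ + 0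
  vanish j j≢i = cong (λ b → ι b * f j) (dec-false (i ≟ j) (j≢i ∘ sym))

Σℤ-∣ : ∀ {n} k (f : Fin n → ℤ) → (∀ i → k ∣ℤ f i) → k ∣ℤ Σℤ f
Σℤ-∣ {zero}  k f k∣f = ℤ∣.∣ᵤ⇒∣ (ℕ∣._∣0 _)
Σℤ-∣ {suc n} k f k∣f = ℤ∣.∣m∣n⇒∣m+n (k∣f zero) (Σℤ-∣ k (f ∘ suc) (k∣f ∘ suc))

Σℤ-nonempty : ∀ {n} (f : Fin n → ℤ) → Σℤ f ≢ + 0 → Fin n
Σℤ-nonempty {zero}  f Σf≢0 = contradiction refl Σf≢0
Σℤ-nonempty {suc n} f Σf≢0 = zero

ι-nonneg : ∀ b → + 0 ℤ.≤ ι b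
ι-nonneg true  = ℤ.+≤+ z≤n
ι-nonneg false = ℤ.+≤+ z≤n

Σℤ-ι-nonneg : ∀ {n} (c : Fin n → Bool) → + 0 ℤ.≤ Σℤ (ι ∘ c)
Σℤ-ι-nonneg {zero}  c = ℤP.≤-refl
Σℤ-ι-nonneg {suc n} c = ℤP.+-mono-≤ (ι-nonneg (c zero)) (Σℤ-ι-nonneg (c ∘ suc))

Σℤ-ι-≥1 : ∀ {n} (c : Fin n → Bool) i → c i ≡ true → + 1 ℤ.≤ Σℤ (ι ∘ c)
Σℤ-ι-≥1 c zero    ci = ℤP.+-mono-≤ (ℤP.≤-reflexive (cong ι (sym ci))) (Σℤ-ι-nonneg (c ∘ suc))
Σℤ-ι-≥1 c (suc i) ci = ℤP.+-mono-≤ (ι-nonneg (c zero)) (Σℤ-ι-≥1 (c ∘ suc) i ci)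

Σℤ-ι-≥2 : ∀ {n} (c : Fin n → Bool) {i j} → i ≢ j → c i ≡ true → c j ≡ true → + 2 ℤ.≤ Σℤ (ι ∘ c)
Σℤ-ι-≥2 c {zero}  {zero}  i≢j ci cj = contradiction refl i≢j
Σℤ-ι-≥2 c {zero}  {suc j} i≢j ci cj =
  ℤP.+-mono-≤ (ℤP.≤-reflexive (cong ι (sym ci))) (Σℤ-ι-≥1 (c ∘ suc) j cj)
Σℤ-ι-≥2 c {suc i} {zero}  i≢j ci cj =
  ℤP.+-mono-≤ (ℤP.≤-reflexive (cong ι (sym cj))) (Σℤ-ι-≥1 (c ∘ suc) i ci)
Σℤ-ι-≥2 c {suc i} {suc j} i≢j ci cj =
  ℤP.+-mono-≤ (ι-nonneg (c zero)) (Σℤ-ι-≥2 (c ∘ suc) (i≢j ∘ cong suc) ci cj)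

Σℤ-ι≡1⇒unique : ∀ {n} (c : Fin n → Bool) → Σℤ (ι ∘ c) ≡ + 1 →
                ∀ {i j} → c i ≡ true → c j ≡ true → i ≡ j
Σℤ-ι≡1⇒unique c Σc≡1 {i} {j} ci cj with i ≟ j
... | yes i≡j = i≡j
... | no  i≢j with subst (+ 2 ℤ.≤_) Σc≡1 (Σℤ-ι-≥2 c i≢j ci cj)
...   | ℤ.+≤+ (s≤s ())

module _ {a b p} {A : Set a} {B : Set b} {P : B → Set p} where

  All-concatMap : ∀ {f : A → List B} → (∀ x → All P (f x)) → ∀ xs → All P (concatMap f xs)
  All-concatMap {f} Pf xs = All.concat⁺ (All.map⁺ {xs = xs} (All.tabulate λ {x} _ → Pf x))

All-if : ∀ {b p} {B : Set b} {P : B → Set p} c (t : B) → (c ≡ true → P t) → All P (if c then [ t ] else [])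
All-if true  t Pt = Pt refl ∷ []
All-if false t Pt = []

All-lookup : ∀ {a p} {A : Set a} {P : A → Set p} {xs} → All P xs → ∀ i → P (lookup xs i)
All-lookup Pxs i = All.lookup Pxs (∈-lookup i)

Σℤ-ordered-pairs : ∀ {n} (K : Fin n → Fin n → ℤ) → (∀ x y → K x y ≡ K y x) → (∀ x → K x x ≡ + 0) →
  Σℤ (λ x → Σℤ (K x)) ≡ + 2 * Σℤ (λ x → Σℤ (λ y → ι (toℕ x <ᵇ toℕ y) * K x y))
Σℤ-ordered-pairs {n} K symmetric diagonal = begin
  Σℤ (λ x → Σℤ (K x))                           ≡⟨ Σℤ-cong (λ x → Σℤ-cong (split x)) ⟩
  Σℤ (λ x → Σℤ (λ y → K< x y + K< y x))        ≡⟨ Σℤ-cong (λ x → Σℤ-+ (K< x) (λ y → K< y x)) ⟩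
  Σℤ (λ x → Σℤ (K< x) + Σℤ (λ y → K< y x))     ≡⟨ Σℤ-+ (λ x → Σℤ (K< x)) (λ x → Σℤ (λ y → K< y x)) ⟩
  Σℤ (λ x → Σℤ (K< x)) + Σℤ (λ x → Σℤ (λ y → K< y x))
                                                ≡⟨ cong (_+_ (Σℤ (λ x → Σℤ (K< x)))) (Σℤ-comm (λ x y → K< y x)) ⟩
  Σℤ (λ x → Σℤ (K< x)) + Σℤ (λ x → Σℤ (K< x))  ≡⟨ double (Σℤ (λ x → Σℤ (K< x))) ⟩
  + 2 * Σℤ (λ x → Σℤ (K< x)) ∎
  where
  open ≡-Reasoning
  K< : Fin n → Fin n → ℤ
  K< x y = ι (toℕ x <ᵇ toℕ y) * K x y
  double : ∀ s → s + s ≡ + 2 * s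
  double = solve-∀
  split : ∀ x y → K x y ≡ K< x y + K< y x
  split x y with ℕP.<-cmp (toℕ x) (toℕ y)
  ... | tri< x<y _ y≮x rewrite <ᵇ-true x<y | <ᵇ-false y≮x =
        trans (sym (ℤP.*-identityˡ (K x y))) (sym (ℤP.+-identityʳ _))
  ... | tri> x≮y _ y<x rewrite <ᵇ-false x≮y | <ᵇ-true y<x =
        trans (trans (symmetric x y) (sym (ℤP.*-identityˡ (K y x)))) (sym (ℤP.+-identityˡ _))
  ... | tri≈ _ x≡y _ rewrite FinP.toℕ-injective x≡y | <ᵇ-false (ℕP.<-irrefl {toℕ y} refl) = diagonal y

AbsOneOrTwo : ℤ → Set
AbsOneOrTwo z = ∣ z ∣ ≡ 1 ⊎ ∣ z ∣ ≡ 2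

AbsOneOrTwo? : ∀ z → Dec (AbsOneOrTwo z)
AbsOneOrTwo? z = (∣ z ∣ ℕ.≟ 1) ⊎-dec (∣ z ∣ ℕ.≟ 2)

AbsOneOrTwo-neg : ∀ {z} → AbsOneOrTwo z → AbsOneOrTwo (- z)
AbsOneOrTwo-neg {z} = subst (λ n → n ≡ 1 ⊎ n ≡ 2) (sym (ℤP.∣-i∣≡∣i∣ z))

sign : Bool → ℤ
sign false = + 1
sign true  = - + 1

∣sign∣≡1 : ∀ b → ∣ sign b ∣ ≡ 1
∣sign∣≡1 false = refl
∣sign∣≡1 true  = refl

AbsOneOrTwo⇒≢0 : ∀ {z} → AbsOneOrTwo z → z ≢ + 0
AbsOneOrTwo⇒≢0 (inj₁ ∣z∣≡1) refl = contradiction ∣z∣≡1 λ ()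
AbsOneOrTwo⇒≢0 (inj₂ ∣z∣≡2) refl = contradiction ∣z∣≡2 λ ()

AbsOneOrTwo⇒1≤ : ∀ {z} → AbsOneOrTwo z → 1 ≤ ∣ z ∣
AbsOneOrTwo⇒1≤ (inj₁ ∣z∣≡1) = ℕP.≤-reflexive (sym ∣z∣≡1)
AbsOneOrTwo⇒1≤ (inj₂ ∣z∣≡2) = ℕP.≤-trans (s≤s z≤n) (ℕP.≤-reflexive (sym ∣z∣≡2))

AbsOneOrTwo⇒≤2 : ∀ {z} → AbsOneOrTwo z → ∣ z ∣ ≤ 2
AbsOneOrTwo⇒≤2 (inj₁ ∣z∣≡1) = ℕP.≤-trans (ℕP.≤-reflexive ∣z∣≡1) (s≤s z≤n)
AbsOneOrTwo⇒≤2 (inj₂ ∣z∣≡2) = ℕP.≤-reflexive ∣z∣≡2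

maxℕ-lub : ∀ {n} (f : Fin n → ℕ) {k} → (∀ i → f i ≤ k) → maxℕ f ≤ k
maxℕ-lub {zero}  f f≤k = z≤n
maxℕ-lub {suc n} f f≤k = ℕP.⊔-lub (f≤k zero) (maxℕ-lub (f ∘ suc) (f≤k ∘ suc))

maxℕ-upper : ∀ {n} (f : Fin n → ℕ) i → f i ≤ maxℕ f
maxℕ-upper f zero    = ℕP.m≤m⊔n (f zero) _
maxℕ-upper f (suc i) = ℕP.≤-trans (maxℕ-upper (f ∘ suc) i) (ℕP.m≤n⊔m (f zero) _)

Σℤ-sign-parity : ∀ {n} (a u : Fin n → ℤ) → (∀ j → u j ≡ + 1 ⊎ u j ≡ - + 1) →
                 + 2 ∣ℤ Σℤ a → + 2 ∣ℤ Σℤ (λ j → a j * u j)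
Σℤ-sign-parity a u ±1 2∣Σa =
  subst (+ 2 ∣ℤ_) (sym Σau≡Σa+Σ) (ℤ∣.∣m∣n⇒∣m+n 2∣Σa (Σℤ-∣ (+ 2) _ 2∣a[u-1]))
  where
  split : ∀ x y → x * y ≡ x + x * (y - + 1)
  split = solve-∀
  Σau≡Σa+Σ : Σℤ (λ j → a j * u j) ≡ Σℤ a + Σℤ (λ j → a j * (u j - + 1))
  Σau≡Σa+Σ = trans (Σℤ-cong (λ j → split (a j) (u j))) (Σℤ-+ a _)
  2∣a[u-1] : ∀ j → + 2 ∣ℤ a j * (u j - + 1)
  2∣a[u-1] j with ±1 j
  ... | inj₁ uj≡1  rewrite uj≡1  = ℤ∣.∣n⇒∣m*n (a j) (ℤ∣.∣ᵤ⇒∣ (ℕ∣._∣0 2))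
  ... | inj₂ uj≡-1 rewrite uj≡-1 = ℤ∣.∣n⇒∣m*n (a j) (ℤ∣.∣ᵤ⇒∣ ℕ∣.∣-refl)

module TripleSystemProperties (S : TripleSystem) where
  open TripleSystem S

  Triple : Set
  Triple = Pt × Pt × Pt

  _∈ᵗ_ : Pt → Triple → Bool
  x ∈ᵗ (a , b , c) = does (x ≟ₚ a) ∨ does (x ≟ₚ b) ∨ does (x ≟ₚ c)

  Σ₃ : (Pt → ℤ) → Triple → ℤ
  Σ₃ f (a , b , c) = f a + f b + f c

  Σ₃-cong : ∀ {f g : Pt → ℤ} → (∀ x → f x ≡ g x) → ∀ t → Σ₃ f t ≡ Σ₃ g t
  Σ₃-cong f≗g (a , b , c) = cong₂ _+_ (cong₂ _+_ (f≗g a) (f≗g b)) (f≗g c)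

  Distinct : Triple → Set
  Distinct (a , b , c) = a ≢ b × b ≢ c × a ≢ c

  inB?≡∈ᵗ : ∀ x i → inB? x i ≡ x ∈ᵗ block i
  inB?≡∈ᵗ x i with x ≟ₚ proj₁ (block i) | x ≟ₚ proj₁ (proj₂ (block i)) | x ≟ₚ proj₂ (proj₂ (block i))
  ... | yes _ | _     | _     = refl
  ... | no _  | yes _ | _     = refl
  ... | no _  | no _  | yes _ = refl
  ... | no _  | no _  | no _  = refl

  W≡ι∈ᵗ : ∀ x i → W x i ≡ ι (x ∈ᵗ block i)
  W≡ι∈ᵗ x i = cong ι (inB?≡∈ᵗ x i)

  inB?⇒∈B : ∀ {x i} → inB? x i ≡ true → x ∈B i
  inB?⇒∈B {x} {i} x∈ with x ≟ₚ proj₁ (block i) | x ≟ₚ proj₁ (proj₂ (block i)) | x ≟ₚ proj₂ (proj₂ (block i))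
  ... | yes x≡a | _       | _       = inj₁ x≡a
  ... | no _    | yes x≡b | _       = inj₂ (inj₁ x≡b)
  ... | no _    | no _    | yes x≡c = inj₂ (inj₂ x≡c)

  ∈B⇒inB? : ∀ {x i} → x ∈B i → inB? x i ≡ true
  ∈B⇒inB? {x} {i} x∈ with x ≟ₚ proj₁ (block i) | x ≟ₚ proj₁ (proj₂ (block i)) | x ≟ₚ proj₂ (proj₂ (block i))
  ... | yes _ | _     | _     = refl
  ... | no _  | yes _ | _     = refl
  ... | no _  | no _  | yes _ = refl
  ... | no x≢a | no x≢b | no x≢c with x∈
  ...   | inj₁ x≡a        = contradiction x≡a x≢a
  ...   | inj₂ (inj₁ x≡b) = contradiction x≡b x≢b
  ...   | inj₂ (inj₂ x≡c) = contradiction x≡c x≢c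

  record IsLinear : Set where
    field
      distinct : ∀ i → Distinct (block i)
      unique   : ∀ i j {x y} → x ≢ y → x ∈B i → y ∈B i → x ∈B j → y ∈B j → i ≡ j

  module _ (linear : IsLinear) where
    open IsLinear linear

    private
      ι-∨₃ : ∀ α β γ → (α ≡ true → β ≡ true → ⊥) → (α ≡ true → γ ≡ true → ⊥) →
             (β ≡ true → γ ≡ true → ⊥) → ι α + ι β + ι γ ≡ ι (α ∨ β ∨ γ)
      ι-∨₃ true  true  _     αβ _  _  = contradiction refl (αβ refl)
      ι-∨₃ true  false true  _  αγ _  = contradiction refl (αγ refl)
      ι-∨₃ false true  true  _  _  βγ = contradiction refl (βγ refl)
      ι-∨₃ true  false false _  _  _  = refl
      ι-∨₃ false true  false _  _  _  = refl
      ι-∨₃ false false true  _  _  _  = refl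
      ι-∨₃ false false false _  _  _  = refl

    incidence : ∀ i j → Σ₃ (λ x → W x j) (block i) ≡ A i j + + 3 * ι (does (i ≟ j))
    incidence i j with i ≟ j
    ... | yes refl rewrite ∈B⇒inB? {proj₁ (block i)} {i} (inj₁ refl)
                         | ∈B⇒inB? {proj₁ (proj₂ (block i))} {i} (inj₂ (inj₁ refl))
                         | ∈B⇒inB? {proj₂ (proj₂ (block i))} {i} (inj₂ (inj₂ refl)) = refl
    ... | no i≢j with distinct i
    ...   | a≢b , b≢c , a≢c = trans (ι-∨₃ _ _ _ (shared a≢b a∈ b∈) (shared a≢c a∈ c∈) (shared b≢c b∈ c∈))
                                    (sym (ℤP.+-identityʳ _))
      where
      a∈ : proj₁ (block i) ∈B i
      a∈ = inj₁ refl
      b∈ : proj₁ (proj₂ (block i)) ∈B i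
      b∈ = inj₂ (inj₁ refl)
      c∈ : proj₂ (proj₂ (block i)) ∈B i
      c∈ = inj₂ (inj₂ refl)
      shared : ∀ {x y} → x ≢ y → x ∈B i → y ∈B i → inB? x j ≡ true → inB? y j ≡ true → ⊥
      shared x≢y x∈i y∈i x∈j y∈j = i≢j (unique i j x≢y x∈i y∈i (inB?⇒∈B x∈j) (inB?⇒∈B y∈j))

    [A+3I]u≡Wᵀ[Wu] : ∀ (u : Fin nb → ℤ) i →
      Σℤ (λ j → A i j * u j) + + 3 * u i ≡ Σ₃ (λ x → Σℤ (λ j → W x j * u j)) (block i)
    [A+3I]u≡Wᵀ[Wu] u i = sym (begin
      Σℤ (λ j → W a j * u j) + Σℤ (λ j → W b j * u j) + Σℤ (λ j → W c j * u j)
        ≡⟨ cong (_+ Σℤ (λ j → W c j * u j)) (Σℤ-+ (λ j → W a j * u j) (λ j → W b j * u j)) ⟨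
      Σℤ (λ j → W a j * u j + W b j * u j) + Σℤ (λ j → W c j * u j)
        ≡⟨ Σℤ-+ (λ j → W a j * u j + W b j * u j) (λ j → W c j * u j) ⟨
      Σℤ (λ j → W a j * u j + W b j * u j + W c j * u j)
        ≡⟨ Σℤ-cong (λ j → regroup (W a j) (W b j) (W c j) (u j)) ⟩
      Σℤ (λ j → Σ₃ (λ x → W x j) (block i) * u j)
        ≡⟨ Σℤ-cong (λ j → cong (_* u j) (incidence i j)) ⟩
      Σℤ (λ j → (A i j + + 3 * ι (does (i ≟ j))) * u j)
        ≡⟨ Σℤ-cong (λ j → expand (A i j) (ι (does (i ≟ j))) (u j)) ⟩
      Σℤ (λ j → A i j * u j + + 3 * (ι (does (i ≟ j)) * u j))
        ≡⟨ Σℤ-+ (λ j → A i j * u j) _ ⟩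
      Σℤ (λ j → A i j * u j) + Σℤ (λ j → + 3 * (ι (does (i ≟ j)) * u j))
        ≡⟨ cong (_+_ (Σℤ (λ j → A i j * u j))) (trans (Σℤ-* (+ 3) (λ j → ι (does (i ≟ j)) * u j)) (cong (+ 3 *_) (Σℤ-indicator i u))) ⟩
      Σℤ (λ j → A i j * u j) + + 3 * u i ∎)
      where
      open ≡-Reasoning
      a b c : Pt
      a = proj₁ (block i)
      b = proj₁ (proj₂ (block i))
      c = proj₂ (proj₂ (block i))
      regroup : ∀ p q r x → p * x + q * x + r * x ≡ (p + q + r) * x
      regroup = solve-∀
      expand : ∀ p d x → (p + + 3 * d) * x ≡ p * x + + 3 * (d * x)
      expand = solve-∀

    flow⇒θ₂Eigvec : ∀ u → InKernelW u → θ₂Eigvec u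
    flow⇒θ₂Eigvec u Wu≡0 i = begin
      Σℤ (λ j → A i j * u j)                              ≡⟨ move (Σℤ (λ j → A i j * u j)) (u i) ⟩
      Σℤ (λ j → A i j * u j) + + 3 * u i - + 3 * u i      ≡⟨ cong (_- + 3 * u i) ([A+3I]u≡Wᵀ[Wu] u i) ⟩
      Σ₃ (λ x → Σℤ (λ j → W x j * u j)) (block i) - + 3 * u i
        ≡⟨ cong (_- + 3 * u i) (cong₂ _+_ (cong₂ _+_ (Wu≡0 _) (Wu≡0 _)) (Wu≡0 _)) ⟩
      + 0 - + 3 * u i                                     ≡⟨ negate (u i) ⟩
      - (+ 3) * u i ∎
      where
      open ≡-Reasoning
      move : ∀ s x → s ≡ s + + 3 * x - + 3 * x
      move = solve-∀
      negate : ∀ x → + 0 - + 3 * x ≡ - (+ 3) * x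
      negate = solve-∀

    degree+3 : ∀ i → Σℤ (A i) + + 3 ≡ Σ₃ (λ x → Σℤ (W x)) (block i)
    degree+3 i = begin
      Σℤ (A i) + + 3                               ≡⟨ cong₂ _+_ (Σℤ-cong (λ j → ℤP.*-identityʳ (A i j))) refl ⟨
      Σℤ (λ j → A i j * + 1) + + 3 * + 1           ≡⟨ [A+3I]u≡Wᵀ[Wu] (λ _ → + 1) i ⟩
      Σ₃ (λ x → Σℤ (λ j → W x j * + 1)) (block i)
        ≡⟨ Σ₃-cong (λ x → Σℤ-cong (λ j → ℤP.*-identityʳ (W x j))) (block i) ⟩
      Σ₃ (λ x → Σℤ (W x)) (block i) ∎
      where open ≡-Reasoning

  linear-from-pair-count :
    (∀ i → Distinct (block i)) →
    (∀ i {x y} → x ≢ y → x ∈B i → y ∈B i → Σℤ (λ k → ι (inB? x k ∧ inB? y k)) ≡ + 1) →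
    IsLinear
  linear-from-pair-count distinct count = record
    { distinct = distinct
    ; unique   = λ i j x≢y x∈i y∈i x∈j y∈j →
        Σℤ-ι≡1⇒unique _ (count i x≢y x∈i y∈i) (both x∈i y∈i) (both x∈j y∈j)
    }
    where
    both : ∀ {x y k} → x ∈B k → y ∈B k → (inB? x k ∧ inB? y k) ≡ true
    both x∈ y∈ rewrite ∈B⇒inB? x∈ | ∈B⇒inB? y∈ = refl

  no-±1-θ₂Eigvec : ∀ i → + 2 ∣ℤ Σℤ (A i) → ∀ u → (∀ j → u j ≡ + 1 ⊎ u j ≡ - + 1) → ¬ θ₂Eigvec u
  no-±1-θ₂Eigvec i 2∣deg u ±1 eig =
    odd (subst (+ 2 ∣ℤ_) (eig i) (Σℤ-sign-parity (A i) u ±1 2∣deg))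
    where
    odd : ¬ (+ 2 ∣ℤ - (+ 3) * u i)
    odd with ±1 i
    ... | inj₁ ui≡1  rewrite ui≡1  = from-no (2 ℕ∣.∣? 3) ∘ ℤ∣.∣⇒∣ᵤ
    ... | inj₂ ui≡-1 rewrite ui≡-1 = from-no (2 ℕ∣.∣? 3) ∘ ℤ∣.∣⇒∣ᵤ

  flow₃⊎flow₂ : Fin nb → ∀ u → (∀ j → AbsOneOrTwo (u j)) → InKernelW u → HasFlow 3 ⊎ HasFlow 2
  flow₃⊎flow₂ i u values Wu≡0 =
    from-norm ‖ u ‖∞ refl (maxℕ-lub (λ j → ∣ u j ∣) (λ j → AbsOneOrTwo⇒≤2 {u j} (values j)))
              (ℕP.≤-trans (AbsOneOrTwo⇒1≤ {u i} (values i)) (maxℕ-upper (λ j → ∣ u j ∣) i))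
    where
    u≢0 : NowhereZero u
    u≢0 j = AbsOneOrTwo⇒≢0 {u j} (values j)
    from-norm : ∀ n → ‖ u ‖∞ ≡ n → n ≤ 2 → 1 ≤ n → HasFlow 3 ⊎ HasFlow 2
    from-norm 1 ‖u‖≡n _ _ = inj₂ (u , u≢0 , Wu≡0 , cong suc ‖u‖≡n)
    from-norm 2 ‖u‖≡n _ _ = inj₁ (u , u≢0 , Wu≡0 , cong suc ‖u‖≡n)
    from-norm (suc (suc (suc n))) _ (s≤s (s≤s ())) _

module Hamming where

  V : ℕ → Set
  V = Vec Bool

  module _ {r : ℕ} where

    0v : V r
    0v = replicate r false

    ⊕-comm : ∀ (x y : V r) → x ⊕ y ≡ y ⊕ x
    ⊕-comm = VecP.zipWith-comm xor-comm

    ⊕-assoc : ∀ (x y z : V r) → (x ⊕ y) ⊕ z ≡ x ⊕ (y ⊕ z)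
    ⊕-assoc = VecP.zipWith-assoc xor-assoc

    ⊕-identityʳ : ∀ (x : V r) → x ⊕ 0v ≡ x
    ⊕-identityʳ = VecP.zipWith-identityʳ xor-identityʳ

    ⊕-identityˡ : ∀ (x : V r) → 0v ⊕ x ≡ x
    ⊕-identityˡ = VecP.zipWith-identityˡ xor-identityˡ

  ⊕-self : ∀ {r} (x : V r) → x ⊕ x ≡ 0v
  ⊕-self []      = refl
  ⊕-self (b ∷ x) = cong₂ _∷_ (xor-same b) (⊕-self x)

  module _ {r : ℕ} where

    ⊕-cancelˡ : ∀ (x y : V r) → x ⊕ (x ⊕ y) ≡ y
    ⊕-cancelˡ x y = begin
      x ⊕ (x ⊕ y)  ≡⟨ ⊕-assoc x x y ⟨
      (x ⊕ x) ⊕ y  ≡⟨ cong (_⊕ y) (⊕-self x) ⟩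
      0v ⊕ y       ≡⟨ ⊕-identityˡ y ⟩
      y ∎
      where open ≡-Reasoning

    ⊕-cancelʳ : ∀ (x y : V r) → (x ⊕ y) ⊕ y ≡ x
    ⊕-cancelʳ x y = trans (⊕-comm (x ⊕ y) y) (trans (cong (y ⊕_) (⊕-comm x y)) (⊕-cancelˡ y x))

    ⊕-cancelʳ′ : ∀ (x y : V r) → (x ⊕ y) ⊕ x ≡ y
    ⊕-cancelʳ′ x y = trans (cong (_⊕ x) (⊕-comm x y)) (⊕-cancelʳ y x)

    ⊕-cancelˡ′ : ∀ (x y : V r) → y ⊕ (x ⊕ y) ≡ x
    ⊕-cancelˡ′ x y = trans (⊕-comm y (x ⊕ y)) (⊕-cancelʳ x y)

    ⊕≡0⇒≡ : ∀ {x y : V r} → x ⊕ y ≡ 0v → x ≡ y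
    ⊕≡0⇒≡ {x} {y} x⊕y≡0 = trans (sym (⊕-cancelʳ x y)) (trans (cong (_⊕ y) x⊕y≡0) (⊕-identityˡ y))

    infix 4 _==_
    _==_ : V r → V r → Bool
    x == y = does (VecP.≡-dec Bool._≟_ x y)

    ==-refl : ∀ x → (x == x) ≡ true
    ==-refl x = dec-true (VecP.≡-dec Bool._≟_ x x) refl

    ≢⇒==false : ∀ {x y} → x ≢ y → (x == y) ≡ false
    ≢⇒==false {x} {y} = dec-false (VecP.≡-dec Bool._≟_ x y)

    ==⇒≡ : ∀ x y → (x == y) ≡ true → x ≡ y
    ==⇒≡ x y x==y with VecP.≡-dec Bool._≟_ x y
    ... | yes x≡y = x≡y

    ==-sym : ∀ x y → (x == y) ≡ (y == x)
    ==-sym x y with VecP.≡-dec Bool._≟_ x y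
    ... | yes refl = sym (==-refl x)
    ... | no x≢y   = sym (≢⇒==false (x≢y ∘ sym))

    valid : V r → V r → Bool
    valid x y = not (x == 0v) ∧ not (y == 0v) ∧ not (x == y)

    Valid : V r → V r → Set
    Valid x y = x ≢ 0v × y ≢ 0v × x ≢ y

    valid⇒Valid : ∀ {x y} → valid x y ≡ true → Valid x y
    valid⇒Valid {x} {y} v with x == 0v in x0 | y == 0v in y0 | x == y in xy
    ... | false | false | false = x0≢ , y0≢ , xy≢
      where
      x0≢ : x ≢ 0v
      x0≢ e = contradiction (trans (sym (==-refl x)) (trans (cong (x ==_) e) x0)) λ ()
      y0≢ : y ≢ 0v
      y0≢ e = contradiction (trans (sym (==-refl y)) (trans (cong (y ==_) e) y0)) λ ()
      xy≢ : x ≢ y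
      xy≢ e = contradiction (trans (sym (==-refl x)) (trans (cong (x ==_) e) xy)) λ ()

    Valid⇒valid : ∀ {x y} → Valid x y → valid x y ≡ true
    Valid⇒valid (x≢0 , y≢0 , x≢y) rewrite ≢⇒==false x≢0 | ≢⇒==false y≢0 | ≢⇒==false x≢y = refl

    valid-sym : ∀ x y → valid x y ≡ valid y x
    valid-sym x y rewrite ==-sym x y with x == 0v | y == 0v
    ... | true  | true  = refl
    ... | true  | false = refl
    ... | false | true  = refl
    ... | false | false = refl

    x≢x⊕y : ∀ {x y : V r} → y ≢ 0v → x ≢ x ⊕ y
    x≢x⊕y {x} {y} y≢0 x≡x⊕y = y≢0 (begin
      y            ≡⟨ ⊕-cancelˡ x y ⟨
      x ⊕ (x ⊕ y)  ≡⟨ cong (x ⊕_) x≡x⊕y ⟨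
      x ⊕ x        ≡⟨ ⊕-self x ⟩
      0v ∎)
      where open ≡-Reasoning

    y≢x⊕y : ∀ {x y : V r} → x ≢ 0v → y ≢ x ⊕ y
    y≢x⊕y {x} {y} x≢0 y≡x⊕y = x≢x⊕y x≢0 (trans y≡x⊕y (⊕-comm x y))

    Valid-shear : ∀ {x y} → Valid x y → Valid x (x ⊕ y)
    Valid-shear (x≢0 , y≢0 , x≢y) = x≢0 , x≢y ∘ ⊕≡0⇒≡ , x≢x⊕y y≢0

    valid-shear : ∀ x y → valid x (x ⊕ y) ≡ valid x y
    valid-shear x y with valid x y in v | valid x (x ⊕ y) in v′
    ... | true  | true  = refl
    ... | false | false = refl
    ... | true  | false = contradiction (trans (sym (Valid⇒valid {x} {x ⊕ y} (Valid-shear (valid⇒Valid {x} {y} v)))) v′) λ ()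
    ... | false | true  = contradiction (trans (sym (Valid⇒valid {x} {y} shear²)) v) λ ()
      where
      shear² : Valid x y
      shear² = subst (Valid x) (⊕-cancelˡ x y) (Valid-shear (valid⇒Valid {x} {x ⊕ y} v′))

  val-injective : ∀ {r} {x y : V r} → val x ≡ val y → x ≡ y
  val-injective {x = []}        {[]}        _ = refl
  val-injective {x = true ∷ x}  {true ∷ y}  e =
    cong (true ∷_) (val-injective (ℕP.*-cancelˡ-≡ _ _ 2 (ℕP.suc-injective e)))
  val-injective {x = false ∷ x} {false ∷ y} e = cong (false ∷_) (val-injective (ℕP.*-cancelˡ-≡ _ _ 2 e))
  val-injective {x = true ∷ x}  {false ∷ y} e = contradiction (sym e) (ℕP.even≢odd (val y) (val x))
  val-injective {x = false ∷ x} {true ∷ y}  e = contradiction e (ℕP.even≢odd (val x) (val y))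

  val-0v : ∀ {r} → val (0v {r}) ≡ 0
  val-0v {zero}  = refl
  val-0v {suc r} = cong (2 ℕ.*_) (val-0v {r})

  val-pos : ∀ {r} {x : V r} → x ≢ 0v → 0 < val x
  val-pos {r} {x} x≢0 with val x in vx
  ... | zero  = contradiction (val-injective (trans vx (sym (val-0v {r})))) x≢0
  ... | suc _ = s≤s z≤n

  sorted : ℕ → ℕ → ℕ → Bool
  sorted a b c = (0 <ᵇ a) ∧ (a <ᵇ b) ∧ (b <ᵇ c)

  exactly-one-sorting : ∀ {a b c} → 0 < a → 0 < b → 0 < c → a ≢ b → b ≢ c → a ≢ c →
    ι (sorted a b c) + ι (sorted b a c) + ι (sorted a c b) +
    ι (sorted c a b) + ι (sorted b c a) + ι (sorted c b a) ≡ + 1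
  exactly-one-sorting {a} {b} {c} 0<a 0<b 0<c a≢b b≢c a≢c
    rewrite <ᵇ-true 0<a | <ᵇ-true 0<b | <ᵇ-true 0<c
          | <ᵇ-flip a≢b | <ᵇ-flip b≢c | <ᵇ-flip a≢c
    = count (a <ᵇ b) (b <ᵇ c) (a <ᵇ c) (<ᵇ-trans {a} {b} {c}) descending
    where
    descending : not (a <ᵇ b) ≡ true → not (b <ᵇ c) ≡ true → not (a <ᵇ c) ≡ true
    descending b<a c<b = trans (sym (<ᵇ-flip a≢c))
      (<ᵇ-trans {c} {b} {a} (trans (<ᵇ-flip b≢c) c<b) (trans (<ᵇ-flip a≢b) b<a))
    count : ∀ p q s → (p ≡ true → q ≡ true → s ≡ true) → (not p ≡ true → not q ≡ true → not s ≡ true) →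
      ι (p ∧ q) + ι (not p ∧ s) + ι (s ∧ not q) + ι (not s ∧ p) + ι (q ∧ not s) + ι (not q ∧ not p) ≡ + 1
    count true  true  true  _ _ = refl
    count true  true  false t _ = contradiction (t refl refl) λ ()
    count true  false true  _ _ = refl
    count true  false false _ _ = refl
    count false true  true  _ _ = refl
    count false true  false _ _ = refl
    count false false true  _ d = contradiction (d refl refl) λ ()
    count false false false _ _ = refl

  Σᵥ : ∀ {r} → (V r → ℤ) → ℤ
  Σᵥ {r} f = ΣL f (allVecs r)

  module _ {r : ℕ} where

    Σᵥ-cong : ∀ {f g : V r → ℤ} → (∀ x → f x ≡ g x) → Σᵥ f ≡ Σᵥ g
    Σᵥ-cong f≗g = ΣL-cong f≗g (allVecs r)

    Σᵥ-+ : ∀ (f g : V r → ℤ) → Σᵥ (λ x → f x + g x) ≡ Σᵥ f + Σᵥ g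
    Σᵥ-+ f g = ΣL-+ f g (allVecs r)

    Σᵥ-* : ∀ c (f : V r → ℤ) → Σᵥ (λ x → c * f x) ≡ c * Σᵥ f
    Σᵥ-* c f = ΣL-* c f (allVecs r)

    Σᵥ-zero : Σᵥ {r} (λ _ → + 0) ≡ + 0
    Σᵥ-zero = ΣL-zero (allVecs r)

  Σᵥ-suc : ∀ {r} (f : V (suc r) → ℤ) → Σᵥ f ≡ Σᵥ (λ v → f (false ∷ v) + f (true ∷ v))
  Σᵥ-suc {r} f = trans (ΣL-concatMap f _ (allVecs r))
    (Σᵥ-cong (λ v → cong (_+_ (f (false ∷ v))) (ℤP.+-identityʳ (f (true ∷ v)))))

  Σᵥ-translate : ∀ {r} (a : V r) (f : V r → ℤ) → Σᵥ (λ v → f (v ⊕ a)) ≡ Σᵥ f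
  Σᵥ-translate []          f = refl
  Σᵥ-translate (false ∷ a) f = begin
    Σᵥ (λ v → f (v ⊕ (false ∷ a)))                     ≡⟨ Σᵥ-suc (λ v → f (v ⊕ (false ∷ a))) ⟩
    Σᵥ (λ v → f (false ∷ v ⊕ a) + f (true ∷ v ⊕ a))   ≡⟨ Σᵥ-translate a (λ w → f (false ∷ w) + f (true ∷ w)) ⟩
    Σᵥ (λ w → f (false ∷ w) + f (true ∷ w))           ≡⟨ Σᵥ-suc f ⟨
    Σᵥ f ∎
    where open ≡-Reasoning
  Σᵥ-translate (true ∷ a)  f = begin
    Σᵥ (λ v → f (v ⊕ (true ∷ a)))                      ≡⟨ Σᵥ-suc (λ v → f (v ⊕ (true ∷ a))) ⟩
    Σᵥ (λ v → f (true ∷ v ⊕ a) + f (false ∷ v ⊕ a))   ≡⟨ Σᵥ-cong (λ v → ℤP.+-comm (f (true ∷ v ⊕ a)) _) ⟩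
    Σᵥ (λ v → f (false ∷ v ⊕ a) + f (true ∷ v ⊕ a))   ≡⟨ Σᵥ-translate a (λ w → f (false ∷ w) + f (true ∷ w)) ⟩
    Σᵥ (λ w → f (false ∷ w) + f (true ∷ w))           ≡⟨ Σᵥ-suc f ⟨
    Σᵥ f ∎
    where open ≡-Reasoning

  Σᵥ-translateˡ : ∀ {r} (a : V r) (f : V r → ℤ) → Σᵥ (λ v → f (a ⊕ v)) ≡ Σᵥ f
  Σᵥ-translateˡ a f = trans (Σᵥ-cong (λ v → cong f (⊕-comm a v))) (Σᵥ-translate a f)

  Σᵥ-single : ∀ {r} (a : V r) (f : V r → ℤ) → (∀ v → v ≢ a → f v ≡ + 0) → Σᵥ f ≡ f a
  Σᵥ-single []          f vanish = ℤP.+-identityʳ (f [])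
  Σᵥ-single (false ∷ a) f vanish = begin
    Σᵥ f                                     ≡⟨ Σᵥ-suc f ⟩
    Σᵥ (λ v → f (false ∷ v) + f (true ∷ v))
      ≡⟨ Σᵥ-single a _ (λ v v≢a → cong₂ _+_ (vanish _ (v≢a ∘ VecP.∷-injectiveʳ)) (vanish _ λ ())) ⟩
    f (false ∷ a) + f (true ∷ a)             ≡⟨ cong (_+_ (f (false ∷ a))) (vanish _ λ ()) ⟩
    f (false ∷ a) + + 0                      ≡⟨ ℤP.+-identityʳ _ ⟩
    f (false ∷ a) ∎
    where open ≡-Reasoning
  Σᵥ-single (true ∷ a)  f vanish = begin
    Σᵥ f                                     ≡⟨ Σᵥ-suc f ⟩
    Σᵥ (λ v → f (false ∷ v) + f (true ∷ v))
      ≡⟨ Σᵥ-single a _ (λ v v≢a → cong₂ _+_ (vanish _ λ ()) (vanish _ (v≢a ∘ VecP.∷-injectiveʳ))) ⟩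
    f (false ∷ a) + f (true ∷ a)             ≡⟨ cong (_+ f (true ∷ a)) (vanish _ λ ()) ⟩
    + 0 + f (true ∷ a)                       ≡⟨ ℤP.+-identityˡ _ ⟩
    f (true ∷ a) ∎
    where open ≡-Reasoning

  Σᵥ-indicator : ∀ {r} (a : V r) (f : V r → ℤ) → Σᵥ (λ v → ι (v == a) * f v) ≡ f a
  Σᵥ-indicator a f = trans (Σᵥ-single a _ (λ v v≢a → cong (λ b → ι b * f v) (≢⇒==false v≢a)))
                   (trans (cong (λ b → ι b * f a) (==-refl a)) (ℤP.*-identityˡ (f a)))

  Σᵥ-one : ∀ r → Σᵥ {r} (λ _ → + 1) ≡ + (2 ^ r)
  Σᵥ-one zero    = refl
  Σᵥ-one (suc r) = begin
    Σᵥ {suc r} (λ _ → + 1)     ≡⟨ Σᵥ-suc {r} (λ _ → + 1) ⟩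
    Σᵥ {r} (λ _ → + 2 * + 1)   ≡⟨ Σᵥ-* {r} (+ 2) (λ _ → + 1) ⟩
    + 2 * Σᵥ {r} (λ _ → + 1)   ≡⟨ cong (+ 2 *_) (Σᵥ-one r) ⟩
    + 2 * + (2 ^ r)            ≡⟨ ℤP.pos-* 2 (2 ^ r) ⟨
    + (2 ^ suc r) ∎
    where open ≡-Reasoning

  Σᵥ-suc² : ∀ {r} (f : V (suc (suc r)) → ℤ) → Σᵥ f ≡
    Σᵥ (λ t → (f (false ∷ false ∷ t) + f (true ∷ false ∷ t)) + (f (false ∷ true ∷ t) + f (true ∷ true ∷ t)))
  Σᵥ-suc² {r} f = trans (Σᵥ-suc f) (Σᵥ-suc (λ v → f (false ∷ v) + f (true ∷ v)))

  Σᵥ-vanish : ∀ {r} {f : V r → ℤ} → (∀ x → f x ≡ + 0) → Σᵥ f ≡ + 0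
  Σᵥ-vanish {r} f≗0 = trans (Σᵥ-cong f≗0) (Σᵥ-zero {r})

  Σᵥ-suc²-vanish : ∀ {r} {f : V (suc (suc r)) → ℤ} →
    (∀ t → (f (false ∷ false ∷ t) + f (true ∷ false ∷ t)) + (f (false ∷ true ∷ t) + f (true ∷ true ∷ t)) ≡ + 0) →
    Σᵥ f ≡ + 0
  Σᵥ-suc²-vanish {r} {f} f≗0 = trans (Σᵥ-suc² f) (Σᵥ-vanish {r} f≗0)

  Σᵥ-sign-head : ∀ {r} → Σᵥ {suc r} (λ t → sign (Data.Vec.head t)) ≡ + 0
  Σᵥ-sign-head {r} = trans (Σᵥ-suc {r} (λ t → sign (Data.Vec.head t))) (Σᵥ-vanish {r} (λ _ → refl))

  module _ {r : ℕ} where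

    Σᵥ² : (V r → V r → ℤ) → ℤ
    Σᵥ² K = Σᵥ (λ x → Σᵥ (K x))

    Σᵥ²-cong : ∀ {K L : V r → V r → ℤ} → (∀ x y → K x y ≡ L x y) → Σᵥ² K ≡ Σᵥ² L
    Σᵥ²-cong K≗L = Σᵥ-cong (λ x → Σᵥ-cong (K≗L x))

    Σᵥ²-+ : ∀ (K L : V r → V r → ℤ) → Σᵥ² (λ x y → K x y + L x y) ≡ Σᵥ² K + Σᵥ² L
    Σᵥ²-+ K L = trans (Σᵥ-cong (λ x → Σᵥ-+ (K x) (L x))) (Σᵥ-+ (λ x → Σᵥ (K x)) (λ x → Σᵥ (L x)))

    Σᵥ²-swap : ∀ (K : V r → V r → ℤ) → Σᵥ² (λ x y → K y x) ≡ Σᵥ² K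
    Σᵥ²-swap K = ΣL-comm (λ x y → K y x) (allVecs r) (allVecs r)

    Σᵥ²-shear : ∀ (K : V r → V r → ℤ) → Σᵥ² (λ x y → K x (x ⊕ y)) ≡ Σᵥ² K
    Σᵥ²-shear K = Σᵥ-cong (λ x → Σᵥ-translateˡ x (K x))

    Σᵥ²-orbit : ∀ (H : V r → V r → ℤ) →
      Σᵥ² (λ x y → H x y + H y x + H x (x ⊕ y) + H (x ⊕ y) x + H y (x ⊕ y) + H (x ⊕ y) y) ≡ + 6 * Σᵥ² H
    Σᵥ²-orbit H = begin
      Σᵥ² (λ x y → H x y + H y x + H x (x ⊕ y) + H (x ⊕ y) x + H y (x ⊕ y) + H (x ⊕ y) y)
        ≡⟨ Σᵥ²-+ (λ x y → H x y + H y x + H x (x ⊕ y) + H (x ⊕ y) x + H y (x ⊕ y)) H₆ ⟩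
      Σᵥ² (λ x y → H x y + H y x + H x (x ⊕ y) + H (x ⊕ y) x + H y (x ⊕ y)) + Σᵥ² H₆
        ≡⟨ cong (_+ Σᵥ² H₆) (Σᵥ²-+ (λ x y → H x y + H y x + H x (x ⊕ y) + H (x ⊕ y) x) H₅) ⟩
      Σᵥ² (λ x y → H x y + H y x + H x (x ⊕ y) + H (x ⊕ y) x) + Σᵥ² H₅ + Σᵥ² H₆
        ≡⟨ cong (λ s → s + Σᵥ² H₅ + Σᵥ² H₆) (Σᵥ²-+ (λ x y → H x y + H y x + H x (x ⊕ y)) H₄) ⟩
      Σᵥ² (λ x y → H x y + H y x + H x (x ⊕ y)) + Σᵥ² H₄ + Σᵥ² H₅ + Σᵥ² H₆
        ≡⟨ cong (λ s → s + Σᵥ² H₄ + Σᵥ² H₅ + Σᵥ² H₆) (Σᵥ²-+ (λ x y → H x y + H y x) H₃) ⟩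
      Σᵥ² (λ x y → H x y + H y x) + Σᵥ² H₃ + Σᵥ² H₄ + Σᵥ² H₅ + Σᵥ² H₆
        ≡⟨ cong (λ s → s + Σᵥ² H₃ + Σᵥ² H₄ + Σᵥ² H₅ + Σᵥ² H₆) (Σᵥ²-+ H H₂) ⟩
      Σᵥ² H + Σᵥ² H₂ + Σᵥ² H₃ + Σᵥ² H₄ + Σᵥ² H₅ + Σᵥ² H₆
        ≡⟨ cong₂ _+_ (cong₂ _+_ (cong₂ _+_ (cong₂ _+_ (cong (_+_ (Σᵥ² H)) Σ₂) Σ₃) Σ₄) Σ₅) Σ₆ ⟩
      Σᵥ² H + Σᵥ² H + Σᵥ² H + Σᵥ² H + Σᵥ² H + Σᵥ² H
        ≡⟨ six-fold (Σᵥ² H) ⟩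
      + 6 * Σᵥ² H ∎
      where
      open ≡-Reasoning
      H₂ H₃ H₄ H₅ H₆ : V r → V r → ℤ
      H₂ x y = H y x
      H₃ x y = H x (x ⊕ y)
      H₄ x y = H (x ⊕ y) x
      H₅ x y = H y (x ⊕ y)
      H₆ x y = H (x ⊕ y) y
      Σ₂ : Σᵥ² H₂ ≡ Σᵥ² H
      Σ₂ = Σᵥ²-swap H
      Σ₃ : Σᵥ² H₃ ≡ Σᵥ² H
      Σ₃ = Σᵥ²-shear H
      Σ₄ : Σᵥ² H₄ ≡ Σᵥ² H
      Σ₄ = trans (Σᵥ²-shear (λ x y → H y x)) Σ₂
      Σ₅ : Σᵥ² H₅ ≡ Σᵥ² H
      Σ₅ = trans (Σᵥ²-swap (λ x y → H x (y ⊕ x)))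
                 (trans (Σᵥ²-cong (λ x y → cong (H x) (⊕-comm y x))) Σ₃)
      Σ₆ : Σᵥ² H₆ ≡ Σᵥ² H
      Σ₆ = trans (Σᵥ²-swap (λ x y → H (y ⊕ x) x))
                 (trans (Σᵥ²-cong (λ x y → cong (λ z → H z x) (⊕-comm y x))) Σ₄)
      six-fold : ∀ s → s + s + s + s + s + s ≡ + 6 * s
      six-fold = solve-∀

    increasing : V r → V r → Bool
    increasing x y = sorted (val x) (val y) (val (x ⊕ y))

    line : V r → V r → V r × V r × V r
    line x y = x , y , x ⊕ y

    ΣL-hammingBlocks : ∀ (F : V r × V r × V r → ℤ) →
      ΣL F (hammingBlocks r) ≡ Σᵥ² (λ x y → ι (increasing x y) * F (line x y))
    ΣL-hammingBlocks F = trans (ΣL-concatMap F _ (allVecs r)) (Σᵥ-cong λ x →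
      trans (ΣL-concatMap F _ (allVecs r)) (Σᵥ-cong λ y → ΣL-if F (increasing x y) (line x y)))

    increasing⇒Valid : ∀ {x y} → increasing x y ≡ true → Valid x y
    increasing⇒Valid {x} {y} incr with 0 <ᵇ val x in 0<ᵇx | val x <ᵇ val y in x<ᵇy
    ... | true  | true  = x≢0 , y≢0 , x≢y
      where
      0<x : 0 < val x
      0<x = <ᵇ-true⁻¹ 0<ᵇx
      x<y : val x < val y
      x<y = <ᵇ-true⁻¹ {val x} {val y} x<ᵇy
      x≢0 : x ≢ 0v
      x≢0 x≡0 = ℕP.<-irrefl (sym (trans (cong val x≡0) (val-0v {r}))) 0<x
      y≢0 : y ≢ 0v
      y≢0 y≡0 = ℕP.<-irrefl (sym (trans (cong val y≡0) (val-0v {r}))) (ℕP.<-trans 0<x x<y)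
      x≢y : x ≢ y
      x≢y x≡y = ℕP.<-irrefl (cong val x≡y) x<y
    ... | false | _     = contradiction incr λ ()
    ... | true  | false = contradiction incr λ ()

    ΣL-on-lines : ∀ {F G : V r × V r × V r → ℤ} →
                  (∀ x y → Valid x y → F (line x y) ≡ G (line x y)) →
                  ΣL F (hammingBlocks r) ≡ ΣL G (hammingBlocks r)
    ΣL-on-lines {F} {G} F≗G = begin
      ΣL F (hammingBlocks r)                                 ≡⟨ ΣL-hammingBlocks F ⟩
      Σᵥ² (λ x y → ι (increasing x y) * F (line x y))       ≡⟨ Σᵥ²-cong agree ⟩
      Σᵥ² (λ x y → ι (increasing x y) * G (line x y))       ≡⟨ ΣL-hammingBlocks G ⟨
      ΣL G (hammingBlocks r) ∎
      where
      open ≡-Reasoning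
      agree : ∀ x y → ι (increasing x y) * F (line x y) ≡ ι (increasing x y) * G (line x y)
      agree x y with increasing x y in incr
      ... | true  = cong (+ 1 *_) (F≗G x y (increasing⇒Valid incr))
      ... | false = trans (ℤP.*-zeroˡ (F (line x y))) (sym (ℤP.*-zeroˡ (G (line x y))))

    first-two : (V r → V r → ℤ) → V r × V r × V r → ℤ
    first-two g (x , y , _) = g x y

    exactly-one-increasing : ∀ {x y} → Valid x y →
      ι (increasing x y) + ι (increasing y x) + ι (increasing x (x ⊕ y)) +
      ι (increasing (x ⊕ y) x) + ι (increasing y (x ⊕ y)) + ι (increasing (x ⊕ y) y) ≡ + 1
    exactly-one-increasing {x} {y} (x≢0 , y≢0 , x≢y)
      rewrite ⊕-comm y x | ⊕-cancelˡ x y | ⊕-cancelʳ′ x y | ⊕-cancelˡ′ x y | ⊕-cancelʳ x y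
      = exactly-one-sorting (val-pos x≢0) (val-pos y≢0) (val-pos (x≢y ∘ ⊕≡0⇒≡))
          (x≢y ∘ val-injective) (y≢x⊕y x≢0 ∘ val-injective) (x≢x⊕y {x = x} y≢0 ∘ val-injective)

    record IsLineFunction (K : V r → V r → ℤ) : Set where
      field
        symmetric : ∀ x y → K x y ≡ K y x
        shear     : ∀ x y → K x y ≡ K x (x ⊕ y)
        off-lines : ∀ x y → valid x y ≡ false → K x y ≡ + 0

    Σ-pairs≡6Σ-lines : ∀ {K} → IsLineFunction K →
      Σᵥ² K ≡ + 6 * ΣL (first-two K) (hammingBlocks r)
    Σ-pairs≡6Σ-lines {K} isLF = begin
      Σᵥ² K                                                ≡⟨ Σᵥ²-cong orbit-decomposition ⟩
      Σᵥ² (λ x y → H x y + H y x + H x (x ⊕ y) + H (x ⊕ y) x + H y (x ⊕ y) + H (x ⊕ y) y)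
                                                           ≡⟨ Σᵥ²-orbit H ⟩
      + 6 * Σᵥ² H                                          ≡⟨ cong (+ 6 *_) (ΣL-hammingBlocks _) ⟨
      + 6 * ΣL (first-two K) (hammingBlocks r) ∎
      where
      open ≡-Reasoning
      open IsLineFunction isLF
      H : V r → V r → ℤ
      H x y = ι (increasing x y) * K x y
      multiplicity : V r → V r → ℤ
      multiplicity x y = ι (increasing x y) + ι (increasing y x) + ι (increasing x (x ⊕ y)) +
                         ι (increasing (x ⊕ y) x) + ι (increasing y (x ⊕ y)) + ι (increasing (x ⊕ y) y)
      factor : ∀ x y → H x y + H y x + H x (x ⊕ y) + H (x ⊕ y) x + H y (x ⊕ y) + H (x ⊕ y) y ≡
                       multiplicity x y * K x y
      factor x y = begin
        H x y + H y x + H x (x ⊕ y) + H (x ⊕ y) x + H y (x ⊕ y) + H (x ⊕ y) y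
          ≡⟨ cong₂ _+_ (cong₂ _+_ (cong₂ _+_ (cong₂ _+_ (cong (_+_ (H x y)) (weigh y x K₂))
                         (weigh x (x ⊕ y) K₃)) (weigh (x ⊕ y) x K₄)) (weigh y (x ⊕ y) K₅)) (weigh (x ⊕ y) y K₆) ⟩
        ι₁ * K x y + ι₂ * K x y + ι₃ * K x y + ι₄ * K x y + ι₅ * K x y + ι₆ * K x y
          ≡⟨ distrib ι₁ ι₂ ι₃ ι₄ ι₅ ι₆ (K x y) ⟩
        (ι₁ + ι₂ + ι₃ + ι₄ + ι₅ + ι₆) * K x y ∎
        where
        ι₁ ι₂ ι₃ ι₄ ι₅ ι₆ : ℤ
        ι₁ = ι (increasing x y)
        ι₂ = ι (increasing y x)
        ι₃ = ι (increasing x (x ⊕ y))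
        ι₄ = ι (increasing (x ⊕ y) x)
        ι₅ = ι (increasing y (x ⊕ y))
        ι₆ = ι (increasing (x ⊕ y) y)
        weigh : ∀ a b → K a b ≡ K x y → H a b ≡ ι (increasing a b) * K x y
        weigh a b = cong (ι (increasing a b) *_)
        K₂ : K y x ≡ K x y
        K₂ = sym (symmetric x y)
        K₃ : K x (x ⊕ y) ≡ K x y
        K₃ = sym (shear x y)
        K₄ : K (x ⊕ y) x ≡ K x y
        K₄ = trans (symmetric (x ⊕ y) x) K₃
        K₅ : K y (x ⊕ y) ≡ K x y
        K₅ = trans (shear y (x ⊕ y)) (trans (cong (K y) (⊕-cancelˡ′ x y)) K₂)
        K₆ : K (x ⊕ y) y ≡ K x y
        K₆ = trans (symmetric (x ⊕ y) y) K₅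
        distrib : ∀ a b c d e f k → a * k + b * k + c * k + d * k + e * k + f * k ≡ (a + b + c + d + e + f) * k
        distrib = solve-∀
      orbit-decomposition : ∀ x y → K x y ≡ H x y + H y x + H x (x ⊕ y) + H (x ⊕ y) x + H y (x ⊕ y) + H (x ⊕ y) y
      orbit-decomposition x y with valid x y in v
      ... | true  = sym (trans (factor x y) (trans (cong (_* K x y) (exactly-one-increasing (valid⇒Valid {x = x} {y = y} v)))
                                                   (ℤP.*-identityˡ (K x y))))
      ... | false = trans (off-lines x y v)
                          (sym (trans (factor x y) (trans (cong (multiplicity x y *_) (off-lines x y v))
                                                        (ℤP.*-zeroʳ (multiplicity x y)))))

  module _ {r : ℕ} where

    infix 7 _∈ᵗ_
    _∈ᵗ_ : V r → V r × V r × V r → Bool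
    z ∈ᵗ (a , b , c) = (z == a) ∨ (z == b) ∨ (z == c)

    OnLine : V r → V r → V r → Set
    OnLine z x y = z ≡ x ⊎ z ≡ y ⊎ z ≡ x ⊕ y

    ∈ᵗ⇒OnLine : ∀ {z x y} → (z ∈ᵗ line x y) ≡ true → OnLine z x y
    ∈ᵗ⇒OnLine {z} {x} {y} z∈ with z == x in e₁ | z == y in e₂ | z == x ⊕ y in e₃
    ... | true  | _     | _    = inj₁ (==⇒≡ z x e₁)
    ... | false | true  | _    = inj₂ (inj₁ (==⇒≡ z y e₂))
    ... | false | false | true = inj₂ (inj₂ (==⇒≡ z (x ⊕ y) e₃))

    OnLine⇒∈ᵗ : ∀ {z x y} → OnLine z x y → (z ∈ᵗ line x y) ≡ true
    OnLine⇒∈ᵗ {z} {x} {y} = any-true ∘ Sum.map ≡⇒== (Sum.map ≡⇒== ≡⇒==)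
      where
      ≡⇒== : ∀ {a b : V r} → a ≡ b → (a == b) ≡ true
      ≡⇒== {a} refl = ==-refl a
      any-true : ∀ {p q s} → p ≡ true ⊎ q ≡ true ⊎ s ≡ true → (p ∨ q ∨ s) ≡ true
      any-true (inj₁ refl)                = refl
      any-true {p} (inj₂ (inj₁ refl))     = ∨-zeroʳ p
      any-true {p} {q} (inj₂ (inj₂ refl)) = trans (cong (p ∨_) (∨-zeroʳ q)) (∨-zeroʳ p)

    ι-∈ᵗ : ∀ {z a b c} → a ≢ b → b ≢ c → a ≢ c → ι (z ∈ᵗ (a , b , c)) ≡ ι (z == a) + ι (z == b) + ι (z == c)
    ι-∈ᵗ {z} {a} {b} {c} a≢b b≢c a≢c with z == a in e₁ | z == b in e₂ | z == c in e₃
    ... | true  | true  | _     = contradiction (trans (sym (==⇒≡ z a e₁)) (==⇒≡ z b e₂)) a≢b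
    ... | true  | false | true  = contradiction (trans (sym (==⇒≡ z a e₁)) (==⇒≡ z c e₃)) a≢c
    ... | false | true  | true  = contradiction (trans (sym (==⇒≡ z b e₂)) (==⇒≡ z c e₃)) b≢c
    ... | true  | false | false = refl
    ... | false | true  | false = refl
    ... | false | false | true  = refl
    ... | false | false | false = refl

    ∈ᵗ-line-sym : ∀ z x y → (z ∈ᵗ line y x) ≡ (z ∈ᵗ line x y)
    ∈ᵗ-line-sym z x y rewrite ⊕-comm y x = sym (∨-swap (z == x) (z == y) (z == x ⊕ y))
      where
      ∨-swap : ∀ p q s → (p ∨ q ∨ s) ≡ (q ∨ p ∨ s)
      ∨-swap p q s = trans (sym (∨-assoc p q s)) (trans (cong (_∨ s) (∨-comm p q)) (∨-assoc q p s))

    ∈ᵗ-line-shear : ∀ z x y → (z ∈ᵗ line x (x ⊕ y)) ≡ (z ∈ᵗ line x y)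
    ∈ᵗ-line-shear z x y rewrite ⊕-cancelˡ x y = cong ((z == x) ∨_) (∨-comm (z == x ⊕ y) (z == y))

    Valid⇒Distinct : ∀ {x y : V r} → Valid x y → x ≢ y × y ≢ x ⊕ y × x ≢ x ⊕ y
    Valid⇒Distinct (x≢0 , y≢0 , x≢y) = x≢y , y≢x⊕y x≢0 , x≢x⊕y y≢0

    line-through-two : ∀ {a b x y} → x ≢ y → OnLine x a b → OnLine y a b → OnLine a x y × OnLine b x y
    line-through-two x≢y (inj₁ refl)        (inj₁ refl)        = contradiction refl x≢y
    line-through-two _   (inj₁ refl)        (inj₂ (inj₁ refl)) = inj₁ refl , inj₂ (inj₁ refl)
    line-through-two _   (inj₁ refl)        (inj₂ (inj₂ refl)) = inj₁ refl , inj₂ (inj₂ (sym (⊕-cancelˡ _ _)))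
    line-through-two _   (inj₂ (inj₁ refl)) (inj₁ refl)        = inj₂ (inj₁ refl) , inj₁ refl
    line-through-two x≢y (inj₂ (inj₁ refl)) (inj₂ (inj₁ refl)) = contradiction refl x≢y
    line-through-two _   (inj₂ (inj₁ refl)) (inj₂ (inj₂ refl)) = inj₂ (inj₂ (sym (⊕-cancelˡ′ _ _))) , inj₁ refl
    line-through-two _   (inj₂ (inj₂ refl)) (inj₁ refl)        = inj₂ (inj₁ refl) , inj₂ (inj₂ (sym (⊕-cancelʳ′ _ _)))
    line-through-two _   (inj₂ (inj₂ refl)) (inj₂ (inj₁ refl)) = inj₂ (inj₂ (sym (⊕-cancelʳ _ _))) , inj₂ (inj₁ refl)
    line-through-two x≢y (inj₂ (inj₂ refl)) (inj₂ (inj₂ refl)) = contradiction refl x≢y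

    pair-on-line-sym : ∀ {a b x y} → a ≢ b → x ≢ y →
      (x ∈ᵗ line a b ∧ y ∈ᵗ line a b) ≡ (a ∈ᵗ line x y ∧ b ∈ᵗ line x y)
    pair-on-line-sym a≢b x≢y = ⇔→≡ (mk⇔ (both-on-line x≢y) (both-on-line a≢b))
      where
      both-on-line : ∀ {a b x y} → x ≢ y →
        (x ∈ᵗ line a b ∧ y ∈ᵗ line a b) ≡ true → (a ∈ᵗ line x y ∧ b ∈ᵗ line x y) ≡ true
      both-on-line x≢y xy∈ with line-through-two x≢y (∈ᵗ⇒OnLine (∧-conicalˡ _ _ xy∈)) (∈ᵗ⇒OnLine (∧-conicalʳ _ _ xy∈))
      ... | a∈ , b∈ = cong₂ _∧_ (OnLine⇒∈ᵗ a∈) (OnLine⇒∈ᵗ b∈)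

    lines-through : ∀ {g} → IsLineFunction g → ∀ z →
      + 2 * ΣL (λ t → ι (z ∈ᵗ t) * first-two g t) (hammingBlocks r) ≡ Σᵥ (g z)
    lines-through {g} isLF z = ℤP.*-cancelˡ-≡ (+ 3) _ _ (begin
      + 3 * (+ 2 * ΣL (λ t → ι (z ∈ᵗ t) * first-two g t) (hammingBlocks r))
        ≡⟨ ℤP.*-assoc (+ 3) (+ 2) _ ⟨
      + 6 * ΣL (λ t → ι (z ∈ᵗ t) * first-two g t) (hammingBlocks r)
        ≡⟨ cong (+ 6 *_) (ΣL-on-lines {F = λ t → ι (z ∈ᵗ t) * first-two g t} {G = first-two K} (λ x y _ → refl)) ⟩
      + 6 * ΣL (first-two K) (hammingBlocks r)
        ≡⟨ Σ-pairs≡6Σ-lines isLF-K ⟨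
      Σᵥ² K
        ≡⟨ Σᵥ²-cong split ⟩
      Σᵥ² (λ x y → ι (z == x) * g x y + ι (z == y) * g x y + ι (z == x ⊕ y) * g x y)
        ≡⟨ trans (Σᵥ²-+ _ T₃) (cong (_+ Σᵥ² T₃) (Σᵥ²-+ T₁ T₂)) ⟩
      Σᵥ² T₁ + Σᵥ² T₂ + Σᵥ² T₃
        ≡⟨ cong₂ _+_ (cong₂ _+_ ΣT₁ ΣT₂) ΣT₃ ⟩
      Σᵥ (g z) + Σᵥ (g z) + Σᵥ (g z)
        ≡⟨ thrice (Σᵥ (g z)) ⟩
      + 3 * Σᵥ (g z) ∎)
      where
      open ≡-Reasoning
      open IsLineFunction isLF
      K T₁ T₂ T₃ : V r → V r → ℤ
      K  x y = ι (z ∈ᵗ line x y) * g x y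
      T₁ x y = ι (z == x) * g x y
      T₂ x y = ι (z == y) * g x y
      T₃ x y = ι (z == x ⊕ y) * g x y
      isLF-K : IsLineFunction K
      isLF-K = record
        { symmetric = λ x y → cong₂ (λ b w → ι b * w) (sym (∈ᵗ-line-sym z x y)) (symmetric x y)
        ; shear     = λ x y → cong₂ (λ b w → ι b * w) (sym (∈ᵗ-line-shear z x y)) (shear x y)
        ; off-lines = λ x y v → trans (cong (ι (z ∈ᵗ line x y) *_) (off-lines x y v)) (ℤP.*-zeroʳ (ι (z ∈ᵗ line x y)))
        }
      split : ∀ x y → K x y ≡ T₁ x y + T₂ x y + T₃ x y
      split x y with valid x y in v
      ... | true  = let (x≢y , y≢x⊕y , x≢x⊕y) = Valid⇒Distinct (valid⇒Valid {x = x} {y = y} v) in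
        trans (cong (_* g x y) (ι-∈ᵗ {z = z} x≢y y≢x⊕y x≢x⊕y)) (distrib (ι (z == x)) (ι (z == y)) (ι (z == x ⊕ y)) (g x y))
        where
        distrib : ∀ a b c w → (a + b + c) * w ≡ a * w + b * w + c * w
        distrib = solve-∀
      ... | false rewrite off-lines x y v =
        trans (ℤP.*-zeroʳ (ι (z ∈ᵗ line x y))) (sym (vanish (ι (z == x)) (ι (z == y)) (ι (z == x ⊕ y))))
        where
        vanish : ∀ a b c → a * + 0 + b * + 0 + c * + 0 ≡ + 0
        vanish = solve-∀
      ΣT₁ : Σᵥ² T₁ ≡ Σᵥ (g z)
      ΣT₁ = trans (Σᵥ-cong (λ x → trans (Σᵥ-* (ι (z == x)) (g x)) (cong (λ b → ι b * Σᵥ (g x)) (==-sym z x))))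
                  (Σᵥ-indicator z (λ x → Σᵥ (g x)))
      ΣT₂ : Σᵥ² T₂ ≡ Σᵥ (g z)
      ΣT₂ = trans (sym (Σᵥ²-swap T₂)) (trans (Σᵥ²-cong (λ x y → cong (ι (z == x) *_) (symmetric y x))) ΣT₁)
      ΣT₃ : Σᵥ² T₃ ≡ Σᵥ (g z)
      ΣT₃ = trans (Σᵥ²-cong (λ x y → cong (ι (z == x ⊕ y) *_) (shear x y))) (trans (Σᵥ²-shear T₂) ΣT₂)
      thrice : ∀ s → s + s + s ≡ + 3 * s
      thrice = solve-∀

    Σ-over-line : ∀ {x y} → Valid x y → ∀ (f : V r → ℤ) →
                  Σᵥ (λ b → ι (b ∈ᵗ line x y) * f b) ≡ f x + f y + f (x ⊕ y)
    Σ-over-line {x} {y} xy f = begin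
      Σᵥ (λ b → ι (b ∈ᵗ line x y) * f b)
        ≡⟨ Σᵥ-cong split ⟩
      Σᵥ (λ b → ι (b == x) * f b + ι (b == y) * f b + ι (b == x ⊕ y) * f b)
        ≡⟨ trans (Σᵥ-+ (λ b → ι (b == x) * f b + ι (b == y) * f b) (λ b → ι (b == x ⊕ y) * f b))
                 (cong (_+ Σᵥ (λ b → ι (b == x ⊕ y) * f b)) (Σᵥ-+ (λ b → ι (b == x) * f b) (λ b → ι (b == y) * f b))) ⟩
      Σᵥ (λ b → ι (b == x) * f b) + Σᵥ (λ b → ι (b == y) * f b) + Σᵥ (λ b → ι (b == x ⊕ y) * f b)
        ≡⟨ cong₂ _+_ (cong₂ _+_ (Σᵥ-indicator x f) (Σᵥ-indicator y f)) (Σᵥ-indicator (x ⊕ y) f) ⟩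
      f x + f y + f (x ⊕ y) ∎
      where
      open ≡-Reasoning
      split : ∀ b → ι (b ∈ᵗ line x y) * f b ≡ ι (b == x) * f b + ι (b == y) * f b + ι (b == x ⊕ y) * f b
      split b = let (x≢y , y≢x⊕y , x≢x⊕y) = Valid⇒Distinct xy in
        trans (cong (_* f b) (ι-∈ᵗ {z = b} x≢y y≢x⊕y x≢x⊕y)) (distrib (ι (b == x)) (ι (b == y)) (ι (b == x ⊕ y)) (f b))
        where
        distrib : ∀ a b c w → (a + b + c) * w ≡ a * w + b * w + c * w
        distrib = solve-∀

    valid-irrefl : ∀ (x : V r) → valid x x ≡ false
    valid-irrefl x with x == 0v
    ... | true  = refl
    ... | false rewrite ==-refl x = refl

    lines-through-pair : ∀ {x y} → Valid x y → ΣL (λ t → ι (x ∈ᵗ t ∧ y ∈ᵗ t)) (hammingBlocks r) ≡ + 1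
    lines-through-pair {x} {y} xy = ℤP.*-cancelˡ-≡ (+ 6) _ (+ 1) (begin
      + 6 * ΣL (λ t → ι (x ∈ᵗ t ∧ y ∈ᵗ t)) (hammingBlocks r)
        ≡⟨ cong (+ 6 *_) (ΣL-on-lines {F = λ t → ι (x ∈ᵗ t ∧ y ∈ᵗ t)} {G = first-two K} on-lines) ⟩
      + 6 * ΣL (first-two K) (hammingBlocks r)
        ≡⟨ Σ-pairs≡6Σ-lines isLF-K ⟨
      Σᵥ² K
        ≡⟨ Σᵥ²-cong factor ⟩
      Σᵥ² (λ a b → ι (a ∈ᵗ ℓ) * (ι (b ∈ᵗ ℓ) * ι (valid a b)))
        ≡⟨ Σᵥ-cong (λ a → Σᵥ-* (ι (a ∈ᵗ ℓ)) (λ b → ι (b ∈ᵗ ℓ) * ι (valid a b))) ⟩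
      Σᵥ (λ a → ι (a ∈ᵗ ℓ) * Σᵥ (λ b → ι (b ∈ᵗ ℓ) * ι (valid a b)))
        ≡⟨ trans (Σ-over-line xy _) (cong₂ _+_ (cong₂ _+_ (Σ-over-line xy _) (Σ-over-line xy _)) (Σ-over-line xy _)) ⟩
      (ι (valid x x) + ι (valid x y) + ι (valid x (x ⊕ y))) +
      (ι (valid y x) + ι (valid y y) + ι (valid y (x ⊕ y))) +
      (ι (valid (x ⊕ y) x) + ι (valid (x ⊕ y) y) + ι (valid (x ⊕ y) (x ⊕ y)))
        ≡⟨ six-valid-pairs ⟩
      + 6 * + 1 ∎)
      where
      open ≡-Reasoning
      ℓ : V r × V r × V r
      ℓ = line x y
      K : V r → V r → ℤ
      K a b = ι (x ∈ᵗ line a b ∧ y ∈ᵗ line a b) * ι (valid a b)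
      isLF-K : IsLineFunction K
      isLF-K = record
        { symmetric = λ a b → cong₂ (λ p q → ι p * ι q)
            (sym (cong₂ _∧_ (∈ᵗ-line-sym x a b) (∈ᵗ-line-sym y a b))) (valid-sym a b)
        ; shear     = λ a b → cong₂ (λ p q → ι p * ι q)
            (sym (cong₂ _∧_ (∈ᵗ-line-shear x a b) (∈ᵗ-line-shear y a b))) (sym (valid-shear a b))
        ; off-lines = λ a b v → trans (cong (λ q → ι (x ∈ᵗ line a b ∧ y ∈ᵗ line a b) * ι q) v)
                                      (ℤP.*-zeroʳ (ι (x ∈ᵗ line a b ∧ y ∈ᵗ line a b)))
        }
      on-lines : ∀ a b → Valid a b → ι (x ∈ᵗ line a b ∧ y ∈ᵗ line a b) ≡ K a b
      on-lines a b ab rewrite Valid⇒valid {x = a} {y = b} ab = sym (ℤP.*-identityʳ _)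
      ι-∧ : ∀ p q → ι (p ∧ q) ≡ ι p * ι q
      ι-∧ true  q = sym (ℤP.*-identityˡ (ι q))
      ι-∧ false q = sym (ℤP.*-zeroˡ (ι q))
      factor : ∀ a b → K a b ≡ ι (a ∈ᵗ ℓ) * (ι (b ∈ᵗ ℓ) * ι (valid a b))
      factor a b with valid a b in v
      ... | true  = trans (cong (λ p → ι p * + 1) (pair-on-line-sym (proj₂ (proj₂ (valid⇒Valid {x = a} {y = b} v)))
                                                                 (proj₂ (proj₂ xy))))
                          (trans (ℤP.*-identityʳ _) (trans (ι-∧ (a ∈ᵗ ℓ) (b ∈ᵗ ℓ))
                                 (cong (ι (a ∈ᵗ ℓ) *_) (sym (ℤP.*-identityʳ _)))))
      ... | false = trans (ℤP.*-zeroʳ (ι (x ∈ᵗ line a b ∧ y ∈ᵗ line a b)))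
                          (sym (trans (cong (ι (a ∈ᵗ ℓ) *_) (ℤP.*-zeroʳ (ι (b ∈ᵗ ℓ)))) (ℤP.*-zeroʳ (ι (a ∈ᵗ ℓ)))))
      v-xy : valid x y ≡ true
      v-xy = Valid⇒valid {x = x} {y = y} xy
      v-xz : valid x (x ⊕ y) ≡ true
      v-xz = Valid⇒valid {x = x} {y = x ⊕ y} (Valid-shear xy)
      v-yx : valid y x ≡ true
      v-yx = trans (valid-sym y x) v-xy
      v-zx : valid (x ⊕ y) x ≡ true
      v-zx = trans (valid-sym (x ⊕ y) x) v-xz
      v-yz : valid y (x ⊕ y) ≡ true
      v-yz = trans (cong (valid y) (⊕-comm x y)) (trans (valid-shear y x) v-yx)
      v-zy : valid (x ⊕ y) y ≡ true
      v-zy = trans (valid-sym (x ⊕ y) y) v-yz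
      six-valid-pairs :
        (ι (valid x x) + ι (valid x y) + ι (valid x (x ⊕ y))) +
        (ι (valid y x) + ι (valid y y) + ι (valid y (x ⊕ y))) +
        (ι (valid (x ⊕ y) x) + ι (valid (x ⊕ y) y) + ι (valid (x ⊕ y) (x ⊕ y))) ≡ + 6 * + 1
      six-valid-pairs = cong₂ _+_ (cong₂ _+_ (row (valid-irrefl x) v-xy v-xz) (row v-yx (valid-irrefl y) v-yz))
                                  (row v-zx v-zy (valid-irrefl (x ⊕ y)))
        where
        row : ∀ {p q s p′ q′ s′} → p ≡ p′ → q ≡ q′ → s ≡ s′ → ι p + ι q + ι s ≡ ι p′ + ι q′ + ι s′
        row refl refl refl = refl

  record IsLine3Flow {r} (g : V r → V r → ℤ) : Set where
    field
      isLineFunction : IsLineFunction g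
      values         : ∀ x y → Valid x y → AbsOneOrTwo (g x y)
      balanced       : ∀ z → Σᵥ (g z) ≡ + 0

  module HammingSystem (r : ℕ) where

    open TripleSystem (HammingSTS r)
    open TripleSystemProperties (HammingSTS r) using (IsLinear; Distinct; inB?≡∈ᵗ; W≡ι∈ᵗ; linear-from-pair-count)

    IsLineBlock : V r × V r × V r → Set
    IsLineBlock t = ∃₂ λ x y → t ≡ line x y × Valid x y

    block-is-line : ∀ k → IsLineBlock (block k)
    block-is-line = All-lookup lines
      where
      lines : All IsLineBlock (hammingBlocks r)
      lines = All-concatMap (λ x → All-concatMap (λ y →
                All-if (increasing x y) (line x y) (λ incr → x , y , refl , increasing⇒Valid {x = x} {y = y} incr)) (allVecs r))
                (allVecs r)

    Σℤ-blocks : ∀ (F : V r × V r × V r → ℤ) → Σℤ (λ k → F (block k)) ≡ ΣL F (hammingBlocks r)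
    Σℤ-blocks F = Σℤ-lookup F (hammingBlocks r)

    block-distinct : ∀ k → Distinct (block k)
    block-distinct k with block-is-line k
    ... | x , y , eq , xy rewrite eq = Valid⇒Distinct xy

    block-point-nonzero : ∀ {z} k → z ∈B k → z ≢ 0v
    block-point-nonzero {z} k z∈ with block-is-line k
    ... | x , y , eq , (x≢0 , y≢0 , x≢y) rewrite eq with z∈
    ...   | inj₁ refl        = x≢0
    ...   | inj₂ (inj₁ refl) = y≢0
    ...   | inj₂ (inj₂ refl) = x≢y ∘ ⊕≡0⇒≡

    linear : IsLinear
    linear = linear-from-pair-count block-distinct count
      where
      count : ∀ k {x y} → x ≢ y → x ∈B k → y ∈B k → Σℤ (λ j → ι (inB? x j ∧ inB? y j)) ≡ + 1
      count k {x} {y} x≢y x∈ y∈ = begin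
        Σℤ (λ j → ι (inB? x j ∧ inB? y j))
          ≡⟨ Σℤ-cong (λ j → cong₂ (λ p q → ι (p ∧ q)) (inB?≡∈ᵗ x j) (inB?≡∈ᵗ y j)) ⟩
        Σℤ (λ j → ι (x ∈ᵗ block j ∧ y ∈ᵗ block j))      ≡⟨ Σℤ-blocks (λ t → ι (x ∈ᵗ t ∧ y ∈ᵗ t)) ⟩
        ΣL (λ t → ι (x ∈ᵗ t ∧ y ∈ᵗ t)) (hammingBlocks r)
          ≡⟨ lines-through-pair (block-point-nonzero k x∈ , block-point-nonzero k y∈ , x≢y) ⟩
        + 1 ∎
        where open ≡-Reasoning

    incidence-sum : ∀ {g} → IsLineFunction g → ∀ z →
      + 2 * Σℤ (λ k → W z k * first-two g (block k)) ≡ Σᵥ (g z)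
    incidence-sum {g} isLF z = begin
      + 2 * Σℤ (λ k → W z k * first-two g (block k))
        ≡⟨ cong (+ 2 *_) (Σℤ-cong (λ k → cong (_* first-two g (block k)) (W≡ι∈ᵗ z k))) ⟩
      + 2 * Σℤ (λ k → ι (z ∈ᵗ block k) * first-two g (block k))
        ≡⟨ cong (+ 2 *_) (Σℤ-blocks (λ t → ι (z ∈ᵗ t) * first-two g t)) ⟩
      + 2 * ΣL (λ t → ι (z ∈ᵗ t) * first-two g t) (hammingBlocks r)
        ≡⟨ lines-through isLF z ⟩
      Σᵥ (g z) ∎
      where open ≡-Reasoning

    valid-isLineFunction : IsLineFunction {r} (λ x y → ι (valid x y))
    valid-isLineFunction = record
      { symmetric = λ x y → cong ι (valid-sym x y)
      ; shear     = λ x y → cong ι (sym (valid-shear x y))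
      ; off-lines = λ x y v → cong ι v
      }

    Σ-valid-partners : ∀ {z : V r} → z ≢ 0v → Σᵥ (λ y → ι (valid z y)) + + 2 ≡ + (2 ^ r)
    Σ-valid-partners {z} z≢0 = begin
      Σᵥ (λ y → ι (valid z y)) + + 2
        ≡⟨ cong (_+_ (Σᵥ (λ y → ι (valid z y)))) (cong₂ _+_ (Σᵥ-indicator 0v one) (Σᵥ-indicator z one)) ⟨
      Σᵥ (λ y → ι (valid z y)) + (Σᵥ (is 0v) + Σᵥ (is z))
        ≡⟨ cong (_+_ (Σᵥ (λ y → ι (valid z y)))) (Σᵥ-+ (is 0v) (is z)) ⟨
      Σᵥ (λ y → ι (valid z y)) + Σᵥ (λ y → is 0v y + is z y)
        ≡⟨ Σᵥ-+ (λ y → ι (valid z y)) (λ y → is 0v y + is z y) ⟨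
      Σᵥ (λ y → ι (valid z y) + (is 0v y + is z y))
        ≡⟨ Σᵥ-cong partition ⟩
      Σᵥ one
        ≡⟨ Σᵥ-one r ⟩
      + (2 ^ r) ∎
      where
      open ≡-Reasoning
      one : V r → ℤ
      one _ = + 1
      is : V r → V r → ℤ
      is a y = ι (y == a) * one y
      partition : ∀ y → ι (valid z y) + (is 0v y + is z y) ≡ + 1
      partition y rewrite ≢⇒==false z≢0 | ==-sym z y with y == 0v in y0 | y == z in yz
      ... | true  | true  = contradiction (trans (sym (==⇒≡ y z yz)) (==⇒≡ y 0v y0)) z≢0
      ... | true  | false = refl
      ... | false | true  = refl
      ... | false | false = refl

    replication : ∀ {z} → z ≢ 0v → + 2 * Σℤ (W z) ≡ + (2 ^ r) - + 2
    replication {z} z≢0 = begin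
      + 2 * Σℤ (W z)                                           ≡⟨ cong (+ 2 *_) (Σℤ-cong on-blocks) ⟩
      + 2 * Σℤ (λ k → W z k * first-two (λ x y → ι (valid x y)) (block k))
                                                               ≡⟨ incidence-sum valid-isLineFunction z ⟩
      Σᵥ (λ y → ι (valid z y))                                 ≡⟨ move (Σᵥ (λ y → ι (valid z y))) ⟩
      Σᵥ (λ y → ι (valid z y)) + + 2 - + 2                     ≡⟨ cong (_- + 2) (Σ-valid-partners z≢0) ⟩
      + (2 ^ r) - + 2 ∎
      where
      open ≡-Reasoning
      move : ∀ s → s ≡ s + + 2 - + 2
      move = solve-∀
      on-blocks : ∀ k → W z k ≡ W z k * first-two (λ x y → ι (valid x y)) (block k)
      on-blocks k = sym (trans (cong (W z k *_) block-valid) (ℤP.*-identityʳ (W z k)))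
        where
        block-valid : first-two (λ x y → ι (valid x y)) (block k) ≡ + 1
        block-valid with block-is-line k
        ... | x , y , eq , xy = trans (cong (first-two (λ x y → ι (valid x y))) eq)
                                      (cong ι (Valid⇒valid {x = x} {y = y} xy))

  module HammingParity (m : ℕ) where

    private
      r : ℕ
      r = suc (suc m)

    open TripleSystem (HammingSTS r)
    open TripleSystemProperties (HammingSTS r) using (Σ₃; degree+3; flow⇒θ₂Eigvec; no-±1-θ₂Eigvec)
    open HammingSystem r

    degree-even : ∀ i → + 2 ∣ℤ Σℤ (A i)
    degree-even i = ℤ∣.divides (+ 3 * P - + 3) (ℤP.*-cancelˡ-≡ (+ 2) _ _ (begin
      + 2 * Σℤ (A i)                                   ≡⟨ shift (Σℤ (A i)) ⟩
      + 2 * (Σℤ (A i) + + 3) - + 6                     ≡⟨ cong (λ s → + 2 * s - + 6) (degree+3 linear i) ⟩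
      + 2 * (Rₐ + R_b + R_c) - + 6                     ≡⟨ distrib Rₐ R_b R_c ⟩
      + 2 * Rₐ + + 2 * R_b + + 2 * R_c - + 6
        ≡⟨ cong (_- + 6) (cong₂ _+_ (cong₂ _+_ (rep (inj₁ refl)) (rep (inj₂ (inj₁ refl)))) (rep (inj₂ (inj₂ refl)))) ⟩
      (+ 4 * P - + 2) + (+ 4 * P - + 2) + (+ 4 * P - + 2) - + 6 ≡⟨ collect P ⟩
      + 2 * ((+ 3 * P - + 3) * + 2) ∎))
      where
      open ≡-Reasoning
      P Rₐ R_b R_c : ℤ
      P = + (2 ^ m)
      Rₐ = Σℤ (W (proj₁ (block i)))
      R_b = Σℤ (W (proj₁ (proj₂ (block i))))
      R_c = Σℤ (W (proj₂ (proj₂ (block i))))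
      2^r≡4P : + (2 ^ r) ≡ + 4 * P
      2^r≡4P = trans (ℤP.pos-* 2 (2 ^ suc m)) (trans (cong (+ 2 *_) (ℤP.pos-* 2 (2 ^ m))) (sym (ℤP.*-assoc (+ 2) (+ 2) P)))
      rep : ∀ {z} → z ∈B i → + 2 * Σℤ (W z) ≡ + 4 * P - + 2
      rep z∈ = trans (replication (block-point-nonzero i z∈)) (cong (_- + 2) 2^r≡4P)
      shift : ∀ d → + 2 * d ≡ + 2 * (d + + 3) - + 6
      shift = solve-∀
      distrib : ∀ a b c → + 2 * (a + b + c) - + 6 ≡ + 2 * a + + 2 * b + + 2 * c - + 6
      distrib = solve-∀
      collect : ∀ p → (+ 4 * p - + 2) + (+ 4 * p - + 2) + (+ 4 * p - + 2) - + 6 ≡ + 2 * ((+ 3 * p - + 3) * + 2)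
      collect = solve-∀

    some-block : Fin nb
    some-block = Σℤ-nonempty (W e) λ ΣWe≡0 →
      ℕP.even≢odd (2 ^ m) 0 (ℕP.*-cancelˡ-≡ _ _ 2 (ℤP.+-injective
        (ℤP.i-j≡0⇒i≡j (+ (2 ^ r)) (+ 2) (trans (sym (replication {z = e} λ ())) (cong (+ 2 *_) ΣWe≡0)))))
      where
      e : V r
      e = true ∷ 0v

    norm≥2 : ∀ u → NowhereZero u → θ₂Eigvec u → 2 ≤ ‖ u ‖∞
    norm≥2 u u≢0 eig with 2 ℕP.≤? ‖ u ‖∞
    ... | yes 2≤‖u‖ = 2≤‖u‖
    ... | no  2≰‖u‖ = contradiction eig (no-±1-θ₂Eigvec some-block (degree-even some-block) u ±1)
      where
      unit : ∀ {z} → z ≢ + 0 → ∣ z ∣ ≤ 1 → z ≡ + 1 ⊎ z ≡ - + 1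
      unit {+ zero}        z≢0 _ = contradiction refl z≢0
      unit {+ suc zero}    _   _ = inj₁ refl
      unit { -[1+ zero ]}  _   _ = inj₂ refl
      unit {+ suc (suc n)} _ (s≤s ())
      unit { -[1+ suc n ]} _ (s≤s ())
      ±1 : ∀ j → u j ≡ + 1 ⊎ u j ≡ - + 1
      ±1 j = unit (u≢0 j) (ℕP.≤-trans (maxℕ-upper (λ k → ∣ u k ∣) j) (ℕP.≤-pred (ℕP.≰⇒> 2≰‖u‖)))

    m2≡3 : ∀ {g} → IsLine3Flow g → m2≡ 3
    m2≡3 {g} flow = (u , u≢0 , eig , cong suc (ℕP.≤-antisym ‖u‖≤2 (norm≥2 u u≢0 eig))) ,
                    λ v v≢0 eig-v → s≤s (norm≥2 v v≢0 eig-v)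
      where
      open IsLine3Flow flow
      u : Fin nb → ℤ
      u k = first-two g (block k)
      value : ∀ k → AbsOneOrTwo (u k)
      value k with block-is-line k
      ... | x , y , eq , xy = subst AbsOneOrTwo (sym (cong (first-two g) eq)) (values x y xy)
      u≢0 : NowhereZero u
      u≢0 k = AbsOneOrTwo⇒≢0 (value k)
      ‖u‖≤2 : ‖ u ‖∞ ≤ 2
      ‖u‖≤2 = maxℕ-lub (λ k → ∣ u k ∣) (λ k → AbsOneOrTwo⇒≤2 {u k} (value k))
      Wu≡0 : InKernelW u
      Wu≡0 z = ℤP.*-cancelˡ-≡ (+ 2) _ (+ 0) (trans (incidence-sum isLineFunction z) (balanced z))
      eig : θ₂Eigvec u
      eig = flow⇒θ₂Eigvec linear u Wu≡0

  record IsAffineWeight {n} (w : V n → V n → ℤ) : Set where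
    field
      symmetric           : ∀ a b → w a b ≡ w b a
      diagonal            : ∀ a → w a a ≡ + 0
      values              : ∀ a b → a ≢ b → AbsOneOrTwo (w a b)
      row-balanced        : ∀ a → Σᵥ (w a) ≡ + 0
      difference-balanced : ∀ c → Σᵥ (λ a → w a (a ⊕ c)) ≡ + 0

  module _ {n : ℕ} where

    -- The lines of PG(n,2) off the hyperplane x₀ = 0 are {(1,a), (1,b), (0,a ⊕ b)}; w a b is their weight.
    extend : (V n → V n → ℤ) → (V n → V n → ℤ) → V (suc n) → V (suc n) → ℤ
    extend w g (false ∷ x) (false ∷ y) = g x y
    extend w g (true ∷ x)  (true ∷ y)  = w x y
    extend w g (true ∷ x)  (false ∷ y) = w x (x ⊕ y)
    extend w g (false ∷ x) (true ∷ y)  = w y (x ⊕ y)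

    extend-flow : ∀ {w g} → IsAffineWeight w → IsLine3Flow g → IsLine3Flow (extend w g)
    extend-flow {w} {g} affine flow = record
      { isLineFunction = record { symmetric = symmetric′ ; shear = shear′ ; off-lines = off-lines′ }
      ; values         = values′
      ; balanced       = balanced′
      }
      where
      module w = IsAffineWeight affine
      open IsLine3Flow flow
      open IsLineFunction isLineFunction
      h : V (suc n) → V (suc n) → ℤ
      h = extend w g

      symmetric′ : ∀ x y → h x y ≡ h y x
      symmetric′ (false ∷ x) (false ∷ y) = symmetric x y
      symmetric′ (true ∷ x)  (true ∷ y)  = w.symmetric x y
      symmetric′ (true ∷ x)  (false ∷ y) = cong (w x) (⊕-comm x y)
      symmetric′ (false ∷ x) (true ∷ y)  = cong (w y) (⊕-comm x y)

      shear′ : ∀ x y → h x y ≡ h x (x ⊕ y)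
      shear′ (false ∷ x) (false ∷ y) = shear x y
      shear′ (false ∷ x) (true ∷ y)  = trans (w.symmetric y (x ⊕ y)) (cong (w (x ⊕ y)) (sym (⊕-cancelˡ x y)))
      shear′ (true ∷ x)  (false ∷ y) = refl
      shear′ (true ∷ x)  (true ∷ y)  = cong (w x) (sym (⊕-cancelˡ x y))

      off-lines′ : ∀ x y → valid x y ≡ false → h x y ≡ + 0
      off-lines′ (false ∷ x) (false ∷ y) v = off-lines x y v
      off-lines′ (true ∷ x)  (true ∷ y)  v with x == y in x==y
      ... | true rewrite ==⇒≡ x y x==y = w.diagonal y
      off-lines′ (true ∷ x)  (false ∷ y) v with y == 0v in y==0
      ... | true rewrite ==⇒≡ y 0v y==0 | ⊕-identityʳ x = w.diagonal x
      off-lines′ (false ∷ x) (true ∷ y)  v with x == 0v in x==0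
      ... | true rewrite ==⇒≡ x 0v x==0 | ⊕-identityˡ y = w.diagonal y

      values′ : ∀ x y → Valid x y → AbsOneOrTwo (h x y)
      values′ (false ∷ x) (false ∷ y) (x≢0 , y≢0 , x≢y) =
        values x y (x≢0 ∘ cong (false ∷_) , y≢0 ∘ cong (false ∷_) , x≢y ∘ cong (false ∷_))
      values′ (true ∷ x)  (true ∷ y)  (_ , _ , x≢y) = w.values x y (x≢y ∘ cong (true ∷_))
      values′ (true ∷ x)  (false ∷ y) (_ , y≢0 , _) =
        w.values x (x ⊕ y) (x≢x⊕y (y≢0 ∘ cong (false ∷_)))
      values′ (false ∷ x) (true ∷ y)  (x≢0 , _ , _) =
        w.values y (x ⊕ y) (y≢x⊕y (x≢0 ∘ cong (false ∷_)))

      balanced′ : ∀ z → Σᵥ (h z) ≡ + 0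
      balanced′ (false ∷ c) = begin
        Σᵥ (h (false ∷ c))                          ≡⟨ Σᵥ-suc (h (false ∷ c)) ⟩
        Σᵥ (λ y → g c y + w y (c ⊕ y))              ≡⟨ Σᵥ-+ (g c) (λ y → w y (c ⊕ y)) ⟩
        Σᵥ (g c) + Σᵥ (λ y → w y (c ⊕ y))
          ≡⟨ cong₂ _+_ (balanced c) (trans (Σᵥ-cong (λ y → cong (w y) (⊕-comm c y))) (w.difference-balanced c)) ⟩
        + 0 ∎
        where open ≡-Reasoning
      balanced′ (true ∷ c) = begin
        Σᵥ (h (true ∷ c))                           ≡⟨ Σᵥ-suc (h (true ∷ c)) ⟩
        Σᵥ (λ y → w c (c ⊕ y) + w c y)              ≡⟨ Σᵥ-+ (λ y → w c (c ⊕ y)) (w c) ⟩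
        Σᵥ (λ y → w c (c ⊕ y)) + Σᵥ (w c)           ≡⟨ cong₂ _+_ (trans (Σᵥ-translateˡ c (w c)) (w.row-balanced c))
                                                                 (w.row-balanced c) ⟩
        + 0 ∎
        where open ≡-Reasoning

  module AffineWeight (k : ℕ) where

    n : ℕ
    n = suc (suc (suc (suc k)))

    ζ : V (suc (suc k)) → ℤ
    ζ (true ∷ _)          = - + 1
    ζ (false ∷ false ∷ x) = if x == 0v then + 0 else + 1
    ζ (false ∷ true ∷ x)  = if x == 0v then + 2 else + 1

    Σζ : Σᵥ ζ ≡ + 0
    Σζ = Σᵥ-suc²-vanish {f = ζ} quadruple
      where
      quadruple : ∀ x → (ζ (false ∷ false ∷ x) + ζ (true ∷ false ∷ x)) +
                        (ζ (false ∷ true ∷ x) + ζ (true ∷ true ∷ x)) ≡ + 0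
      quadruple x with x == 0v
      ... | true  = refl
      ... | false = refl

    ε : V n → ℤ
    ε (false ∷ false ∷ t)      = ζ t
    ε (_     ∷ _     ∷ t₀ ∷ _) = sign t₀

    -- χ c a is the bit ⟨λ, a⟩ for a vector λ ≠ 0 supported on the first two coordinates with ⟨λ, c⟩ = 0.
    χ : V n → V n → Bool
    χ (true  ∷ false ∷ _) (a₀ ∷ a₁ ∷ _) = a₁
    χ (true  ∷ true  ∷ _) (a₀ ∷ a₁ ∷ _) = a₀ xor a₁
    χ (false ∷ _     ∷ _) (a₀ ∷ a₁ ∷ _) = a₀

    w : V n → V n → ℤ
    w a b = ε (a ⊕ b) * sign (χ (a ⊕ b) a)

    χ-translate : ∀ (a b : V n) → χ (a ⊕ b) a ≡ χ (a ⊕ b) b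
    χ-translate (true  ∷ true  ∷ _) (true  ∷ true  ∷ _) = refl
    χ-translate (true  ∷ true  ∷ _) (true  ∷ false ∷ _) = refl
    χ-translate (true  ∷ true  ∷ _) (false ∷ true  ∷ _) = refl
    χ-translate (true  ∷ true  ∷ _) (false ∷ false ∷ _) = refl
    χ-translate (true  ∷ false ∷ _) (true  ∷ true  ∷ _) = refl
    χ-translate (true  ∷ false ∷ _) (true  ∷ false ∷ _) = refl
    χ-translate (true  ∷ false ∷ _) (false ∷ true  ∷ _) = refl
    χ-translate (true  ∷ false ∷ _) (false ∷ false ∷ _) = refl
    χ-translate (false ∷ true  ∷ _) (true  ∷ true  ∷ _) = refl
    χ-translate (false ∷ true  ∷ _) (true  ∷ false ∷ _) = refl
    χ-translate (false ∷ true  ∷ _) (false ∷ true  ∷ _) = refl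
    χ-translate (false ∷ true  ∷ _) (false ∷ false ∷ _) = refl
    χ-translate (false ∷ false ∷ _) (true  ∷ true  ∷ _) = refl
    χ-translate (false ∷ false ∷ _) (true  ∷ false ∷ _) = refl
    χ-translate (false ∷ false ∷ _) (false ∷ true  ∷ _) = refl
    χ-translate (false ∷ false ∷ _) (false ∷ false ∷ _) = refl

    Σχ : ∀ c → Σᵥ (λ a → sign (χ c a)) ≡ + 0
    Σχ c@(true  ∷ false ∷ _) = Σᵥ-suc²-vanish {f = λ a → sign (χ c a)} (λ _ → refl)
    Σχ c@(true  ∷ true  ∷ _) = Σᵥ-suc²-vanish {f = λ a → sign (χ c a)} (λ _ → refl)
    Σχ c@(false ∷ _     ∷ _) = Σᵥ-suc²-vanish {f = λ a → sign (χ c a)} (λ _ → refl)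

    ε-values : ∀ c → c ≢ 0v → AbsOneOrTwo (ε c)
    ε-values (true  ∷ _     ∷ t₀ ∷ _) _ = inj₁ (∣sign∣≡1 t₀)
    ε-values (false ∷ true  ∷ t₀ ∷ _) _ = inj₁ (∣sign∣≡1 t₀)
    ε-values (false ∷ false ∷ true  ∷ _) _ = inj₁ refl
    ε-values (false ∷ false ∷ false ∷ false ∷ x) c≢0 with x == 0v in x==0
    ... | true  = contradiction (cong (λ v → false ∷ false ∷ false ∷ false ∷ v) (==⇒≡ x 0v x==0)) c≢0
    ... | false = inj₁ refl
    ε-values (false ∷ false ∷ false ∷ true ∷ x) _ with x == 0v
    ... | true  = inj₂ refl
    ... | false = inj₁ refl


    ε-0v : ε 0v ≡ + 0
    ε-0v rewrite ==-refl (0v {k}) = refl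

    Σ-ε-χ : ∀ a → Σᵥ (λ c → ε c * sign (χ c a)) ≡ + 0
    Σ-ε-χ (a₀ ∷ a₁ ∷ _) = begin
      Σᵥ (λ c → ε c * sign (χ c (a₀ ∷ a₁ ∷ _)))
        ≡⟨ Σᵥ-suc² (λ c → ε c * sign (χ c (a₀ ∷ a₁ ∷ _))) ⟩
      Σᵥ (λ t → (ζ t * sign a₀ + ε (true ∷ false ∷ t) * sign a₁) +
                (ε (false ∷ true ∷ t) * sign a₀ + ε (true ∷ true ∷ t) * sign (a₀ xor a₁)))
        ≡⟨ Σᵥ-cong regroup ⟩
      Σᵥ (λ t → sign a₀ * ζ t + s * hd t)
        ≡⟨ Σᵥ-+ (λ t → sign a₀ * ζ t) (λ t → s * hd t) ⟩
      Σᵥ (λ t → sign a₀ * ζ t) + Σᵥ (λ t → s * hd t)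
        ≡⟨ cong₂ _+_ (trans (Σᵥ-* (sign a₀) ζ) (cong (sign a₀ *_) Σζ))
                     (trans (Σᵥ-* s hd) (cong (s *_) (Σᵥ-sign-head {suc k}))) ⟩
      sign a₀ * + 0 + s * + 0
        ≡⟨ cong₂ _+_ (ℤP.*-zeroʳ (sign a₀)) (ℤP.*-zeroʳ s) ⟩
      + 0 ∎
      where
      open ≡-Reasoning
      s : ℤ
      s = sign a₁ + sign a₀ + sign (a₀ xor a₁)
      hd : V (suc (suc k)) → ℤ
      hd t = sign (Data.Vec.head t)
      regroup : ∀ t → (ζ t * sign a₀ + ε (true ∷ false ∷ t) * sign a₁) +
                      (ε (false ∷ true ∷ t) * sign a₀ + ε (true ∷ true ∷ t) * sign (a₀ xor a₁))
                      ≡ sign a₀ * ζ t + s * hd t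
      regroup (t₀ ∷ _) = ring (ζ (t₀ ∷ _)) (sign t₀) (sign a₀) (sign a₁) (sign (a₀ xor a₁))
        where
        ring : ∀ z e p q u → (z * p + e * q) + (e * p + e * u) ≡ p * z + (q + p + u) * e
        ring = solve-∀

    affine : IsAffineWeight w
    affine = record
      { symmetric           = λ a b → trans (cong (λ x → ε (a ⊕ b) * sign x) (χ-translate a b))
                                            (cong (λ c → ε c * sign (χ c b)) (⊕-comm a b))
      ; diagonal            = λ a → trans (cong (λ c → ε c * sign (χ c a)) (⊕-self a))
                                          (trans (cong (_* sign (χ 0v a)) ε-0v) (ℤP.*-zeroˡ (sign (χ 0v a))))
      ; values              = λ a b a≢b → times-sign {ε (a ⊕ b)} (ε-values (a ⊕ b) (a≢b ∘ ⊕≡0⇒≡)) (χ (a ⊕ b) a)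
      ; row-balanced        = λ a → trans (sym (Σᵥ-translateˡ a (w a)))
                                          (trans (Σᵥ-cong (λ c → cong (λ x → ε x * sign (χ x a)) (⊕-cancelˡ a c)))
                                                 (Σ-ε-χ a))
      ; difference-balanced = λ c → trans (Σᵥ-cong (λ a → cong (λ x → ε x * sign (χ x a)) (⊕-cancelˡ a c)))
                                          (trans (Σᵥ-* (ε c) (λ a → sign (χ c a))) (trans (cong (ε c *_) (Σχ c)) (ℤP.*-zeroʳ (ε c))))
      }
      where
      times-sign : ∀ {z} → AbsOneOrTwo z → ∀ b → AbsOneOrTwo (z * sign b)
      times-sign {z} z∈ b = subst (λ n → n ≡ 1 ⊎ n ≡ 2) (sym ∣z*sign∣≡∣z∣) z∈
        where
        ∣z*sign∣≡∣z∣ : ∣ z * sign b ∣ ≡ ∣ z ∣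
        ∣z*sign∣≡∣z∣ = trans (ℤP.abs-* z (sign b)) (trans (cong (∣ z ∣ ℕ.*_) (∣sign∣≡1 b)) (ℕP.*-identityʳ ∣ z ∣))

  all-V? : ∀ {r p} {P : V r → Set p} → (∀ v → Dec (P v)) → Dec (∀ v → P v)
  all-V? {zero}  P? = map′ (λ { p [] → p }) (λ ∀P → ∀P []) (P? [])
  all-V? {suc r} P? = map′ (λ { (p₀ , p₁) (false ∷ v) → p₀ v ; (p₀ , p₁) (true ∷ v) → p₁ v })
                           (λ ∀P → (λ v → ∀P (false ∷ v)) , (λ v → ∀P (true ∷ v)))
                           (all-V? (λ v → P? (false ∷ v)) ×-dec all-V? (λ v → P? (true ∷ v)))

  -- Row val x, column val y holds g₄ x y (val reads the bits least significant first).
  module Table₄ where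
    open import Agda.Builtin.FromNat
    open import Agda.Builtin.FromNeg
    open IntegerLiterals

    rows : List (List ℤ)
    rows = ( 0 ∷  0 ∷  0 ∷  0 ∷  0 ∷  0 ∷  0 ∷  0 ∷  0 ∷  0 ∷  0 ∷  0 ∷  0 ∷  0 ∷  0 ∷  0 ∷ [])
         ∷ ( 0 ∷  0 ∷ -1 ∷ -1 ∷ -2 ∷ -2 ∷  2 ∷  2 ∷  1 ∷  1 ∷  1 ∷  1 ∷  1 ∷  1 ∷ -2 ∷ -2 ∷ [])
         ∷ ( 0 ∷ -1 ∷  0 ∷ -1 ∷ -1 ∷  1 ∷ -1 ∷  1 ∷  1 ∷  1 ∷  1 ∷  1 ∷  1 ∷ -2 ∷  1 ∷ -2 ∷ [])
         ∷ ( 0 ∷ -1 ∷ -1 ∷  0 ∷ -1 ∷  2 ∷  2 ∷ -1 ∷ -2 ∷ -1 ∷ -1 ∷ -2 ∷  2 ∷  1 ∷  1 ∷  2 ∷ [])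
         ∷ ( 0 ∷ -2 ∷ -1 ∷ -1 ∷  0 ∷ -2 ∷ -1 ∷ -1 ∷  1 ∷  1 ∷  1 ∷  1 ∷  1 ∷  1 ∷  1 ∷  1 ∷ [])
         ∷ ( 0 ∷ -2 ∷  1 ∷  2 ∷ -2 ∷  0 ∷  2 ∷  1 ∷ -1 ∷ -1 ∷ -1 ∷  2 ∷ -1 ∷ -1 ∷  2 ∷ -1 ∷ [])
         ∷ ( 0 ∷  2 ∷ -1 ∷  2 ∷ -1 ∷  2 ∷  0 ∷  2 ∷ -1 ∷  1 ∷ -2 ∷ -1 ∷ -2 ∷ -1 ∷ -1 ∷  1 ∷ [])
         ∷ ( 0 ∷  2 ∷  1 ∷ -1 ∷ -1 ∷  1 ∷  2 ∷  0 ∷  1 ∷ -2 ∷  1 ∷ -2 ∷ -2 ∷  1 ∷ -2 ∷  1 ∷ [])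
         ∷ ( 0 ∷  1 ∷  1 ∷ -2 ∷  1 ∷ -1 ∷ -1 ∷  1 ∷  0 ∷  1 ∷  1 ∷ -2 ∷  1 ∷ -1 ∷ -1 ∷  1 ∷ [])
         ∷ ( 0 ∷  1 ∷  1 ∷ -1 ∷  1 ∷ -1 ∷  1 ∷ -2 ∷  1 ∷  0 ∷ -1 ∷  1 ∷ -1 ∷  1 ∷ -2 ∷  1 ∷ [])
         ∷ ( 0 ∷  1 ∷  1 ∷ -1 ∷  1 ∷ -1 ∷ -2 ∷  1 ∷  1 ∷ -1 ∷  0 ∷  1 ∷ -2 ∷  1 ∷  1 ∷ -1 ∷ [])
         ∷ ( 0 ∷  1 ∷  1 ∷ -2 ∷  1 ∷  2 ∷ -1 ∷ -2 ∷ -2 ∷  1 ∷  1 ∷  0 ∷ -2 ∷ -1 ∷  2 ∷  1 ∷ [])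
         ∷ ( 0 ∷  1 ∷  1 ∷  2 ∷  1 ∷ -1 ∷ -2 ∷ -2 ∷  1 ∷ -1 ∷ -2 ∷ -2 ∷  0 ∷  1 ∷  1 ∷  2 ∷ [])
         ∷ ( 0 ∷  1 ∷ -2 ∷  1 ∷  1 ∷ -1 ∷ -1 ∷  1 ∷ -1 ∷  1 ∷  1 ∷ -1 ∷  1 ∷  0 ∷  1 ∷ -2 ∷ [])
         ∷ ( 0 ∷ -2 ∷  1 ∷  1 ∷  1 ∷  2 ∷ -1 ∷ -2 ∷ -1 ∷ -2 ∷  1 ∷  2 ∷  1 ∷  1 ∷  0 ∷ -2 ∷ [])
         ∷ ( 0 ∷ -2 ∷ -2 ∷  2 ∷  1 ∷ -1 ∷  1 ∷  1 ∷  1 ∷  1 ∷ -1 ∷  1 ∷  2 ∷ -2 ∷ -2 ∷  0 ∷ [])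
         ∷ []

  g₄ : V 4 → V 4 → ℤ
  g₄ x y = at (+ 0) (at [] Table₄.rows (val x)) (val y)

  line3Flow₄ : IsLine3Flow g₄
  line3Flow₄ = record
    { isLineFunction = record
      { symmetric = from-yes (all-V? λ x → all-V? λ y → g₄ x y ℤ.≟ g₄ y x)
      ; shear     = from-yes (all-V? λ x → all-V? λ y → g₄ x y ℤ.≟ g₄ x (x ⊕ y))
      ; off-lines = from-yes (all-V? λ x → all-V? λ y → (valid x y Bool.≟ false) →-dec (g₄ x y ℤ.≟ + 0))
      }
    ; values   = λ x y xy → from-yes (all-V? λ x → all-V? λ y → (valid x y Bool.≟ true) →-dec AbsOneOrTwo? (g₄ x y))
                                     x y (Valid⇒valid xy)
    ; balanced = from-yes (all-V? λ z → Σᵥ (g₄ z) ℤ.≟ + 0)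
    }

  line3Flow : ∀ k → ∃ (IsLine3Flow {suc (suc (suc (suc k)))})
  line3Flow zero    = g₄ , line3Flow₄
  line3Flow (suc k) with line3Flow k
  ... | g , flow = extend (AffineWeight.w k) g , extend-flow (AffineWeight.affine k) flow

  hamming : (r : ℕ) → 4 ≤ r → TripleSystem.m2≡ (HammingSTS r) 3
  hamming (suc (suc (suc (suc k)))) _ = HammingParity.m2≡3 (suc (suc k)) (proj₂ (line3Flow k))
  hamming 0 ()
  hamming 1 (s≤s ())
  hamming 2 (s≤s (s≤s ()))
  hamming 3 (s≤s (s≤s (s≤s ())))


module Bose where

  module ZMod (p : ℕ) .{{_ : NonZero p}} where

    ⟦_⟧ : ℕ → Fin p
    ⟦ n ⟧ = n mod p

    toℕ⟦⟧ : ∀ n → toℕ ⟦ n ⟧ ≡ n % p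
    toℕ⟦⟧ n = FinP.toℕ-fromℕ< _

    infix 4 _≈_
    record _≈_ (a b : ℕ) : Set where
      constructor mod≡
      field %≡ : a % p ≡ b % p
    open _≈_

    ≈-setoid : Setoid 0ℓ 0ℓ
    ≈-setoid = record
      { Carrier       = ℕ
      ; _≈_           = _≈_
      ; isEquivalence = record
        { refl  = mod≡ refl
        ; sym   = λ (mod≡ a≈b) → mod≡ (sym a≈b)
        ; trans = λ (mod≡ a≈b) (mod≡ b≈c) → mod≡ (trans a≈b b≈c)
        }
      }

    module ≈-Reasoning = SetoidReasoning ≈-setoid
    open Setoid ≈-setoid public using () renaming (refl to ≈-refl)

    ≈-+ : ∀ {a a′ b b′} → a ≈ a′ → b ≈ b′ → a ℕ.+ b ≈ a′ ℕ.+ b′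
    ≈-+ {a} {a′} {b} {b′} (mod≡ a≈a′) (mod≡ b≈b′) = mod≡ (begin
      (a ℕ.+ b) % p              ≡⟨ %-distribˡ-+ a b p ⟩
      (a % p ℕ.+ b % p) % p      ≡⟨ cong₂ (λ x y → (x ℕ.+ y) % p) a≈a′ b≈b′ ⟩
      (a′ % p ℕ.+ b′ % p) % p    ≡⟨ %-distribˡ-+ a′ b′ p ⟨
      (a′ ℕ.+ b′) % p ∎)
      where open ≡-Reasoning

    ≈-* : ∀ {a a′ b b′} → a ≈ a′ → b ≈ b′ → a ℕ.* b ≈ a′ ℕ.* b′
    ≈-* {a} {a′} {b} {b′} (mod≡ a≈a′) (mod≡ b≈b′) = mod≡ (begin
      (a ℕ.* b) % p              ≡⟨ %-distribˡ-* a b p ⟩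
      (a % p ℕ.* (b % p)) % p    ≡⟨ cong₂ (λ x y → (x ℕ.* y) % p) a≈a′ b≈b′ ⟩
      (a′ % p ℕ.* (b′ % p)) % p  ≡⟨ %-distribˡ-* a′ b′ p ⟨
      (a′ ℕ.* b′) % p ∎)
      where open ≡-Reasoning

    +kp≈ : ∀ a k → a ℕ.+ k ℕ.* p ≈ a
    +kp≈ a k = mod≡ ([m+kn]%n≡m%n a k p)

    toℕ⟦⟧≈ : ∀ n → toℕ ⟦ n ⟧ ≈ n
    toℕ⟦⟧≈ n = mod≡ (trans (cong (_% p) (FinP.toℕ-fromℕ< _)) (m%n%n≡m%n n p))

    ≈⇒⟦⟧≡ : ∀ {a b} → a ≈ b → ⟦ a ⟧ ≡ ⟦ b ⟧
    ≈⇒⟦⟧≡ (mod≡ a≈b) = FinP.toℕ-injective (trans (FinP.toℕ-fromℕ< _) (trans a≈b (sym (FinP.toℕ-fromℕ< _))))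

    ≈⇒≡⟦⟧ : ∀ (x : Fin p) n → toℕ x ≈ n → x ≡ ⟦ n ⟧
    ≈⇒≡⟦⟧ x n (mod≡ x≈n) = FinP.toℕ-injective (begin
      toℕ x          ≡⟨ m<n⇒m%n≡m (FinP.toℕ<n x) ⟨
      toℕ x % p      ≡⟨ x≈n ⟩
      n % p          ≡⟨ FinP.toℕ-fromℕ< _ ⟨
      toℕ ⟦ n ⟧ ∎)
      where open ≡-Reasoning

    infixl 8 _⊞_ _⊟_

    _⊞_ : Fin p → Fin p → Fin p
    x ⊞ y = ⟦ toℕ x ℕ.+ toℕ y ⟧

    ⊖_ : Fin p → Fin p
    ⊖ y = ⟦ p ∸ toℕ y ⟧

    _⊟_ : Fin p → Fin p → Fin p
    x ⊟ y = x ⊞ ⊖ y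

    𝟘 : Fin p
    𝟘 = ⟦ 0 ⟧

    ⊞-comm : ∀ x y → x ⊞ y ≡ y ⊞ x
    ⊞-comm x y = cong ⟦_⟧ (ℕP.+-comm (toℕ x) (toℕ y))

    ⊞-assoc : ∀ x y z → (x ⊞ y) ⊞ z ≡ x ⊞ (y ⊞ z)
    ⊞-assoc x y z = ≈⇒⟦⟧≡ (begin
      toℕ ⟦ toℕ x ℕ.+ toℕ y ⟧ ℕ.+ toℕ z  ≈⟨ ≈-+ (toℕ⟦⟧≈ (toℕ x ℕ.+ toℕ y)) ≈-refl ⟩
      toℕ x ℕ.+ toℕ y ℕ.+ toℕ z          ≡⟨ ℕP.+-assoc (toℕ x) (toℕ y) (toℕ z) ⟩
      toℕ x ℕ.+ (toℕ y ℕ.+ toℕ z)        ≈⟨ ≈-+ ≈-refl (toℕ⟦⟧≈ (toℕ y ℕ.+ toℕ z)) ⟨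
      toℕ x ℕ.+ toℕ ⟦ toℕ y ℕ.+ toℕ z ⟧ ∎)
      where open ≈-Reasoning

    ⊞-identityʳ : ∀ x → x ⊞ 𝟘 ≡ x
    ⊞-identityʳ x = sym (≈⇒≡⟦⟧ x _ (begin
      toℕ x              ≡⟨ ℕP.+-identityʳ (toℕ x) ⟨
      toℕ x ℕ.+ 0          ≈⟨ ≈-+ ≈-refl (toℕ⟦⟧≈ 0) ⟨
      toℕ x ℕ.+ toℕ ⟦ 0 ⟧ ∎))
      where open ≈-Reasoning

    ⊞-inverseʳ : ∀ x → x ⊞ ⊖ x ≡ 𝟘
    ⊞-inverseʳ x = ≈⇒⟦⟧≡ (begin
      toℕ x ℕ.+ toℕ ⟦ p ∸ toℕ x ⟧  ≈⟨ ≈-+ ≈-refl (toℕ⟦⟧≈ (p ∸ toℕ x)) ⟩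
      toℕ x ℕ.+ (p ∸ toℕ x)        ≡⟨ ℕP.m+[n∸m]≡n (ℕP.<⇒≤ (FinP.toℕ<n x)) ⟩
      p                          ≡⟨ ℕP.+-identityʳ p ⟨
      0 ℕ.+ 1 ℕ.* p                  ≈⟨ +kp≈ 0 1 ⟩
      0 ∎)
      where open ≈-Reasoning

    ℤ/p : AbelianGroup 0ℓ 0ℓ
    ℤ/p = record
      { Carrier        = Fin p
      ; _≈_            = _≡_
      ; _∙_            = _⊞_
      ; ε              = 𝟘
      ; _⁻¹            = ⊖_
      ; isAbelianGroup = record
        { isGroup = record
          { isMonoid = record
            { isSemigroup = record
              { isMagma = record { isEquivalence = isEquivalence ; ∙-cong = cong₂ _⊞_ }
              ; assoc   = ⊞-assoc
              }
            ; identity = (λ x → trans (⊞-comm 𝟘 x) (⊞-identityʳ x)) , ⊞-identityʳ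
            }
          ; inverse = (λ x → trans (⊞-comm (⊖ x) x) (⊞-inverseʳ x)) , ⊞-inverseʳ
          ; ⁻¹-cong = cong ⊖_
          }
        ; comm = ⊞-comm
        }
      }

    open AbelianGroup ℤ/p public using () renaming (identityˡ to ⊞-identityˡ)

    open Algebra.Properties.AbelianGroup ℤ/p public
      using (⁻¹-involutive; ⁻¹-anti-homo‿-; ⁻¹-∙-comm; xyx⁻¹≈y; //-rightDividesˡ; //-rightDividesʳ; ε⁻¹≈ε)

    ⊞-⊟-cancel : ∀ x y → x ⊞ (y ⊟ x) ≡ y
    ⊞-⊟-cancel x y = trans (⊞-comm x (y ⊟ x)) (//-rightDividesˡ x y)

    ⊟-involutive : ∀ z x → z ⊟ (z ⊟ x) ≡ x
    ⊟-involutive z x = trans (cong (z ⊞_) (⁻¹-anti-homo‿- z x)) (⊞-⊟-cancel z x)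

  module Halving (M : ℕ) where

    p : ℕ
    p = suc (M ℕ.+ M)

    open ZMod p public

    half : Fin p → Fin p
    half x = ⟦ toℕ x ℕ.* suc M ⟧

    half-double : ∀ x → half (x ⊞ x) ≡ x
    half-double x = sym (≈⇒≡⟦⟧ x _ (begin
      toℕ x                             ≈⟨ +kp≈ (toℕ x) (toℕ x) ⟨
      toℕ x ℕ.+ toℕ x ℕ.* p                 ≡⟨ expand (toℕ x) M ⟨
      (toℕ x ℕ.+ toℕ x) ℕ.* suc M           ≈⟨ ≈-* (toℕ⟦⟧≈ (toℕ x ℕ.+ toℕ x)) ≈-refl ⟨
      toℕ ⟦ toℕ x ℕ.+ toℕ x ⟧ ℕ.* suc M ∎))
      where
      open ≈-Reasoning
      expand : ∀ x M → (x ℕ.+ x) ℕ.* suc M ≡ x ℕ.+ x ℕ.* suc (M ℕ.+ M)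
      expand = ℕ-Solver.solve-∀

    double-half : ∀ y → half y ⊞ half y ≡ y
    double-half y = sym (≈⇒≡⟦⟧ y _ (begin
      toℕ y                             ≈⟨ +kp≈ (toℕ y) (toℕ y) ⟨
      toℕ y ℕ.+ toℕ y ℕ.* p                 ≡⟨ expand (toℕ y) M ⟨
      toℕ y ℕ.* suc M ℕ.+ toℕ y ℕ.* suc M     ≈⟨ ≈-+ (toℕ⟦⟧≈ (toℕ y ℕ.* suc M)) (toℕ⟦⟧≈ (toℕ y ℕ.* suc M)) ⟨
      toℕ (half y) ℕ.+ toℕ (half y) ∎))
      where
      open ≈-Reasoning
      expand : ∀ y M → y ℕ.* suc M ℕ.+ y ℕ.* suc M ≡ y ℕ.+ y ℕ.* suc (M ℕ.+ M)
      expand = ℕ-Solver.solve-∀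

    double-injective : ∀ {x y} → x ⊞ x ≡ y ⊞ y → x ≡ y
    double-injective {x} {y} 2x≡2y = trans (sym (half-double x)) (trans (cong half 2x≡2y) (half-double y))

    mid≡half : ∀ x y → mid p x y ≡ half (x ⊞ y)
    mid≡half x y = ≈⇒⟦⟧≡ (begin
      (toℕ x ℕ.+ toℕ y) ℕ.* ((p ℕ.+ 1) / 2)     ≡⟨ cong ((toℕ x ℕ.+ toℕ y) ℕ.*_) (p+1/2≡ M) ⟩
      (toℕ x ℕ.+ toℕ y) ℕ.* suc M             ≈⟨ ≈-* (toℕ⟦⟧≈ (toℕ x ℕ.+ toℕ y)) ≈-refl ⟨
      toℕ ⟦ toℕ x ℕ.+ toℕ y ⟧ ℕ.* suc M ∎)
      where
      open ≈-Reasoning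
      p+1/2≡ : ∀ M → (suc (M ℕ.+ M) ℕ.+ 1) / 2 ≡ suc M
      p+1/2≡ M = trans (cong (_/ 2) (double M)) (m*n/n≡m (suc M) 2)
        where
        double : ∀ M → suc (M ℕ.+ M) ℕ.+ 1 ≡ suc M ℕ.* 2
        double = ℕ-Solver.solve-∀

    mid-comm : ∀ x y → mid p x y ≡ mid p y x
    mid-comm x y = trans (mid≡half x y) (trans (cong half (⊞-comm x y)) (sym (mid≡half y x)))

    mid≡⇔reflect : ∀ x y z → mid p x y ≡ z → y ≡ (z ⊞ z) ⊟ x
    mid≡⇔reflect x y z mid≡z = begin
      y                          ≡⟨ xyx⁻¹≈y x y ⟨
      (x ⊞ y) ⊟ x                ≡⟨ cong (_⊟ x) (double-half (x ⊞ y)) ⟨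
      (h ⊞ h) ⊟ x                ≡⟨ cong (λ w → (w ⊞ w) ⊟ x) (trans (sym (mid≡half x y)) mid≡z) ⟩
      (z ⊞ z) ⊟ x ∎
      where
      open ≡-Reasoning
      h : Fin p
      h = half (x ⊞ y)

    mid-reflect : ∀ x z → mid p x ((z ⊞ z) ⊟ x) ≡ z
    mid-reflect x z = trans (mid≡half x _) (trans (cong half (⊞-⊟-cancel x (z ⊞ z))) (half-double z))

  module BoseIncidence (M : ℕ) where

    open Halving M
    open TripleSystem (BoseSTS p)
    open TripleSystemProperties (BoseSTS p) using (Triple; _∈ᵗ_; W≡ι∈ᵗ)

    infix 7 _≡ᵇ_
    _≡ᵇ_ : ∀ {n} → Fin n → Fin n → Bool
    x ≡ᵇ y = does (x ≟ y)

    vertical : Fin p → Triple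
    vertical x = (x , zero) , (x , suc zero) , (x , suc (suc zero))

    horizontal : Fin 3 → Fin p → Fin p → Triple
    horizontal i x y = (x , i) , (y , i) , (mid p x y , next3 i)

    horizontal-blocks : Fin 3 → Fin p → Fin p → List Triple
    horizontal-blocks i x y = if toℕ x <ᵇ toℕ y then [ horizontal i x y ] else []

    level-blocks : Fin 3 → List Triple
    level-blocks i = concatMap (λ x → concatMap (horizontal-blocks i x) (allFin p)) (allFin p)

    horizontals : List Triple
    horizontals = concatMap level-blocks (allFin 3)

    prev3 : Fin 3 → Fin 3
    prev3 zero             = suc (suc zero)
    prev3 (suc zero)       = zero
    prev3 (suc (suc zero)) = suc zero

    next3-prev3 : ∀ i → next3 (prev3 i) ≡ i
    next3-prev3 zero             = refl
    next3-prev3 (suc zero)       = refl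
    next3-prev3 (suc (suc zero)) = refl

    prev3-next3 : ∀ i → prev3 (next3 i) ≡ i
    prev3-next3 zero             = refl
    prev3-next3 (suc zero)       = refl
    prev3-next3 (suc (suc zero)) = refl

    -- A block is vertical exactly when its first two points lie on different levels.
    weight : (Fin p → ℤ) → (Fin p → Fin p → ℤ) → Triple → ℤ
    weight v F ((x , i) , (y , i′) , _) = if i ≡ᵇ i′ then F x y else v x

    weight-horizontal : ∀ v F i x y → weight v F (horizontal i x y) ≡ F x y
    weight-horizontal v F i x y rewrite dec-true (i ≟ i) refl = refl

    point≡ᵇ : ∀ (z x : Fin p) (j i : Fin 3) → does ((z , j) ≟ₚ (x , i)) ≡ (j ≡ᵇ i) ∧ (z ≡ᵇ x)
    point≡ᵇ z x j i with z ≟ x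
    ... | no _     = sym (∧-zeroʳ (j ≡ᵇ i))
    ... | yes refl = sym (∧-identityʳ (j ≡ᵇ i))

    ι-∈-vertical : ∀ z j x → ι ((z , j) ∈ᵗ vertical x) ≡ ι (z ≡ᵇ x)
    ι-∈-vertical z j x rewrite point≡ᵇ z x j zero | point≡ᵇ z x j (suc zero) | point≡ᵇ z x j (suc (suc zero)) =
      one-level j (z ≡ᵇ x)
      where
      one-level : ∀ j b → ι ((j ≡ᵇ zero ∧ b) ∨ (j ≡ᵇ suc zero ∧ b) ∨ (j ≡ᵇ suc (suc zero) ∧ b)) ≡ ι b
      one-level zero             true  = refl
      one-level zero             false = refl
      one-level (suc zero)       true  = refl
      one-level (suc zero)       false = refl
      one-level (suc (suc zero)) true  = refl
      one-level (suc (suc zero)) false = refl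

    ι-∈-horizontal : ∀ z j i x y → x ≢ y → ι ((z , j) ∈ᵗ horizontal i x y) ≡
      ι (j ≡ᵇ i) * (ι (z ≡ᵇ x) + ι (z ≡ᵇ y)) + ι (j ≡ᵇ next3 i) * ι (z ≡ᵇ mid p x y)
    ι-∈-horizontal z j i x y x≢y
      rewrite point≡ᵇ z x j i | point≡ᵇ z y j i | point≡ᵇ z (mid p x y) j (next3 i) =
      two-levels (j ≡ᵇ i) (j ≡ᵇ next3 i) (z ≡ᵇ x) (z ≡ᵇ y) (z ≡ᵇ mid p x y) (distinct-levels j i) distinct-points
      where
      distinct-levels : ∀ j i → (j ≡ᵇ i ∧ j ≡ᵇ next3 i) ≡ false
      distinct-levels zero             zero             = refl
      distinct-levels zero             (suc zero)       = refl
      distinct-levels zero             (suc (suc zero)) = refl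
      distinct-levels (suc zero)       zero             = refl
      distinct-levels (suc zero)       (suc zero)       = refl
      distinct-levels (suc zero)       (suc (suc zero)) = refl
      distinct-levels (suc (suc zero)) zero             = refl
      distinct-levels (suc (suc zero)) (suc zero)       = refl
      distinct-levels (suc (suc zero)) (suc (suc zero)) = refl
      distinct-points : (z ≡ᵇ x ∧ z ≡ᵇ y) ≡ false
      distinct-points with z ≟ x | z ≟ y
      ... | yes refl | yes refl = contradiction refl x≢y
      ... | yes _    | no _     = refl
      ... | no _     | _        = refl
      two-levels : ∀ s t a b c → (s ∧ t) ≡ false → (a ∧ b) ≡ false →
                   ι ((s ∧ a) ∨ (s ∧ b) ∨ (t ∧ c)) ≡ ι s * (ι a + ι b) + ι t * ι c
      two-levels true  false true  false c     _ _ = refl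
      two-levels true  false false true  c     _ _ = refl
      two-levels true  false false false c     _ _ = refl
      two-levels false true  a     b     true  _ _ = refl
      two-levels false true  a     b     false _ _ = refl
      two-levels false false a     b     c     _ _ = refl

    module _ (v : Fin p → ℤ) (F : Fin p → Fin p → ℤ)
             (F-sym : ∀ x y → F x y ≡ F y x) (F-diag : ∀ x → F x x ≡ + 0) (z : Fin p) (j : Fin 3) where

      incident : Triple → ℤ
      incident t = ι ((z , j) ∈ᵗ t) * weight v F t

      Row Mid : Fin p → Fin p → ℤ
      Row x y = (ι (z ≡ᵇ x) + ι (z ≡ᵇ y)) * F x y
      Mid x y = ι (z ≡ᵇ mid p x y) * F x y

      Σ< : (Fin p → Fin p → ℤ) → ℤ
      Σ< K = Σℤ (λ x → Σℤ (λ y → ι (toℕ x <ᵇ toℕ y) * K x y))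

      Σ-verticals : ΣL incident (map vertical (allFin p)) ≡ v z
      Σ-verticals = begin
        ΣL incident (map vertical (allFin p))    ≡⟨ ΣL-map incident vertical (allFin p) ⟩
        ΣL (incident ∘ vertical) (allFin p)      ≡⟨ ΣL-allFin (incident ∘ vertical) ⟩
        Σℤ (incident ∘ vertical)                 ≡⟨ Σℤ-cong (λ x → cong (_* v x) (ι-∈-vertical z j x)) ⟩
        Σℤ (λ x → ι (z ≡ᵇ x) * v x)              ≡⟨ Σℤ-indicator z v ⟩
        v z ∎
        where open ≡-Reasoning

      Σ-horizontals : ΣL incident horizontals ≡ Σ< Row + Σ< Mid
      Σ-horizontals = begin
        ΣL incident horizontals
          ≡⟨ ΣL-concatMap incident level-blocks (allFin 3) ⟩
        ΣL (ΣL incident ∘ level-blocks) (allFin 3)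
          ≡⟨ ΣL-allFin (ΣL incident ∘ level-blocks) ⟩
        Σℤ (ΣL incident ∘ level-blocks)                                      ≡⟨ Σℤ-cong level ⟩
        Σℤ (λ i → ι (j ≡ᵇ i) * Σ< Row + ι (j ≡ᵇ next3 i) * Σ< Mid)          ≡⟨ levels ⟩
        Σ< Row + Σ< Mid ∎
        where
        open ≡-Reasoning
        Row< Mid< : Fin p → Fin p → ℤ
        Row< x y = ι (toℕ x <ᵇ toℕ y) * Row x y
        Mid< x y = ι (toℕ x <ᵇ toℕ y) * Mid x y
        pointwise : ∀ i x y → ι (toℕ x <ᵇ toℕ y) * incident (horizontal i x y) ≡
                    ι (j ≡ᵇ i) * Row< x y + ι (j ≡ᵇ next3 i) * Mid< x y
        pointwise i x y with toℕ x <ᵇ toℕ y in x<y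
        ... | false = sym (cong₂ _+_ (ℤP.*-zeroʳ (ι (j ≡ᵇ i))) (ℤP.*-zeroʳ (ι (j ≡ᵇ next3 i))))
        ... | true  = trans (ℤP.*-identityˡ _) (trans (cong₂ _*_ (ι-∈-horizontal z j i x y x≢y) (weight-horizontal v F i x y))
                            (distrib (ι (j ≡ᵇ i)) (ι (z ≡ᵇ x) + ι (z ≡ᵇ y)) (ι (j ≡ᵇ next3 i)) (ι (z ≡ᵇ mid p x y)) (F x y)))
          where
          x≢y : x ≢ y
          x≢y x≡y = ℕP.<-irrefl (cong toℕ x≡y) (<ᵇ-true⁻¹ x<y)
          distrib : ∀ s a t c f → (s * a + t * c) * f ≡ s * (+ 1 * (a * f)) + t * (+ 1 * (c * f))
          distrib = solve-∀
        level : ∀ i → ΣL incident (level-blocks i) ≡ ι (j ≡ᵇ i) * Σ< Row + ι (j ≡ᵇ next3 i) * Σ< Mid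
        level i = begin
          ΣL incident (level-blocks i)
            ≡⟨ ΣL-concatMap incident (λ x → concatMap (horizontal-blocks i x) (allFin p)) (allFin p) ⟩
          ΣL (λ x → ΣL incident (concatMap (horizontal-blocks i x) (allFin p))) (allFin p)
            ≡⟨ ΣL-allFin (λ x → ΣL incident (concatMap (horizontal-blocks i x) (allFin p))) ⟩
          Σℤ (λ x → ΣL incident (concatMap (horizontal-blocks i x) (allFin p)))
            ≡⟨ Σℤ-cong (λ x → trans (ΣL-concatMap incident (horizontal-blocks i x) (allFin p))
                                    (ΣL-allFin (λ y → ΣL incident (horizontal-blocks i x y)))) ⟩
          Σℤ (λ x → Σℤ (λ y → ΣL incident (horizontal-blocks i x y)))
            ≡⟨ Σℤ-cong (λ x → Σℤ-cong (λ y → ΣL-if incident (toℕ x <ᵇ toℕ y) (horizontal i x y))) ⟩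
          Σℤ (λ x → Σℤ (λ y → ι (toℕ x <ᵇ toℕ y) * incident (horizontal i x y)))
            ≡⟨ Σℤ-cong (λ x → Σℤ-cong (pointwise i x)) ⟩
          Σℤ (λ x → Σℤ (λ y → ι (j ≡ᵇ i) * Row< x y + ι (j ≡ᵇ next3 i) * Mid< x y))
            ≡⟨ Σℤ-cong (λ x → Σℤ-+ (λ y → ι (j ≡ᵇ i) * Row< x y) (λ y → ι (j ≡ᵇ next3 i) * Mid< x y)) ⟩
          Σℤ (λ x → Σℤ (λ y → ι (j ≡ᵇ i) * Row< x y) + Σℤ (λ y → ι (j ≡ᵇ next3 i) * Mid< x y))
            ≡⟨ Σℤ-+ (λ x → Σℤ (λ y → ι (j ≡ᵇ i) * Row< x y)) (λ x → Σℤ (λ y → ι (j ≡ᵇ next3 i) * Mid< x y)) ⟩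
          Σℤ (λ x → Σℤ (λ y → ι (j ≡ᵇ i) * Row< x y)) + Σℤ (λ x → Σℤ (λ y → ι (j ≡ᵇ next3 i) * Mid< x y))
            ≡⟨ cong₂ _+_ (pull (ι (j ≡ᵇ i)) Row<) (pull (ι (j ≡ᵇ next3 i)) Mid<) ⟩
          ι (j ≡ᵇ i) * Σ< Row + ι (j ≡ᵇ next3 i) * Σ< Mid ∎
          where
          pull : ∀ c K → Σℤ (λ x → Σℤ (λ y → c * K x y)) ≡ c * Σℤ (λ x → Σℤ (K x))
          pull c K = trans (Σℤ-cong (λ x → Σℤ-* c (K x))) (Σℤ-* c (λ x → Σℤ (K x)))
        levels : Σℤ (λ i → ι (j ≡ᵇ i) * Σ< Row + ι (j ≡ᵇ next3 i) * Σ< Mid) ≡ Σ< Row + Σ< Mid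
        levels = trans (Σℤ-+ (λ i → ι (j ≡ᵇ i) * Σ< Row) (λ i → ι (j ≡ᵇ next3 i) * Σ< Mid))
          (cong₂ _+_ (Σℤ-indicator j (λ _ → Σ< Row))
                     (trans (Σℤ-reindex (λ i → ι (j ≡ᵇ i) * Σ< Mid) next3 prev3 next3-prev3 prev3-next3)
                            (Σℤ-indicator j (λ _ → Σ< Mid))))

      ΣΣRow : Σℤ (λ x → Σℤ (Row x)) ≡ + 2 * Σℤ (F z)
      ΣΣRow = begin
        Σℤ (λ x → Σℤ (Row x))
          ≡⟨ Σℤ-cong (λ x → trans (Σℤ-cong (λ y → ℤP.*-distribʳ-+ (F x y) (ι (z ≡ᵇ x)) (ι (z ≡ᵇ y))))
                                  (Σℤ-+ (λ y → ι (z ≡ᵇ x) * F x y) (λ y → ι (z ≡ᵇ y) * F x y))) ⟩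
        Σℤ (λ x → Σℤ (λ y → ι (z ≡ᵇ x) * F x y) + Σℤ (λ y → ι (z ≡ᵇ y) * F x y))
          ≡⟨ Σℤ-+ (λ x → Σℤ (λ y → ι (z ≡ᵇ x) * F x y)) (λ x → Σℤ (λ y → ι (z ≡ᵇ y) * F x y)) ⟩
        Σℤ (λ x → Σℤ (λ y → ι (z ≡ᵇ x) * F x y)) + Σℤ (λ x → Σℤ (λ y → ι (z ≡ᵇ y) * F x y))
          ≡⟨ cong₂ _+_ (trans (Σℤ-cong (λ x → Σℤ-* (ι (z ≡ᵇ x)) (F x))) (Σℤ-indicator z (λ x → Σℤ (F x))))
                       (trans (Σℤ-comm (λ x y → ι (z ≡ᵇ y) * F x y))
                              (trans (Σℤ-cong (λ y → Σℤ-* (ι (z ≡ᵇ y)) (λ x → F x y)))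
                                     (trans (Σℤ-indicator z (λ y → Σℤ (λ x → F x y))) (Σℤ-cong (λ x → F-sym x z))))) ⟩
        Σℤ (F z) + Σℤ (F z)
          ≡⟨ double (Σℤ (F z)) ⟩
        + 2 * Σℤ (F z) ∎
        where
        open ≡-Reasoning
        double : ∀ s → s + s ≡ + 2 * s
        double = solve-∀

      ΣΣMid : Σℤ (λ x → Σℤ (Mid x)) ≡ Σℤ (λ x → F x ((z ⊞ z) ⊟ x))
      ΣΣMid = Σℤ-cong λ x → trans (Σℤ-single ((z ⊞ z) ⊟ x) (Mid x) (off-reflection x))
        (trans (cong (λ b → ι b * F x ((z ⊞ z) ⊟ x)) (dec-true (z ≟ _) (sym (mid-reflect x z))))
               (ℤP.*-identityˡ _))
        where
        off-reflection : ∀ x y → y ≢ (z ⊞ z) ⊟ x → Mid x y ≡ + 0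
        off-reflection x y y≢ = cong (λ b → ι b * F x y) (dec-false (z ≟ mid p x y) (y≢ ∘ mid≡⇔reflect x y z ∘ sym))

      Σ-incidence : + 2 * ΣL incident (boseBlocks p) ≡ + 2 * v z + + 2 * Σℤ (F z) + Σℤ (λ x → F x ((z ⊞ z) ⊟ x))
      Σ-incidence = begin
        + 2 * ΣL incident (boseBlocks p)
          ≡⟨ cong (+ 2 *_) (trans (ΣL-++ incident (map vertical (allFin p)) horizontals)
                                  (cong₂ _+_ Σ-verticals Σ-horizontals)) ⟩
        + 2 * (v z + (Σ< Row + Σ< Mid))
          ≡⟨ distrib (v z) (Σ< Row) (Σ< Mid) ⟩
        + 2 * v z + + 2 * Σ< Row + + 2 * Σ< Mid
          ≡⟨ cong₂ (λ r m → + 2 * v z + r + m) (sym (Σℤ-ordered-pairs Row Row-sym Row-diag))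
                                              (sym (Σℤ-ordered-pairs Mid Mid-sym Mid-diag)) ⟩
        + 2 * v z + Σℤ (λ x → Σℤ (Row x)) + Σℤ (λ x → Σℤ (Mid x))
          ≡⟨ cong₂ (λ r m → + 2 * v z + r + m) ΣΣRow ΣΣMid ⟩
        + 2 * v z + + 2 * Σℤ (F z) + Σℤ (λ x → F x ((z ⊞ z) ⊟ x)) ∎
        where
        open ≡-Reasoning
        distrib : ∀ a b c → + 2 * (a + (b + c)) ≡ + 2 * a + + 2 * b + + 2 * c
        distrib = solve-∀
        Row-sym : ∀ x y → Row x y ≡ Row y x
        Row-sym x y = cong₂ _*_ (ℤP.+-comm (ι (z ≡ᵇ x)) (ι (z ≡ᵇ y))) (F-sym x y)
        Row-diag : ∀ x → Row x x ≡ + 0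
        Row-diag x = trans (cong (_*_ (ι (z ≡ᵇ x) + ι (z ≡ᵇ x))) (F-diag x)) (ℤP.*-zeroʳ (ι (z ≡ᵇ x) + ι (z ≡ᵇ x)))
        Mid-sym : ∀ x y → Mid x y ≡ Mid y x
        Mid-sym x y = cong₂ (λ m f → ι (z ≡ᵇ m) * f) (mid-comm x y) (F-sym x y)
        Mid-diag : ∀ x → Mid x x ≡ + 0
        Mid-diag x = trans (cong (ι (z ≡ᵇ mid p x x) *_) (F-diag x)) (ℤP.*-zeroʳ (ι (z ≡ᵇ mid p x x)))

    weight-values : ∀ v F → (∀ z → AbsOneOrTwo (v z)) → (∀ x y → x ≢ y → AbsOneOrTwo (F x y)) →
                    ∀ k → AbsOneOrTwo (weight v F (block k))
    weight-values v F v-values F-values = All-lookup (All.++⁺ verticals horizontals′)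
      where
      verticals : All (AbsOneOrTwo ∘ weight v F) (map vertical (allFin p))
      verticals = All.map⁺ (All.tabulate (λ {x} _ → v-values x))
      horizontal-value : ∀ i x y → (toℕ x <ᵇ toℕ y) ≡ true → AbsOneOrTwo (weight v F (horizontal i x y))
      horizontal-value i x y x<y = subst AbsOneOrTwo (sym (weight-horizontal v F i x y))
        (F-values x y (λ x≡y → ℕP.<-irrefl (cong toℕ x≡y) (<ᵇ-true⁻¹ x<y)))
      horizontals′ : All (AbsOneOrTwo ∘ weight v F) horizontals
      horizontals′ = All-concatMap (λ i → All-concatMap (λ x → All-concatMap (λ y →
        All-if (toℕ x <ᵇ toℕ y) (horizontal i x y) (horizontal-value i x y)) (allFin p)) (allFin p)) (allFin 3)

    weight-kernel : ∀ v F (F-sym : ∀ x y → F x y ≡ F y x) (F-diag : ∀ x → F x x ≡ + 0) →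
      (∀ z → + 2 * v z + + 2 * Σℤ (F z) + Σℤ (λ x → F x ((z ⊞ z) ⊟ x)) ≡ + 0) →
      InKernelW (λ k → weight v F (block k))
    weight-kernel v F F-sym F-diag balanced (z , j) = ℤP.*-cancelˡ-≡ (+ 2) _ (+ 0) (begin
      + 2 * Σℤ (λ k → W (z , j) k * weight v F (block k))
        ≡⟨ cong (+ 2 *_) (Σℤ-cong (λ k → cong (_* weight v F (block k)) (W≡ι∈ᵗ (z , j) k))) ⟩
      + 2 * Σℤ (λ k → incident v F F-sym F-diag z j (block k))
        ≡⟨ cong (+ 2 *_) (Σℤ-lookup (incident v F F-sym F-diag z j) (boseBlocks p)) ⟩
      + 2 * ΣL (incident v F F-sym F-diag z j) (boseBlocks p)
        ≡⟨ Σ-incidence v F F-sym F-diag z j ⟩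
      + 2 * v z + + 2 * Σℤ (F z) + Σℤ (λ x → F x ((z ⊞ z) ⊟ x))
        ≡⟨ balanced z ⟩
      + 0 ∎)
      where open ≡-Reasoning

  Σᵣ : ℕ → (ℕ → ℤ) → ℤ
  Σᵣ zero    g = + 0
  Σᵣ (suc n) g = g 0 + Σᵣ n (g ∘ suc)

  Σᵣ-cong : ∀ n {f g : ℕ → ℤ} → (∀ i → i < n → f i ≡ g i) → Σᵣ n f ≡ Σᵣ n g
  Σᵣ-cong zero    f≗g = refl
  Σᵣ-cong (suc n) f≗g = cong₂ _+_ (f≗g 0 (s≤s z≤n)) (Σᵣ-cong n (λ i i<n → f≗g (suc i) (s≤s i<n)))

  Σᵣ-+ : ∀ a b (f : ℕ → ℤ) → Σᵣ (a ℕ.+ b) f ≡ Σᵣ a f + Σᵣ b (λ i → f (a ℕ.+ i))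
  Σᵣ-+ zero    b f = sym (ℤP.+-identityˡ _)
  Σᵣ-+ (suc a) b f = trans (cong (_+_ (f 0)) (Σᵣ-+ a b (f ∘ suc))) (sym (ℤP.+-assoc (f 0) _ _))

  Σᵣ-last : ∀ n (f : ℕ → ℤ) → Σᵣ (suc n) f ≡ Σᵣ n f + f n
  Σᵣ-last zero    f = trans (ℤP.+-identityʳ (f 0)) (sym (ℤP.+-identityˡ (f 0)))
  Σᵣ-last (suc n) f = trans (cong (_+_ (f 0)) (Σᵣ-last n (f ∘ suc))) (sym (ℤP.+-assoc (f 0) _ _))

  Σᵣ-reverse : ∀ n (f : ℕ → ℤ) → Σᵣ n (λ i → f (n ∸ i)) ≡ Σᵣ n (f ∘ suc)
  Σᵣ-reverse zero    f = refl
  Σᵣ-reverse (suc n) f = begin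
    f (suc n) + Σᵣ n (λ i → f (n ∸ i))   ≡⟨ cong (_+_ (f (suc n))) (Σᵣ-reverse n f) ⟩
    f (suc n) + Σᵣ n (f ∘ suc)           ≡⟨ ℤP.+-comm (f (suc n)) _ ⟩
    Σᵣ n (f ∘ suc) + f (suc n)           ≡⟨ Σᵣ-last n (f ∘ suc) ⟨
    Σᵣ (suc n) (f ∘ suc) ∎
    where open ≡-Reasoning

  Σℤ≡Σᵣ : ∀ n (g : ℕ → ℤ) → Σℤ {n} (g ∘ toℕ) ≡ Σᵣ n g
  Σℤ≡Σᵣ zero    g = refl
  Σℤ≡Σᵣ (suc n) g = cong (_+_ (g 0)) (Σℤ≡Σᵣ n (g ∘ suc))

  odd : ℕ → Bool
  odd zero    = false
  odd (suc n) = not (odd n)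

  odd-double : ∀ n → odd (n ℕ.+ n) ≡ false
  odd-double zero    = refl
  odd-double (suc n) rewrite ℕP.+-suc n n | odd-double n = refl

  Σᵣ-alternating : ∀ m → Σᵣ m (λ j → - sign (odd j)) ≡ (if odd m then - + 1 else + 0)
  Σᵣ-alternating zero    = refl
  Σᵣ-alternating (suc m) = begin
    Σᵣ (suc m) (λ j → - sign (odd j))                     ≡⟨ Σᵣ-last m (λ j → - sign (odd j)) ⟩
    Σᵣ m (λ j → - sign (odd j)) + - sign (odd m)          ≡⟨ cong (_+ - sign (odd m)) (Σᵣ-alternating m) ⟩
    (if odd m then - + 1 else + 0) + - sign (odd m)       ≡⟨ step (odd m) ⟩
    (if not (odd m) then - + 1 else + 0) ∎
    where
    open ≡-Reasoning
    step : ∀ b → (if b then - + 1 else + 0) + - sign b ≡ (if not b then - + 1 else + 0)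
    step true  = refl
    step false = refl

  module BoseWeights (m : ℕ) where

    M : ℕ
    M = suc (suc (suc m))

    open Halving M
    open BoseIncidence M using (_≡ᵇ_; weight; weight-values; weight-kernel)

    one two : Fin p
    one = ⟦ 1 ⟧
    two = one ⊞ one

    q : Fin p → ℤ
    q x = sign (odd (toℕ x))

    profile : ℕ → ℤ
    profile 0                         = + 0
    profile 1                         = + 2
    profile 2                         = + 0
    profile 3                         = if odd m then - + 1 else - + 2
    profile (suc (suc (suc (suc j)))) = - sign (odd j)

    Σprofile : Σᵣ M (profile ∘ suc) ≡ + 0
    Σprofile = trans (cong (λ s → + 2 + (+ 0 + (profile 3 + s))) (Σᵣ-alternating m)) (cancel (odd m))
      where
      cancel : ∀ b → + 2 + (+ 0 + ((if b then - + 1 else - + 2) + (if b then - + 1 else + 0))) ≡ + 0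
      cancel true  = refl
      cancel false = refl

    h : Fin p → ℤ
    h d = profile (toℕ d ⊓ toℕ (⊖ d))

    h-⊖ : ∀ d → h (⊖ d) ≡ h d
    h-⊖ d = trans (cong (λ e → profile (toℕ (⊖ d) ⊓ toℕ e)) (⁻¹-involutive d))
                  (cong profile (ℕP.⊓-comm (toℕ (⊖ d)) (toℕ d)))

    Σh : Σℤ h ≡ + 0
    Σh = begin
      Σℤ h
        ≡⟨ Σℤ-cong {n = p} {f = h} {g = g ∘ toℕ} (λ d → cong (λ n → profile (toℕ d ⊓ n)) (toℕ⟦⟧ (p ∸ toℕ d))) ⟩
      Σℤ {p} (g ∘ toℕ)                               ≡⟨ Σℤ≡Σᵣ p g ⟩
      + 0 + Σᵣ (M ℕ.+ M) (g ∘ suc)                   ≡⟨ cong (_+_ (+ 0)) (Σᵣ-cong (M ℕ.+ M) g≡G) ⟩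
      + 0 + Σᵣ (M ℕ.+ M) G                           ≡⟨ cong (_+_ (+ 0)) (Σᵣ-+ M M G) ⟩
      + 0 + (Σᵣ M G + Σᵣ M (λ i → G (M ℕ.+ i)))
        ≡⟨ cong (_+_ (+ 0)) (cong₂ _+_ (Σᵣ-cong M (λ i i<M → cong profile (ℕP.m≤n⇒m⊓n≡m (lower i i<M))))
                                       (Σᵣ-cong M (λ i i<M → cong profile (upper i i<M)))) ⟩
      + 0 + (Σᵣ M (profile ∘ suc) + Σᵣ M (λ i → profile (M ∸ i)))
        ≡⟨ cong (λ s → + 0 + (Σᵣ M (profile ∘ suc) + s)) (Σᵣ-reverse M profile) ⟩
      + 0 + (Σᵣ M (profile ∘ suc) + Σᵣ M (profile ∘ suc))
        ≡⟨ cong (λ s → + 0 + (s + s)) Σprofile ⟩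
      + 0 ∎
      where
      open ≡-Reasoning
      g : ℕ → ℤ
      g t = profile (t ⊓ ((p ∸ t) ℕ.% p))
      G : ℕ → ℤ
      G s = profile (suc s ⊓ ((M ℕ.+ M) ∸ s))
      g≡G : ∀ s → s < M ℕ.+ M → g (suc s) ≡ G s
      g≡G s _ = cong (λ n → profile (suc s ⊓ n)) (m<n⇒m%n≡m (s≤s (ℕP.m∸n≤m (M ℕ.+ M) s)))
      lower : ∀ i → i < M → suc i ≤ (M ℕ.+ M) ∸ i
      lower i i<M = ℕP.m+n≤o⇒m≤o∸n (suc i) (ℕP.+-mono-≤ i<M (ℕP.<⇒≤ i<M))
      upper : ∀ i → i < M → suc (M ℕ.+ i) ⊓ ((M ℕ.+ M) ∸ (M ℕ.+ i)) ≡ M ∸ i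
      upper i _ rewrite ℕP.[m+n]∸[m+o]≡n∸o M M i =
        ℕP.m≥n⇒m⊓n≡n (ℕP.≤-trans (ℕP.m∸n≤m M i) (ℕP.≤-trans (ℕP.m≤m+n M i) (ℕP.n≤1+n _)))

    toℕ-⊖two : toℕ (⊖ two) ≡ M ℕ.+ M ∸ 1
    toℕ-⊖two = trans (toℕ⟦⟧ (p ∸ 2)) (m<n⇒m%n≡m (s≤s (ℕP.m∸n≤m (M ℕ.+ M) 1)))

    two≢𝟘 : two ≢ 𝟘
    two≢𝟘 two≡𝟘 = contradiction (cong toℕ two≡𝟘) λ ()

    two≢⊖two : two ≢ ⊖ two
    two≢⊖two two≡⊖two =
      ℕP.m+1+n≢0 m (sym (ℕP.suc-injective (ℕP.suc-injective (trans (cong toℕ two≡⊖two) toℕ-⊖two))))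

    ⊖two≢𝟘 : ⊖ two ≢ 𝟘
    ⊖two≢𝟘 ⊖two≡𝟘 = two≢𝟘 (trans (sym (⁻¹-involutive two)) (trans (cong ⊖_ ⊖two≡𝟘) ε⁻¹≈ε))

    h-two : h two ≡ + 0
    h-two = cong (λ n → profile (2 ⊓ n)) toℕ-⊖two

    h-⊖two : h (⊖ two) ≡ + 0
    h-⊖two = trans (h-⊖ two) h-two

    profile-values : ∀ k → k ≢ 0 → k ≢ 2 → AbsOneOrTwo (profile k)
    profile-values 0 k≢0 _ = contradiction refl k≢0
    profile-values 1 _ _ = inj₂ refl
    profile-values 2 _ k≢2 = contradiction refl k≢2
    profile-values 3 _ _ with odd m
    ... | true  = inj₁ refl
    ... | false = inj₂ refl
    profile-values (suc (suc (suc (suc j)))) _ _ = inj₁ (trans (ℤP.∣-i∣≡∣i∣ (sign (odd j))) (∣sign∣≡1 (odd j)))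

    toℕ≡0⇒≡𝟘 : ∀ {x} → toℕ x ≡ 0 → x ≡ 𝟘
    toℕ≡0⇒≡𝟘 = FinP.toℕ-injective

    toℕ≡2⇒≡two : ∀ {x} → toℕ x ≡ 2 → x ≡ two
    toℕ≡2⇒≡two = FinP.toℕ-injective

    ⊖-swap : ∀ {x y} → ⊖ x ≡ y → x ≡ ⊖ y
    ⊖-swap {x} ⊖x≡y = trans (sym (⁻¹-involutive x)) (cong ⊖_ ⊖x≡y)

    h-values : ∀ d → d ≢ 𝟘 → d ≢ two → d ≢ ⊖ two → AbsOneOrTwo (h d)
    h-values d d≢0 d≢2 d≢-2 with ℕP.⊓-sel (toℕ d) (toℕ (⊖ d))
    ... | inj₁ eq = subst (AbsOneOrTwo ∘ profile) (sym eq)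
                          (profile-values (toℕ d) (d≢0 ∘ toℕ≡0⇒≡𝟘) (d≢2 ∘ toℕ≡2⇒≡two))
    ... | inj₂ eq = subst (AbsOneOrTwo ∘ profile) (sym eq)
                          (profile-values (toℕ (⊖ d)) (d≢0 ∘ ⊖≡𝟘 ∘ toℕ≡0⇒≡𝟘) (d≢-2 ∘ ⊖-swap ∘ toℕ≡2⇒≡two))
      where
      ⊖≡𝟘 : ⊖ d ≡ 𝟘 → d ≡ 𝟘
      ⊖≡𝟘 ⊖d≡𝟘 = trans (⊖-swap ⊖d≡𝟘) ε⁻¹≈ε

    ⊖≡ᵇ⊖ : ∀ a b → (⊖ a ≡ᵇ ⊖ b) ≡ (a ≡ᵇ b)
    ⊖≡ᵇ⊖ a b with a ≟ b | ⊖ a ≟ ⊖ b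
    ... | yes _    | yes _      = refl
    ... | no _     | no _       = refl
    ... | yes refl | no ⊖a≢⊖a   = contradiction refl ⊖a≢⊖a
    ... | no a≢b   | yes ⊖a≡⊖b  = contradiction (trans (⊖-swap ⊖a≡⊖b) (⁻¹-involutive b)) a≢b

    two≡ᵇ⊖ : ∀ d → (two ≡ᵇ ⊖ d) ≡ (⊖ two ≡ᵇ d)
    two≡ᵇ⊖ d = trans (cong (_≡ᵇ ⊖ d) (sym (⁻¹-involutive two))) (⊖≡ᵇ⊖ (⊖ two) d)

    F-at : Fin p → Fin p → Fin p → ℤ
    F-at x y d = ι (two ≡ᵇ d) * q x + ι (⊖ two ≡ᵇ d) * q y + h d

    F : Fin p → Fin p → ℤ
    F x y = F-at x y (y ⊟ x)

    v : Fin p → ℤ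
    v z = - (q z + q (z ⊟ one) + q (z ⊟ two))

    F-sym : ∀ x y → F x y ≡ F y x
    F-sym x y = begin
      ι (two ≡ᵇ d) * q x + ι (⊖ two ≡ᵇ d) * q y + h d
        ≡⟨ swap (ι (two ≡ᵇ d) * q x) (ι (⊖ two ≡ᵇ d) * q y) (h d) ⟩
      ι (⊖ two ≡ᵇ d) * q y + ι (two ≡ᵇ d) * q x + h d
        ≡⟨ cong₂ _+_ (cong₂ _+_ (cong (λ b → ι b * q y) (sym (two≡ᵇ⊖ d)))
                                (cong (λ b → ι b * q x) (sym (⊖≡ᵇ⊖ two d))))
                     (sym (h-⊖ d)) ⟩
      ι (two ≡ᵇ ⊖ d) * q y + ι (⊖ two ≡ᵇ ⊖ d) * q x + h (⊖ d)
        ≡⟨ cong (λ e → ι (two ≡ᵇ e) * q y + ι (⊖ two ≡ᵇ e) * q x + h e) (⁻¹-anti-homo‿- y x) ⟩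
      F y x ∎
      where
      open ≡-Reasoning
      d : Fin p
      d = y ⊟ x
      swap : ∀ a b c → a + b + c ≡ b + a + c
      swap = solve-∀

    F-diag : ∀ x → F x x ≡ + 0
    F-diag x = begin
      F x x                                                       ≡⟨ cong (F-at x x) (⊞-inverseʳ x) ⟩
      ι (two ≡ᵇ 𝟘) * q x + ι (⊖ two ≡ᵇ 𝟘) * q x + h 𝟘
        ≡⟨ cong₂ (λ a b → ι a * q x + ι b * q x + h 𝟘) (dec-false (two ≟ 𝟘) two≢𝟘) (dec-false (⊖ two ≟ 𝟘) ⊖two≢𝟘) ⟩
      + 0 ∎
      where open ≡-Reasoning

    Σ-row : ∀ z → Σℤ (F z) ≡ q z + q (z ⊟ two) + Σℤ h
    Σ-row z = begin
      Σℤ (F z)                                   ≡⟨ Σℤ-reindex (F z) (z ⊞_) (_⊟ z) (⊞-⊟-cancel z) (xyx⁻¹≈y z) ⟨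
      Σℤ (λ e → F z (z ⊞ e))
        ≡⟨ Σℤ-cong (λ e → cong (λ d → ι (two ≡ᵇ d) * q z + ι (⊖ two ≡ᵇ d) * q (z ⊞ e) + h d)
                                                                        (xyx⁻¹≈y z e)) ⟩
      Σℤ (λ e → ι (two ≡ᵇ e) * q z + ι (⊖ two ≡ᵇ e) * q (z ⊞ e) + h e)
                                                 ≡⟨ Σℤ-+₃ (λ e → ι (two ≡ᵇ e) * q z) (λ e → ι (⊖ two ≡ᵇ e) * q (z ⊞ e)) h ⟩
      Σℤ (λ e → ι (two ≡ᵇ e) * q z) + Σℤ (λ e → ι (⊖ two ≡ᵇ e) * q (z ⊞ e)) + Σℤ h
                                                 ≡⟨ cong₂ (λ a b → a + b + Σℤ h) (Σℤ-indicator two (λ _ → q z)) (Σℤ-indicator (⊖ two) (q ∘ (z ⊞_))) ⟩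
      q z + q (z ⊟ two) + Σℤ h ∎
      where open ≡-Reasoning

    Σ-reflected : ∀ z → Σℤ (λ x → F x ((z ⊞ z) ⊟ x)) ≡ q (z ⊟ one) + q (z ⊟ one) + Σℤ h
    Σ-reflected z = begin
      Σℤ (λ x → F x ((z ⊞ z) ⊟ x))
        ≡⟨ Σℤ-reindex (λ x → F x ((z ⊞ z) ⊟ x)) (z ⊟_) (z ⊟_) (⊟-involutive z) (⊟-involutive z) ⟨
      Σℤ (λ e → F (z ⊟ e) ((z ⊞ z) ⊟ (z ⊟ e)))
        ≡⟨ Σℤ-cong (λ e → trans (cong (F (z ⊟ e)) (reflect e))
                                (cong (λ d → ι (two ≡ᵇ d) * q (z ⊟ e) + ι (⊖ two ≡ᵇ d) * q (z ⊞ e) + h d) (difference e))) ⟩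
      Σℤ (λ e → ι (two ≡ᵇ e ⊞ e) * q (z ⊟ e) + ι (⊖ two ≡ᵇ e ⊞ e) * q (z ⊞ e) + h (e ⊞ e))
        ≡⟨ Σℤ-+₃ (λ e → ι (two ≡ᵇ e ⊞ e) * q (z ⊟ e)) (λ e → ι (⊖ two ≡ᵇ e ⊞ e) * q (z ⊞ e)) (λ e → h (e ⊞ e)) ⟩
      Σℤ (λ e → ι (two ≡ᵇ e ⊞ e) * q (z ⊟ e)) + Σℤ (λ e → ι (⊖ two ≡ᵇ e ⊞ e) * q (z ⊞ e)) + Σℤ (λ e → h (e ⊞ e))
        ≡⟨ cong₂ _+_ (cong₂ _+_ (double-δ one two refl (q ∘ (z ⊟_))) (double-δ (⊖ one) (⊖ two) (⁻¹-∙-comm one one) (q ∘ (z ⊞_))))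
                     (Σℤ-reindex h (λ e → e ⊞ e) half double-half half-double) ⟩
      q (z ⊟ one) + q (z ⊟ one) + Σℤ h ∎
      where
      open ≡-Reasoning
      reflect : ∀ e → (z ⊞ z) ⊟ (z ⊟ e) ≡ z ⊞ e
      reflect e = begin
        (z ⊞ z) ⊞ ⊖ (z ⊟ e)  ≡⟨ cong ((z ⊞ z) ⊞_) (⁻¹-anti-homo‿- z e) ⟩
        (z ⊞ z) ⊞ (e ⊟ z)    ≡⟨ ⊞-assoc z z (e ⊟ z) ⟩
        z ⊞ (z ⊞ (e ⊟ z))    ≡⟨ cong (z ⊞_) (⊞-⊟-cancel z e) ⟩
        z ⊞ e ∎
      difference : ∀ e → (z ⊞ e) ⊟ (z ⊟ e) ≡ e ⊞ e
      difference e = begin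
        (z ⊞ e) ⊞ ⊖ (z ⊟ e)  ≡⟨ cong₂ _⊞_ (⊞-comm z e) (⁻¹-anti-homo‿- z e) ⟩
        (e ⊞ z) ⊞ (e ⊟ z)    ≡⟨ ⊞-assoc e z (e ⊟ z) ⟩
        e ⊞ (z ⊞ (e ⊟ z))    ≡⟨ cong (e ⊞_) (⊞-⊟-cancel z e) ⟩
        e ⊞ e ∎
      double-δ : ∀ a b → a ⊞ a ≡ b → (f : Fin p → ℤ) → Σℤ (λ e → ι (b ≡ᵇ e ⊞ e) * f e) ≡ f a
      double-δ a b 2a≡b f = trans (Σℤ-single a _ off-a)
        (trans (cong (λ c → ι c * f a) (dec-true (b ≟ a ⊞ a) (sym 2a≡b))) (ℤP.*-identityˡ (f a)))
        where
        off-a : ∀ e → e ≢ a → ι (b ≡ᵇ e ⊞ e) * f e ≡ + 0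
        off-a e e≢a = cong (λ c → ι c * f e) (dec-false (b ≟ e ⊞ e) (e≢a ∘ double-injective ∘ sym ∘ trans 2a≡b))

    kernel : ∀ z → + 2 * v z + + 2 * Σℤ (F z) + Σℤ (λ x → F x ((z ⊞ z) ⊟ x)) ≡ + 0
    kernel z = begin
      + 2 * v z + + 2 * Σℤ (F z) + Σℤ (λ x → F x ((z ⊞ z) ⊟ x))
        ≡⟨ cong₂ (λ r s → + 2 * v z + + 2 * r + s) (Σ-row z) (Σ-reflected z) ⟩
      + 2 * v z + + 2 * (q z + q (z ⊟ two) + Σℤ h) + (q (z ⊟ one) + q (z ⊟ one) + Σℤ h)
        ≡⟨ cong (λ s → + 2 * v z + + 2 * (q z + q (z ⊟ two) + s) + (q (z ⊟ one) + q (z ⊟ one) + s)) Σh ⟩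
      + 2 * v z + + 2 * (q z + q (z ⊟ two) + + 0) + (q (z ⊟ one) + q (z ⊟ one) + + 0)
        ≡⟨ cancel (q z) (q (z ⊟ one)) (q (z ⊟ two)) ⟩
      + 0 ∎
      where
      open ≡-Reasoning
      cancel : ∀ a b c → + 2 * - (a + b + c) + + 2 * (a + c + + 0) + (b + b + + 0) ≡ + 0
      cancel = solve-∀

    q-values : ∀ x → AbsOneOrTwo (q x)
    q-values x = inj₁ (∣sign∣≡1 (odd (toℕ x)))

    F-at-two : ∀ {x y} → y ⊟ x ≡ two → F x y ≡ q x
    F-at-two {x} {y} d≡2 = begin
      F x y                                  ≡⟨ cong (F-at x y) d≡2 ⟩
      ι (two ≡ᵇ two) * q x + ι (⊖ two ≡ᵇ two) * q y + h two
        ≡⟨ cong₂ (λ a b → ι a * q x + ι b * q y + h two) (dec-true (two ≟ two) refl) (dec-false (⊖ two ≟ two) (two≢⊖two ∘ sym)) ⟩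
      + 1 * q x + + 0 * q y + h two          ≡⟨ cong (_+_ (+ 1 * q x + + 0 * q y)) h-two ⟩
      + 1 * q x + + 0 * q y + + 0            ≡⟨ simplify (q x) (q y) ⟩
      q x ∎
      where
      open ≡-Reasoning
      simplify : ∀ a b → + 1 * a + + 0 * b + + 0 ≡ a
      simplify = solve-∀

    F-at-⊖two : ∀ {x y} → y ⊟ x ≡ ⊖ two → F x y ≡ q y
    F-at-⊖two {x} {y} d≡-2 = begin
      F x y                                  ≡⟨ cong (F-at x y) d≡-2 ⟩
      ι (two ≡ᵇ ⊖ two) * q x + ι (⊖ two ≡ᵇ ⊖ two) * q y + h (⊖ two)
        ≡⟨ cong₂ (λ a b → ι a * q x + ι b * q y + h (⊖ two)) (dec-false (two ≟ ⊖ two) two≢⊖two) (dec-true (⊖ two ≟ ⊖ two) refl) ⟩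
      + 0 * q x + + 1 * q y + h (⊖ two)      ≡⟨ cong (_+_ (+ 0 * q x + + 1 * q y)) h-⊖two ⟩
      + 0 * q x + + 1 * q y + + 0            ≡⟨ simplify (q x) (q y) ⟩
      q y ∎
      where
      open ≡-Reasoning
      simplify : ∀ a b → + 0 * a + + 1 * b + + 0 ≡ b
      simplify = solve-∀

    F-elsewhere : ∀ {x y} → y ⊟ x ≢ two → y ⊟ x ≢ ⊖ two → F x y ≡ h (y ⊟ x)
    F-elsewhere {x} {y} d≢2 d≢-2 = begin
      F x y
        ≡⟨ cong₂ (λ a b → ι a * q x + ι b * q y + h (y ⊟ x))
                 (dec-false (two ≟ y ⊟ x) (d≢2 ∘ sym)) (dec-false (⊖ two ≟ y ⊟ x) (d≢-2 ∘ sym)) ⟩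
      + 0 * q x + + 0 * q y + h (y ⊟ x)      ≡⟨ simplify (q x) (q y) (h (y ⊟ x)) ⟩
      h (y ⊟ x) ∎
      where
      open ≡-Reasoning
      simplify : ∀ a b c → + 0 * a + + 0 * b + c ≡ c
      simplify = solve-∀

    F-values : ∀ x y → x ≢ y → AbsOneOrTwo (F x y)
    F-values x y x≢y with y ⊟ x ≟ two | y ⊟ x ≟ ⊖ two
    ... | yes d≡2  | _         = subst AbsOneOrTwo (sym (F-at-two {x} {y} d≡2)) (q-values x)
    ... | no _     | yes d≡-2  = subst AbsOneOrTwo (sym (F-at-⊖two {x} {y} d≡-2)) (q-values y)
    ... | no d≢2   | no d≢-2   = subst AbsOneOrTwo (sym (F-elsewhere {x} {y} d≢2 d≢-2)) (h-values (y ⊟ x) d≢0 d≢2 d≢-2)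
      where
      d≢0 : y ⊟ x ≢ 𝟘
      d≢0 d≡0 = x≢y (sym (trans (sym (//-rightDividesˡ x y)) (trans (cong (_⊞ x) d≡0) (⊞-identityˡ x))))

    sign-not : ∀ b → sign (not b) ≡ - sign b
    sign-not true  = refl
    sign-not false = refl

    toℕ-⊟one : ∀ x s → toℕ x ≡ suc s → toℕ (x ⊟ one) ≡ s
    toℕ-⊟one x s x≡ = begin
      toℕ (x ⊟ one)                       ≡⟨ toℕ⟦⟧ (toℕ x ℕ.+ toℕ (⊖ one)) ⟩
      (toℕ x ℕ.+ toℕ (⊖ one)) ℕ.% p
        ≡⟨ cong₂ (λ a b → (a ℕ.+ b) ℕ.% p) x≡ (trans (toℕ⟦⟧ (M ℕ.+ M)) (m<n⇒m%n≡m ℕP.≤-refl)) ⟩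
      (suc s ℕ.+ (M ℕ.+ M)) ℕ.% p         ≡⟨ cong (ℕ._% p) (sym (ℕP.+-suc s (M ℕ.+ M))) ⟩
      (s ℕ.+ p) ℕ.% p                     ≡⟨ [m+n]%n≡m%n s p ⟩
      s ℕ.% p                             ≡⟨ m<n⇒m%n≡m (ℕP.<-trans (ℕP.n<1+n s) (subst (ℕ._< p) x≡ (FinP.toℕ<n x))) ⟩
      s ∎
      where open ≡-Reasoning

    q-step : ∀ x → toℕ x ≢ 0 → q (x ⊟ one) ≡ - q x
    q-step x x≢0 = step (toℕ x) refl x≢0
      where
      step : ∀ n → toℕ x ≡ n → n ≢ 0 → q (x ⊟ one) ≡ - q x
      step zero    _  n≢0 = contradiction refl n≢0
      step (suc s) x≡ _   = begin
        q (x ⊟ one)              ≡⟨ cong (sign ∘ odd) (toℕ-⊟one x s x≡) ⟩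
        sign (odd s)             ≡⟨ ℤP.neg-involutive (sign (odd s)) ⟨
        - - sign (odd s)         ≡⟨ cong -_ (sign-not (odd s)) ⟨
        - sign (not (odd s))     ≡⟨ cong (λ n → - sign (odd n)) x≡ ⟨
        - q x ∎
        where open ≡-Reasoning

    v-values : ∀ z → AbsOneOrTwo (v z)
    v-values z with toℕ z ℕ.≟ 0
    ... | no z≢0 = subst AbsOneOrTwo (sym (trans (cong (λ a → - (q z + a + q (z ⊟ two))) (q-step z z≢0))
                                                (cancel₁ (q z) (q (z ⊟ two)))))
                         (AbsOneOrTwo-neg {q (z ⊟ two)} (q-values (z ⊟ two)))
      where
      cancel₁ : ∀ a c → - (a + - a + c) ≡ - c
      cancel₁ = solve-∀
    ... | yes z≡0 = subst AbsOneOrTwo (sym (trans (cong (λ c → - (q z + q (z ⊟ one) + c)) z⊟two)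
                                                 (cancel₂ (q z) (q (z ⊟ one)))))
                          (AbsOneOrTwo-neg {q z} (q-values z))
      where
      cancel₂ : ∀ a b → - (a + b + - b) ≡ - a
      cancel₂ = solve-∀
      z⊟one≢𝟘 : toℕ (z ⊟ one) ≢ 0
      z⊟one≢𝟘 e = contradiction (trans (sym (cong toℕ z≡one)) z≡0) λ ()
        where
        z≡one : z ≡ one
        z≡one = trans (sym (//-rightDividesˡ one z)) (trans (cong (_⊞ one) (toℕ≡0⇒≡𝟘 e)) (⊞-identityˡ one))
      z⊟two : q (z ⊟ two) ≡ - q (z ⊟ one)
      z⊟two = trans (cong q (trans (cong (z ⊞_) (sym (⁻¹-∙-comm one one))) (sym (⊞-assoc z (⊖ one) (⊖ one)))))
                    (q-step (z ⊟ one) z⊟one≢𝟘)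

    flow : TripleSystem.HasFlow (BoseSTS p) 3 ⊎ TripleSystem.HasFlow (BoseSTS p) 2
    flow = TripleSystemProperties.flow₃⊎flow₂ (BoseSTS p) zero (λ k → weight v F (TripleSystem.block (BoseSTS p) k))
             (weight-values v F v-values F-values) (weight-kernel v F F-sym F-diag kernel)


  module _ (q : ℕ) .{{_ : NonZero q}} (tab : List ℤ) where
    open TripleSystem (BoseSTS q)
    open TripleSystemProperties (BoseSTS q) using (flow₃⊎flow₂)

    tabulated : Fin nb → ℤ
    tabulated k = at (+ 0) tab (toℕ k)

    table-flow : Fin nb →
      {True (FinP.all? (λ k → AbsOneOrTwo? (tabulated k)))} →
      {True (FinP.all? (λ a → FinP.all? (λ j → Σℤ (λ k → W (a , j) k * tabulated k) ℤ.≟ + 0)))} →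
      HasFlow 3 ⊎ HasFlow 2
    table-flow k {values} {kernel} = flow₃⊎flow₂ k tabulated (toWitness values) (λ (a , j) → toWitness kernel a j)

  module SmallTables where
    open import Agda.Builtin.FromNat
    open import Agda.Builtin.FromNeg
    open IntegerLiterals

    bose₃ : List ℤ
    bose₃ = 1 ∷ 1 ∷ 1 ∷ 1 ∷ -1 ∷ -1 ∷ 1 ∷ -1 ∷ -1 ∷ 1 ∷ -1 ∷ -1 ∷ []

    bose₅ : List ℤ
    bose₅ = -1 ∷ -1 ∷ -1 ∷ -1 ∷ 1 ∷ -1 ∷ 2 ∷ 1 ∷ -1 ∷ -2 ∷ 1 ∷ 1 ∷ -2 ∷ 1 ∷ 1 ∷ -2 ∷ 2 ∷ 1 ∷
            1 ∷ -1 ∷ 2 ∷ -1 ∷ -1 ∷ 1 ∷ -1 ∷ 2 ∷ 1 ∷ -1 ∷ 1 ∷ -2 ∷ 1 ∷ -1 ∷ 1 ∷ -2 ∷ 1 ∷ []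

  odd⇒suc-double : ∀ n → ¬ (2 ∣ n) → ∃ λ M → n ≡ suc (M ℕ.+ M)
  odd⇒suc-double 0 ¬2∣0 = contradiction (ℕ∣._∣0 2) ¬2∣0
  odd⇒suc-double 1 _ = 0 , refl
  odd⇒suc-double (suc (suc n)) ¬2∣n+2 with odd⇒suc-double n (¬2∣n+2 ∘ ℕ∣.∣m∣n⇒∣m+n ℕ∣.∣-refl)
  ... | M , refl = suc M , cong (ℕ.suc ∘ ℕ.suc) (sym (ℕP.+-suc M M))

  bose : (p : ℕ) → (pr : Prime p) → ¬ (2 ∣ p) →
         TripleSystem.HasFlow (BoseSTS p {{prime⇒nonZero pr}}) 3
         ⊎ TripleSystem.HasFlow (BoseSTS p {{prime⇒nonZero pr}}) 2
  bose p pr ¬2∣p with odd⇒suc-double p ¬2∣p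
  ... | 0 , refl = contradiction pr ¬prime[1]
  ... | 1 , refl = table-flow 3 SmallTables.bose₃ zero
  ... | 2 , refl = table-flow 5 SmallTables.bose₅ zero
  ... | suc (suc (suc m)) , refl = BoseWeights.flow m


proposition9 : ((r : ℕ) → 4 ≤ r → TripleSystem.m2≡ (HammingSTS r) 3)
    × ((p : ℕ) → (pr : Prime p) → ¬ (2 ∣ p) →
         TripleSystem.HasFlow (BoseSTS p {{prime⇒nonZero pr}}) 3
         ⊎ TripleSystem.HasFlow (BoseSTS p {{prime⇒nonZero pr}}) 2)
proposition9 = Hamming.hamming , Bose.bose
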